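{- Let $m\ge1$. On the vector space $\mathbb K[\mathrm{Dyck}^m]$ spanned by all $m$-Dyck paths of positive size, the binary operations $*_0,\dots,*_m$ satisfy, for all $x,y,z\in\mathbb K[\mathrm{Dyck}^m]$: (1) $x*_i(y*_j z)=(x*_i y)*_j z$ for all $0\le i<j\le m$; (2) $x*_i(y*_0z+\dots+y*_iz)=(x*_iy+\dots+x*_my)*_iz$ for all $0\le i\le m$.
   Context: Fix a field $\mathbb K$ and $m\ge 1$. For $n\ge1$ an $m$-Dyck path of size $n$ is a lattice path from $(0,0)$ to $(2nm,0)$ with $n$ up steps $(m,m)$ and $nm$ down steps $(1,-1)$ never going below the $x$-axis; $\mathrm{Dyck}^m_n$ is the set of them. Up steps are ranked $1,\dots,n$ from left to right; a down step is at level $k$ if the last up step before it has rank $k$. For $P$ of size $n$, $L(P)$ is the number of down steps at level $n$ (the last $L(P)$ steps of $P$), listed left to right as $d^P_1,\dots,d^P_{L(P)}$. Concatenation: for $P$ of size $n_1$, $Q$ of size $n_2$ and $0\le j\le L(P)$, $P\times_jQ$ is the path of size $n_1+n_2$ obtained by deleting the last $j$ down steps of $P$, appending a translate of $Q$, and then appending $j$ down steps. $P$ is prime if it is not $Q\times_0R$ with $Q,R$ of smaller positive sizes; every path factors uniquely as $Q_1\times_0\cdots\times_0Q_r$ with all $Q_i$ prime. Standard coloring: $\alpha_P(d)$, for a down step $d$ of $P$, is the rank of the first up step of $P$ met by the horizontal half-line starting at the midpoint of $d$ and going to the left. A weak composition of $N$ of length $r+1$ is $\underline\lambda=(\lambda_0,\dots,\lambda_r)$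 of nonnegative integers with sum $N$. For $P$ of size $n_1$ and $0\le i\le m$, $\Lambda^i_r(P)$ is the set of weak compositions $\underline\lambda$ of $L(P)$ of length $r+1$ such that in the word $\alpha_P(d^P_{L(P)-\lambda_r+1})\cdots\alpha_P(d^P_{L(P)})$ (the last $\lambda_r$ colors of top-level down steps) every integer appears at most $i$ times and some integer in $\{1,\dots,n_1\}$ appears exactly $i$ times (for $i=0$ this means $\lambda_r=0$). For $Q=Q_1\times_0\cdots\times_0Q_r$ with $Q_j$ prime and $\underline\lambda$ a weak composition of $L(P)$ of length $r+1$, $P*_{\underline\lambda}Q:=((\cdots((P\times_{\lambda_1+\dots+\lambda_r}Q_1)\times_{\lambda_2+\dots+\lambda_r}Q_2)\cdots)\times_{\lambda_r}Q_r)$, and $P*_iQ:=\sum_{\underline\lambda\in\Lambda^i_r(P)}P*_{\underline\lambda}Q$, extended bilinearly to $\mathbb K[\mathrm{Dyck}^m]$. -}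

module Defs where

open import Level using (Level; _⊔_) renaming (suc to lsuc)
open import Data.Bool using (Bool; true; false; not; _∧_; if_then_else_)
open import Data.Nat using (ℕ; zero; suc; _+_; _∸_; _<ᵇ_; _≤ᵇ_; _≡ᵇ_; _≤_)
open import Data.List using (List; []; _∷_; _++_; map; concatMap; reverse; length;
  drop; take; takeWhile; filter; replicate; upTo; foldr)
open import Data.Nat.ListAction using (sum)
open import Data.Bool.ListAction using (all; any)
open import Data.List.Properties using (≡-dec)
import Data.Bool.Properties as BoolP
open import Data.Product using (Σ; _×_; _,_; proj₁; proj₂)
open import Data.List.Relation.Unary.All using (All)
open import Relation.Nullary using (¬_; does)
open import Relation.Binary.PropositionalEquality using (_≡_)
open import Algebra.Bundles using (CommutativeRing)

record Field (c ℓ : Level) : Set (lsuc (c ⊔ ℓ)) where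
  field
    commutativeRing : CommutativeRing c ℓ
  open CommutativeRing commutativeRing public
  field
    0≉1 : ¬ (0# ≈ 1#)
    inverse : ∀ x → ¬ (x ≈ 0#) → Σ Carrier (λ y → (x * y) ≈ 1#)

-- m-Dyck paths as words: true = up step (m,m), false = down step (1,-1).

Word : Set
Word = List Bool

valid : ℕ → ℕ → Word → Bool
valid m h []            = h ≡ᵇ 0
valid m h (true ∷ w)    = valid m (h + m) w
valid m zero (false ∷ w)    = false
valid m (suc h) (false ∷ w) = valid m h w

size : Word → ℕ
size []           = 0
size (true ∷ w)   = suc (size w)
size (false ∷ w)  = size w

IsDyck : ℕ → Word → Set
IsDyck m w = (valid m 0 w ≡ true) × (1 ≤ size w)

-- L(P): number of down steps at the top level (= trailing down steps)
L : Word → ℕ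
L w = length (takeWhile (λ b → b BoolP.≟ false) (reverse w))

lastN : {A : Set} → ℕ → List A → List A
lastN k xs = drop (length xs ∸ k) xs

_×[_]_ : Word → ℕ → Word → Word
P ×[ j ] Q = take (length P ∸ j) P ++ Q ++ replicate j false

-- prime factorisation Q₁ ×₀ ⋯ ×₀ Q_r: cut the path at its returns to the axis
factorsAux : ℕ → ℕ → Word → Word → List Word
factorsAux m h acc [] = []
factorsAux m h acc (s ∷ w) with (if s then h + m else h ∸ 1)
... | zero  = reverse (s ∷ acc) ∷ factorsAux m 0 [] w
... | suc h' = factorsAux m (suc h') (s ∷ acc) w

factors : ℕ → Word → List Word
factors m w = factorsAux m 0 [] w

-- We scan the word, remembering the up steps met so
-- far (most recent first) as pairs (rank , starting height).  The half-line
-- at height h - 1/2 (h = starting height of the down step) going left meets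
-- first the most recent up step from height y to y + m with y < h ≤ y + m.
findUp : ℕ → ℕ → List (ℕ × ℕ) → ℕ
findUp m h [] = 0
findUp m h ((r , y) ∷ ups) =
  if (y <ᵇ h) ∧ (h ≤ᵇ y + m) then r else findUp m h ups

colorsAux : ℕ → ℕ → ℕ → List (ℕ × ℕ) → Word → List ℕ
colorsAux m h r ups []          = []
colorsAux m h r ups (true ∷ w)  = colorsAux m (h + m) (suc r) ((suc r , h) ∷ ups) w
colorsAux m h r ups (false ∷ w) = findUp m h ups ∷ colorsAux m (h ∸ 1) r ups w

downColors : ℕ → Word → List ℕ
downColors m w = colorsAux m 0 0 [] w

weakComps : ℕ → ℕ → List (List ℕ)
weakComps zero    N = if N ≡ᵇ 0 then [] ∷ [] else []
weakComps (suc l) N = concatMap (λ a → map (a ∷_) (weakComps l (N ∸ a))) (upTo (suc N))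
  -- a ranges over 0 … N; only compositions with sum N survive below
  -- (weakComps l (N ∸ a) with a ≤ N has sum exactly N ∸ a)

lastOr0 : List ℕ → ℕ
lastOr0 []           = 0
lastOr0 (x ∷ [])     = x
lastOr0 (x ∷ y ∷ xs) = lastOr0 (y ∷ xs)

count : ℕ → List ℕ → ℕ
count a []       = 0
count a (x ∷ xs) = if a ≡ᵇ x then suc (count a xs) else count a xs

inΛ : ℕ → ℕ → Word → List ℕ → Bool
inΛ m i P lam =
  let c = lastN (lastOr0 lam) (downColors m P) in
  all (λ a → count a c ≤ᵇ i) c ∧ any (λ a → count a c ≡ᵇ i) (map suc (upTo (size P)))

Λ : ℕ → ℕ → ℕ → Word → List (List ℕ)
Λ m i r P = filter (λ lam → inΛ m i P lam BoolP.≟ true) (weakComps (suc r) (L P))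

starGo : Word → List Word → List ℕ → Word
starGo P (Q ∷ Qs) (l ∷ ls) = starGo (P ×[ sum (l ∷ ls) ] Q) Qs ls
starGo P _ _ = P

starλ : ℕ → Word → Word → List ℕ → Word
starλ m P Q []          = P
starλ m P Q (l₀ ∷ lams) = starGo P (factors m Q) lams

-- P *_i Q as the list of its terms (all with coefficient 1)
starPaths : ℕ → ℕ → Word → Word → List Word
starPaths m i P Q = map (starλ m P Q) (Λ m i (length (factors m Q)) P)

-- The vector space 𝕂[Dyck^m]: finite formal linear combinations, compared
-- coefficientwise.

module FreeSpace {c ℓ} (K : Field c ℓ) (m : ℕ) where
  open Field K using (Carrier; _≈_; 0#) renaming (_+_ to _+K_; _*_ to _*K_)

  Vec𝕂 : Set c
  Vec𝕂 = List (Carrier × Word)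

  InDyck : Vec𝕂 → Set c
  InDyck x = All (λ e → IsDyck m (proj₂ e)) x

  coeff : Vec𝕂 → Word → Carrier
  coeff [] w = 0#
  coeff ((a , P) ∷ x) w = if does (≡-dec BoolP._≟_ P w) then a +K coeff x w else coeff x w

  _≋_ : Vec𝕂 → Vec𝕂 → Set ℓ
  x ≋ y = ∀ w → coeff x w ≈ coeff y w

  _⊕_ : Vec𝕂 → Vec𝕂 → Vec𝕂
  x ⊕ y = x ++ y

  star : ℕ → Vec𝕂 → Vec𝕂 → Vec𝕂
  star i x y = concatMap (λ aP → concatMap (λ bQ →
      map (λ R → (proj₁ aP *K proj₁ bQ , R)) (starPaths m i (proj₂ aP) (proj₂ bQ))) y) x

  starRange : ℕ → ℕ → Vec𝕂 → Vec𝕂 → Vec𝕂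
  starRange lo hi x y = foldr (λ k acc → star (lo + k) x y ⊕ acc) [] (upTo (suc (hi ∸ lo)))

module Submission where

-- Both identities are compared coefficientwise, so by bilinearity it suffices to show that for
-- m-Dyck paths P, Q, R every word W occurs equally often among the terms of the two nested products.
-- Write P as P' followed by its top run of a = L(P) down steps, and Q = Q₁ ×₀ ⋯ ×₀ Q_s with top
-- run b = L(Q).  Then P *_λ Q is P' followed by the runs λ₀, …, λ_s interleaved with Q₁, …, Q_s,
-- so every term on either side is P' followed by an interleaving, governed by a weak composition,
-- of the prime factors of Q and R.  Whether λ ∈ Λ^i only depends on F(λ_s), where F k is the
-- largest multiplicity of a colour among the last k top-level steps of P; F is nondecreasing and
-- bounded by m.  For T = P *_x Q with last part c the same profile of T is F k for k ≤ c and
-- max (F c, H (k ∸ c)) beyond, H being the profile of Q.  On the other side, Q *_λ' R has the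
-- prime factors of Q except that the last one absorbs the factors of R up to the last nonzero part
-- of λ', and grafting the remaining parts onto λ' matches the terms of the two sides bijectively:
-- for i < j the conditions agree term by term, and for the second identity they agree once the
-- conditions "= k" are summed over k ≤ i on the left and over i ≤ k ≤ m on the right.

open import Level using (Level)
open import Data.Nat
open import Data.Nat.Properties
open import Data.Bool using (Bool; true; false; if_then_else_; _∧_; T)
import Data.Bool.Properties as BoolP
open BoolP using (∧-conicalˡ; ∧-conicalʳ; ⇔→≡)
open import Function.Bundles using (mk⇔)
open import Data.Unit using (tt)
open import Data.Empty using (⊥-elim)
open import Data.Product using (Σ; ∃; _×_; _,_; proj₁; proj₂)
open import Data.Sum using (_⊎_; inj₁; inj₂)
open import Data.List
  using (List; []; _∷_; _++_; map; concatMap; concat; length; take; drop; takeWhile; upTo; applyUpTo; replicate;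
         reverse; filter; foldr; _∷ʳ_)
open import Data.List.Properties
  using (length-replicate; ++-assoc; ++-identityʳ; reverse-++; length-++; map-++; drop-all; drop-drop; take++drop≡id;
         unfold-reverse; reverse-involutive; ∷ʳ-injective; length-drop; ≡-dec)
open import Data.Nat.ListAction using (sum)
open import Data.Nat.ListAction.Properties using (sum-++)
open import Data.Bool.ListAction using (all; any)
open import Data.List.Relation.Unary.All as All using (All; []; _∷_)
import Data.List.Relation.Unary.All.Properties as AllP
open AllP using (concat⁺; map⁺; applyUpTo⁺₁)
open import Data.List.Relation.Unary.Any using (Any; here; there)
import Data.List.Relation.Unary.Any.Properties as AnyP
open import Data.List.Membership.Propositional using (_∈_)
open import Relation.Nullary using (¬_; yes; no; does; contradiction)
open import Relation.Binary.PropositionalEquality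
open import Function using (_∘_; id)
open import Defs

open import Algebra.Properties.CommutativeSemigroup +-commutativeSemigroup
  using () renaming (interchange to +-interchange)

-- Boolean tests and finite sums

T⇒≡true : ∀ {b} → T b → b ≡ true
T⇒≡true {true} _ = refl

¬T⇒≡false : ∀ {b} → ¬ T b → b ≡ false
¬T⇒≡false {true} n = ⊥-elim (n tt)
¬T⇒≡false {false} _ = refl

≡⇒≡ᵇ≡true : ∀ {x y} → x ≡ y → (x ≡ᵇ y) ≡ true
≡⇒≡ᵇ≡true {x} {y} e = T⇒≡true (≡⇒≡ᵇ x y e)

≢⇒≡ᵇ≡false : ∀ {x y} → x ≢ y → (x ≡ᵇ y) ≡ false
≢⇒≡ᵇ≡false {x} {y} ne = ¬T⇒≡false (λ t → ne (≡ᵇ⇒≡ x y t))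

≤⇒≤ᵇ≡true : ∀ {x y} → x ≤ y → (x ≤ᵇ y) ≡ true
≤⇒≤ᵇ≡true {x} {y} e = T⇒≡true (≤⇒≤ᵇ e)

≰⇒≤ᵇ≡false : ∀ {x y} → ¬ x ≤ y → (x ≤ᵇ y) ≡ false
≰⇒≤ᵇ≡false {x} {y} ne = ¬T⇒≡false (λ t → ne (≤ᵇ⇒≤ x y t))

≡ᵇ≡true⇒≡ : ∀ {x y} → (x ≡ᵇ y) ≡ true → x ≡ y
≡ᵇ≡true⇒≡ {x} {y} e = ≡ᵇ⇒≡ x y (subst T (sym e) tt)

≤ᵇ≡true⇒≤ : ∀ {x y} → (x ≤ᵇ y) ≡ true → x ≤ y
≤ᵇ≡true⇒≤ {x} {y} e = ≤ᵇ⇒≤ x y (subst T (sym e) tt)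

<⇒<ᵇ≡true : ∀ {x y} → x < y → (x <ᵇ y) ≡ true
<⇒<ᵇ≡true p = T⇒≡true (<⇒<ᵇ p)

≮⇒<ᵇ≡false : ∀ {x y} → ¬ x < y → (x <ᵇ y) ≡ false
≮⇒<ᵇ≡false {x} {y} p = ¬T⇒≡false (λ t → p (<ᵇ⇒< x y t))

when : Bool → ℕ → ℕ
when true n = n
when false n = 0

when-0 : ∀ b → when b 0 ≡ 0
when-0 true = refl
when-0 false = refl

when-+ : ∀ b x y → when b (x + y) ≡ when b x + when b y
when-+ true x y = refl
when-+ false x y = refl

sumBy : {A : Set} → List A → (A → ℕ) → ℕ
sumBy [] f = 0
sumBy (x ∷ xs) f = f x + sumBy xs f

module _ {A : Set} where
  sumBy-++ : ∀ (xs ys : List A) f → sumBy (xs ++ ys) f ≡ sumBy xs f + sumBy ys f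
  sumBy-++ [] ys f = refl
  sumBy-++ (x ∷ xs) ys f = trans (cong (f x +_) (sumBy-++ xs ys f)) (sym (+-assoc (f x) _ _))

  sumBy-cong : ∀ (xs : List A) {f g : A → ℕ} → (∀ x → f x ≡ g x) → sumBy xs f ≡ sumBy xs g
  sumBy-cong [] e = refl
  sumBy-cong (x ∷ xs) e = cong₂ _+_ (e x) (sumBy-cong xs e)

  sumBy-congᴬ : ∀ {P : A → Set} {xs : List A} {f g : A → ℕ} → All P xs → (∀ x → P x → f x ≡ g x) →
    sumBy xs f ≡ sumBy xs g
  sumBy-congᴬ [] e = refl
  sumBy-congᴬ (px ∷ a) e = cong₂ _+_ (e _ px) (sumBy-congᴬ a e)

  sumBy-+ : ∀ (xs : List A) f g → sumBy xs (λ x → f x + g x) ≡ sumBy xs f + sumBy xs g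
  sumBy-+ [] f g = refl
  sumBy-+ (x ∷ xs) f g rewrite sumBy-+ xs f g = +-interchange (f x) (g x) (sumBy xs f) (sumBy xs g)

  sumBy-when : ∀ (xs : List A) b f → sumBy xs (λ x → when b (f x)) ≡ when b (sumBy xs f)
  sumBy-when xs true f = refl
  sumBy-when [] false f = refl
  sumBy-when (x ∷ xs) false f = sumBy-when xs false f

  sumBy-0 : ∀ (xs : List A) → sumBy xs (λ _ → 0) ≡ 0
  sumBy-0 [] = refl
  sumBy-0 (x ∷ xs) = sumBy-0 xs

  sumBy-0ᴬ : ∀ {P : A → Set} {xs : List A} {f : A → ℕ} → All P xs → (∀ x → P x → f x ≡ 0) →
    sumBy xs f ≡ 0
  sumBy-0ᴬ {xs = xs} a e = trans (sumBy-congᴬ a e) (sumBy-0 xs)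

sumBy-swap : ∀ {A B : Set} (xs : List A) (ys : List B) (f : A → B → ℕ) →
  sumBy xs (λ x → sumBy ys (f x)) ≡ sumBy ys (λ y → sumBy xs (λ x → f x y))
sumBy-swap [] ys f = sym (sumBy-0 ys)
sumBy-swap (x ∷ xs) ys f rewrite sumBy-swap xs ys f = sym (sumBy-+ ys (f x) (λ y → sumBy xs (λ x → f x y)))

sumBy-map : ∀ {A B : Set} (g : A → B) (xs : List A) f → sumBy (map g xs) f ≡ sumBy xs (f ∘ g)
sumBy-map g [] f = refl
sumBy-map g (x ∷ xs) f = cong (f (g x) +_) (sumBy-map g xs f)

sumBy-concatMap : ∀ {A B : Set} (g : A → List B) (xs : List A) f →
  sumBy (concatMap g xs) f ≡ sumBy xs (λ x → sumBy (g x) f)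
sumBy-concatMap g [] f = refl
sumBy-concatMap g (x ∷ xs) f =
  trans (sumBy-++ (g x) (concatMap g xs) f) (cong (sumBy (g x) f +_) (sumBy-concatMap g xs f))

sumUpTo : ℕ → (ℕ → ℕ) → ℕ
sumUpTo zero h = h 0
sumUpTo (suc N) h = h 0 + sumUpTo N (λ a → h (suc a))

sumBelow : ℕ → (ℕ → ℕ) → ℕ
sumBelow zero h = 0
sumBelow (suc N) h = h 0 + sumBelow N (λ a → h (suc a))

sumBy-applyUpTo : ∀ (f : ℕ → ℕ) N h → sumBy (applyUpTo f (suc N)) h ≡ sumUpTo N (λ a → h (f a))
sumBy-applyUpTo f zero h = +-identityʳ _
sumBy-applyUpTo f (suc N) h = cong (h (f 0) +_) (sumBy-applyUpTo (f ∘ suc) N h)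

sumUpTo-cong : ∀ N {h h' : ℕ → ℕ} → (∀ a → a ≤ N → h a ≡ h' a) → sumUpTo N h ≡ sumUpTo N h'
sumUpTo-cong zero e = e 0 z≤n
sumUpTo-cong (suc N) e = cong₂ _+_ (e 0 z≤n) (sumUpTo-cong N (λ a a≤ → e (suc a) (s≤s a≤)))

sumBelow-cong : ∀ N {h h' : ℕ → ℕ} → (∀ a → a < N → h a ≡ h' a) → sumBelow N h ≡ sumBelow N h'
sumBelow-cong zero e = refl
sumBelow-cong (suc N) e = cong₂ _+_ (e 0 (s≤s z≤n)) (sumBelow-cong N (λ a a< → e (suc a) (s≤s a<)))

sumUpTo-split : ∀ b c h → sumUpTo (b + c) h ≡ sumBelow b h + sumUpTo c (λ e → h (b + e))
sumUpTo-split zero c h = refl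
sumUpTo-split (suc b) c h rewrite sumUpTo-split b c (λ a → h (suc a)) = sym (+-assoc (h 0) _ _)

sumUpTo-last : ∀ b h → sumUpTo b h ≡ sumBelow b h + h b
sumUpTo-last b h = begin
  sumUpTo b h                              ≡⟨ cong (λ z → sumUpTo z h) (sym (+-identityʳ b)) ⟩
  sumUpTo (b + 0) h                        ≡⟨ sumUpTo-split b 0 h ⟩
  sumBelow b h + h (b + 0)                 ≡⟨ cong (λ z → sumBelow b h + h z) (+-identityʳ b) ⟩
  sumBelow b h + h b                       ∎
  where open ≡-Reasoning

sumUpTo-when : ∀ N b h → sumUpTo N (λ a → when b (h a)) ≡ when b (sumUpTo N h)
sumUpTo-when N true h = refl
sumUpTo-when zero false h = refl
sumUpTo-when (suc N) false h = sumUpTo-when N false (λ a → h (suc a))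

sumBelow-when : ∀ N b h → sumBelow N (λ a → when b (h a)) ≡ when b (sumBelow N h)
sumBelow-when N true h = refl
sumBelow-when zero false h = refl
sumBelow-when (suc N) false h = sumBelow-when N false (λ a → h (suc a))

sumUpTo-0 : ∀ N {h : ℕ → ℕ} → (∀ a → a ≤ N → h a ≡ 0) → sumUpTo N h ≡ 0
sumUpTo-0 zero e = e 0 z≤n
sumUpTo-0 (suc N) e rewrite e 0 z≤n = sumUpTo-0 N (λ a a≤ → e (suc a) (s≤s a≤))

sumBelow-0 : ∀ N {h : ℕ → ℕ} → (∀ a → a < N → h a ≡ 0) → sumBelow N h ≡ 0
sumBelow-0 zero e = refl
sumBelow-0 (suc N) e rewrite e 0 (s≤s z≤n) = sumBelow-0 N (λ a a≤ → e (suc a) (s≤s a≤))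

sumUpTo-when-≡ : ∀ i h X → sumUpTo i (λ k → when (h ≡ᵇ k) X) ≡ when (h ≤ᵇ i) X
sumUpTo-when-≡ zero zero X = refl
sumUpTo-when-≡ zero (suc h) X = refl
sumUpTo-when-≡ (suc i) zero X = trans (cong (X +_) (sumUpTo-0 i (λ _ _ → refl))) (+-identityʳ X)
sumUpTo-when-≡ (suc i) (suc h) X with h ≤? i
... | yes le = trans (sumUpTo-when-≡ i h X)
  (trans (cong (λ z → when z X) (≤⇒≤ᵇ≡true le)) (cong (λ z → when z X) (sym (≤⇒≤ᵇ≡true (s≤s le)))))
... | no nle = trans (sumUpTo-when-≡ i h X)
  (trans (cong (λ z → when z X) (≰⇒≤ᵇ≡false nle)) (cong (λ z → when z X) (sym (≰⇒≤ᵇ≡false (nle ∘ ≤-pred)))))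

sumUpTo-when-≡+ : ∀ n i f X → sumUpTo n (λ k → when (f ≡ᵇ i + k) X) ≡ when ((i ≤ᵇ f) ∧ (f ≤ᵇ i + n)) X
sumUpTo-when-≡+ zero i f X rewrite +-identityʳ i with f ≟ i
... | yes refl rewrite ≡⇒≡ᵇ≡true {f} refl | ≤⇒≤ᵇ≡true (≤-refl {f}) = refl
... | no ne rewrite ≢⇒≡ᵇ≡false ne with i ≤? f
...   | no nle rewrite ≰⇒≤ᵇ≡false nle = refl
...   | yes le rewrite ≤⇒≤ᵇ≡true le | ≰⇒≤ᵇ≡false {f} {i} (λ fi → ne (≤-antisym fi le)) = refl
sumUpTo-when-≡+ (suc n) i f X rewrite +-identityʳ i = begin
  when (f ≡ᵇ i) X + sumUpTo n (λ k → when (f ≡ᵇ i + suc k) X) ≡⟨ cong (when (f ≡ᵇ i) X +_)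
    (sumUpTo-cong n (λ k _ → cong (λ z → when (f ≡ᵇ z) X) (+-suc i k))) ⟩
  when (f ≡ᵇ i) X + sumUpTo n (λ k → when (f ≡ᵇ suc i + k) X) ≡⟨ cong (when (f ≡ᵇ i) X +_)
    (sumUpTo-when-≡+ n (suc i) f X) ⟩
  when (f ≡ᵇ i) X + when ((suc i ≤ᵇ f) ∧ (f ≤ᵇ suc i + n)) X ≡⟨ fin' ⟩
  when ((i ≤ᵇ f) ∧ (f ≤ᵇ i + suc n)) X ∎
  where
  open ≡-Reasoning
  fin' : when (f ≡ᵇ i) X + when ((suc i ≤ᵇ f) ∧ (f ≤ᵇ suc i + n)) X ≡ when ((i ≤ᵇ f) ∧ (f ≤ᵇ i + suc n)) X
  fin' rewrite +-suc i n with f ≟ i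
  ... | yes refl rewrite ≡⇒≡ᵇ≡true {f} refl | ≰⇒≤ᵇ≡false (<-irrefl {f} refl) | ≤⇒≤ᵇ≡true
    (≤-refl {f}) | ≤⇒≤ᵇ≡true {f} {suc (f + n)} (≤-trans (m≤m+n f n) (n≤1+n _)) = +-identityʳ X
  ... | no ne rewrite ≢⇒≡ᵇ≡false ne with i <? f
  ...   | yes lt rewrite ≤⇒≤ᵇ≡true lt | ≤⇒≤ᵇ≡true (<⇒≤ lt) = refl
  ...   | no nlt rewrite ≰⇒≤ᵇ≡false nlt | ≰⇒≤ᵇ≡false {i} {f} (λ le → nlt (≤∧≢⇒< le (ne ∘ sym))) = refl

sumBy-upTo-when-≡ : ∀ i h X → sumBy (upTo (suc i)) (λ k → when (h ≡ᵇ k) X) ≡ when (h ≤ᵇ i) X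
sumBy-upTo-when-≡ i h X = trans (sumBy-applyUpTo id i _) (sumUpTo-when-≡ i h X)

sumBy-upTo-when-≡+ : ∀ n i f X → f ≤ i + n → sumBy (upTo (suc n)) (λ k → when (f ≡ᵇ i + k) X) ≡ when (i ≤ᵇ f) X
sumBy-upTo-when-≡+ n i f X f≤i+n = trans (sumBy-applyUpTo id n _) (trans (sumUpTo-when-≡+ n i f X)
  (cong (λ z → when z X) (trans (cong ((i ≤ᵇ f) ∧_) (≤⇒≤ᵇ≡true f≤i+n)) (BoolP.∧-identityʳ _))))

-- Maximal multiplicities

maxCountOn : List ℕ → List ℕ → ℕ
maxCountOn c [] = 0
maxCountOn c (x ∷ xs) = count x c ⊔ maxCountOn c xs

maxMult : List ℕ → ℕ
maxMult c = maxCountOn c c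

maxCountOn-lub : ∀ c xs {i} → All (λ a → count a c ≤ i) xs → maxCountOn c xs ≤ i
maxCountOn-lub c [] _ = z≤n
maxCountOn-lub c (x ∷ xs) (p ∷ ps) = ⊔-lub p (maxCountOn-lub c xs ps)

count≤maxCountOn : ∀ c xs {a} → a ∈ xs → count a c ≤ maxCountOn c xs
count≤maxCountOn c (x ∷ xs) (here refl) = m≤m⊔n _ _
count≤maxCountOn c (x ∷ xs) (there p) = ≤-trans (count≤maxCountOn c xs p) (m≤n⊔m _ _)

maxCountOn-attained : ∀ c x xs → ∃ λ a → a ∈ (x ∷ xs) × count a c ≡ maxCountOn c (x ∷ xs)
maxCountOn-attained c x [] = x , here refl , sym (⊔-identityʳ _)
maxCountOn-attained c x (y ∷ xs) with maxCountOn-attained c y xs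
... | a , mem , e with ≤-total (count x c) (maxCountOn c (y ∷ xs))
...   | inj₁ le = a , there mem , trans e (sym (m≤n⇒m⊔n≡n le))
...   | inj₂ ge = x , here refl , sym (m≥n⇒m⊔n≡m ge)

count-pos⇒∈ : ∀ a c → 0 < count a c → a ∈ c
count-pos⇒∈ a (x ∷ c) p with a ≟ x
... | yes refl = here refl
... | no ne rewrite ≢⇒≡ᵇ≡false ne = there (count-pos⇒∈ a c p)

count≤maxMult : ∀ a c → count a c ≤ maxMult c
count≤maxMult a c with count a c ≟ 0
... | yes z = subst (_≤ maxMult c) (sym z) z≤n
... | no nz = count≤maxCountOn c c (count-pos⇒∈ a c (n≢0⇒n>0 nz))

count-++ : ∀ a xs ys → count a (xs ++ ys) ≡ count a xs + count a ys
count-++ a [] ys = refl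
count-++ a (x ∷ xs) ys with a ≡ᵇ x
... | true = cong suc (count-++ a xs ys)
... | false = count-++ a xs ys

count-∉ : ∀ a ys → All (λ y → y ≢ a) ys → count a ys ≡ 0
count-∉ a [] _ = refl
count-∉ a (y ∷ ys) (p ∷ ps) rewrite ≢⇒≡ᵇ≡false {a} {y} (p ∘ sym) = count-∉ a ys ps

all⇒All : ∀ (p : ℕ → Bool) xs → all p xs ≡ true → All (λ a → p a ≡ true) xs
all⇒All p [] _ = []
all⇒All p (x ∷ xs) e with p x in ex
... | true = ex ∷ all⇒All p xs e

All⇒all : ∀ (p : ℕ → Bool) xs → All (λ a → p a ≡ true) xs → all p xs ≡ true
All⇒all p [] _ = refl
All⇒all p (x ∷ xs) (e ∷ es) rewrite e = All⇒all p xs es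

any⇒Any : ∀ (p : ℕ → Bool) xs → any p xs ≡ true → ∃ λ a → a ∈ xs × p a ≡ true
any⇒Any p (x ∷ xs) e with p x in ex
... | true = x , here refl , ex
... | false with any⇒Any p xs e
...   | a , m , pa = a , there m , pa

Any⇒any : ∀ (p : ℕ → Bool) xs a → a ∈ xs → p a ≡ true → any p xs ≡ true
Any⇒any p (x ∷ xs) a (here refl) pa rewrite pa = refl
Any⇒any p (x ∷ xs) a (there m) pa with p x
... | true = refl
... | false = Any⇒any p xs a m pa

∈-map-suc-upTo : ∀ N a → 1 ≤ a × a ≤ N → a ∈ map suc (upTo N)
∈-map-suc-upTo N (suc a) (_ , le) = AnyP.map⁺ (AnyP.applyUpTo⁺ id {i = a} refl le)

Λ-test : ℕ → ℕ → List ℕ → Bool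
Λ-test i N c = all (λ a → count a c ≤ᵇ i) c ∧ any (λ a → count a c ≡ᵇ i) (map suc (upTo N))

Λ-test⇒maxMult : ∀ i N c → Λ-test i N c ≡ true → maxMult c ≡ i
Λ-test⇒maxMult i N c t with any⇒Any _ (map suc (upTo N)) (∧-conicalʳ _ _ t)
... | a , _ , pa = ≤-antisym
  (maxCountOn-lub c c (All.map ≤ᵇ≡true⇒≤ (all⇒All _ c (∧-conicalˡ _ _ t))))
  (subst (_≤ maxMult c) (≡ᵇ≡true⇒≡ pa) (count≤maxMult a c))

maxMult-witness : ∀ N c → 1 ≤ N → All (λ a → 1 ≤ a × a ≤ N) c →
  ∃ λ a → a ∈ map suc (upTo N) × count a c ≡ maxMult c
maxMult-witness N [] N≥1 _ = 1 , ∈-map-suc-upTo N 1 (≤-refl , N≥1) , refl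
maxMult-witness N (x ∷ xs) _ rng with maxCountOn-attained (x ∷ xs) x xs
... | a , a∈ , ca = a , ∈-map-suc-upTo N a (All.lookup rng a∈) , ca

maxMult⇒Λ-test : ∀ i N c → 1 ≤ N → All (λ a → 1 ≤ a × a ≤ N) c → maxMult c ≡ i → Λ-test i N c ≡ true
maxMult⇒Λ-test i N c N≥1 rng e
  rewrite All⇒all (λ a → count a c ≤ᵇ i) c
            (All.tabulate λ a∈ → ≤⇒≤ᵇ≡true (≤-trans (count≤maxCountOn c c a∈) (≤-reflexive e)))
  with maxMult-witness N c N≥1 rng
... | a , a∈ , ca = Any⇒any _ _ a a∈ (≡⇒≡ᵇ≡true (trans ca e))

-- Since every colour lies in [1, N], the membership test of Λ^i_r only asks for the maximal
-- multiplicity of a colour to be i.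
Λ-test≡maxMult : ∀ i N c → 1 ≤ N → All (λ a → 1 ≤ a × a ≤ N) c → Λ-test i N c ≡ (maxMult c ≡ᵇ i)
Λ-test≡maxMult i N c N≥1 rng = ⇔→≡ (mk⇔
  (λ t → ≡⇒≡ᵇ≡true (Λ-test⇒maxMult i N c t))
  (λ e → maxMult⇒Λ-test i N c N≥1 rng (≡ᵇ≡true⇒≡ e)))

maxCountOn-congᴬ : ∀ c c' xs → All (λ a → count a c ≡ count a c') xs → maxCountOn c xs ≡ maxCountOn c' xs
maxCountOn-congᴬ c c' [] _ = refl
maxCountOn-congᴬ c c' (x ∷ xs) (e ∷ es) = cong₂ _⊔_ e (maxCountOn-congᴬ c c' xs es)

maxCountOn-++ : ∀ c xs ys → maxCountOn c (xs ++ ys) ≡ maxCountOn c xs ⊔ maxCountOn c ys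
maxCountOn-++ c [] ys = refl
maxCountOn-++ c (x ∷ xs) ys rewrite maxCountOn-++ c xs ys = sym (⊔-assoc (count x c) _ _)

maxMult-suffix : ∀ xs ys → maxMult ys ≤ maxMult (xs ++ ys)
maxMult-suffix xs ys = maxCountOn-lub ys ys (All.tabulate λ {a} _ → begin
  count a ys              ≤⟨ m≤n+m (count a ys) (count a xs) ⟩
  count a xs + count a ys ≡⟨ count-++ a xs ys ⟨
  count a (xs ++ ys)      ≤⟨ count≤maxMult a (xs ++ ys) ⟩
  maxMult (xs ++ ys)      ∎)
  where open ≤-Reasoning

count-shift : ∀ r a xs → count (r + a) (map (r +_) xs) ≡ count a xs
count-shift r a [] = refl
count-shift r a (x ∷ xs) with a ≟ x
... | yes refl rewrite ≡⇒≡ᵇ≡true {r + a} refl | ≡⇒≡ᵇ≡true {a} refl = cong suc (count-shift r a xs)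
... | no ne rewrite ≢⇒≡ᵇ≡false {r + a} {r + x} (ne ∘ +-cancelˡ-≡ r a x) | ≢⇒≡ᵇ≡false ne = count-shift r a xs

maxCountOn-shift : ∀ r c xs → maxCountOn (map (r +_) c) (map (r +_) xs) ≡ maxCountOn c xs
maxCountOn-shift r c [] = refl
maxCountOn-shift r c (x ∷ xs) = cong₂ _⊔_ (count-shift r x c) (maxCountOn-shift r c xs)

maxMult-shift : ∀ r xs → maxMult (map (r +_) xs) ≡ maxMult xs
maxMult-shift r xs = maxCountOn-shift r xs xs

maxMult-++-separated : ∀ r xs ys → All (r <_) xs → All (_≤ r) ys → maxMult (xs ++ ys) ≡ maxMult xs ⊔ maxMult ys
maxMult-++-separated r xs ys px py = trans (maxCountOn-++ (xs ++ ys) xs ys)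
  (cong₂ _⊔_ (maxCountOn-congᴬ (xs ++ ys) xs xs (All.map onlyLeft px))
             (maxCountOn-congᴬ (xs ++ ys) ys ys (All.map onlyRight py)))
  where
  onlyLeft : ∀ {a} → r < a → count a (xs ++ ys) ≡ count a xs
  onlyLeft {a} r<a = trans (count-++ a xs ys) (trans
    (cong (count a xs +_) (count-∉ a ys (All.map (λ y≤r y≡a → <⇒≱ r<a (subst (_≤ r) y≡a y≤r)) py)))
    (+-identityʳ _))
  onlyRight : ∀ {a} → a ≤ r → count a (xs ++ ys) ≡ count a ys
  onlyRight {a} a≤r = trans (count-++ a xs ys)
    (cong (_+ count a ys) (count-∉ a xs (All.map (λ r<x x≡a → <⇒≱ r<x (subst (_≤ r) (sym x≡a) a≤r)) px)))

-- Weak compositions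

IsWeakComp : ℕ → ℕ → List ℕ → Set
IsWeakComp n N v = length v ≡ n × sum v ≡ N

weakComps-sound : ∀ n N → All (IsWeakComp n N) (weakComps n N)
weakComps-sound zero zero = (refl , refl) ∷ []
weakComps-sound zero (suc N) = []
weakComps-sound (suc n) N = concat⁺ (map⁺ (applyUpTo⁺₁ id (suc N) λ {a} a<1+N →
  map⁺ (All.map (λ { (l , s) → cong suc l , trans (cong (a +_) s) (m+[n∸m]≡n (≤-pred a<1+N)) })
                (weakComps-sound n (N ∸ a)))))

sumBy-weakComps-suc : ∀ n N f →
  sumBy (weakComps (suc n) N) f ≡ sumUpTo N (λ a → sumBy (weakComps n (N ∸ a)) (λ v → f (a ∷ v)))
sumBy-weakComps-suc n N f =
  trans (sumBy-concatMap (λ a → map (a ∷_) (weakComps n (N ∸ a))) (upTo (suc N)) f)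
    (trans (sumBy-applyUpTo id N _) (sumUpTo-cong N (λ a _ → sumBy-map (a ∷_) (weakComps n (N ∸ a)) f)))

sumBy-weakComps-0-pos : ∀ k g → 0 < k → sumBy (weakComps 0 k) g ≡ 0
sumBy-weakComps-0-pos (suc k) g _ = refl

sumBy-weakComps-1 : ∀ N f → sumBy (weakComps 1 N) f ≡ f (N ∷ [])
sumBy-weakComps-1 N f = begin
  sumBy (weakComps 1 N) f ≡⟨ sumBy-weakComps-suc 0 N f ⟩
  sumUpTo N h             ≡⟨ sumUpTo-last N h ⟩
  sumBelow N h + h N      ≡⟨ cong₂ _+_ (sumBelow-0 N λ a a<N → sumBy-weakComps-0-pos (N ∸ a) _ (m<n⇒0<n∸m a<N))
                                       (cong (λ z → sumBy (weakComps 0 z) (λ v → f (N ∷ v))) (n∸n≡0 N)) ⟩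
  f (N ∷ []) + 0          ≡⟨ +-identityʳ _ ⟩
  f (N ∷ [])              ∎
  where
  open ≡-Reasoning
  h = λ a → sumBy (weakComps 0 (N ∸ a)) (λ v → f (a ∷ v))

sumBy-weakComps-of-0 : ∀ n f → sumBy (weakComps n 0) f ≡ f (replicate n 0)
sumBy-weakComps-of-0 zero f = +-identityʳ _
sumBy-weakComps-of-0 (suc n) f = trans (sumBy-weakComps-suc n 0 f) (sumBy-weakComps-of-0 n (λ v → f (0 ∷ v)))

lastOr0-∷ : ∀ a v {k} → length v ≡ suc k → lastOr0 (a ∷ v) ≡ lastOr0 v
lastOr0-∷ a (y ∷ v) _ = refl

lastOr0-++ : ∀ xs ys {k} → length ys ≡ suc k → lastOr0 (xs ++ ys) ≡ lastOr0 ys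
lastOr0-++ [] ys l = refl
lastOr0-++ (x ∷ xs) ys {k} l = trans (lastOr0-∷ x (xs ++ ys) length≡) (lastOr0-++ xs ys l)
  where
  length≡ : length (xs ++ ys) ≡ suc (length xs + k)
  length≡ = trans (length-++ xs) (trans (cong (length xs +_) l) (+-suc _ _))

lastOr0-∷ʳ : ∀ (ys : List ℕ) z → lastOr0 (ys ++ z ∷ []) ≡ z
lastOr0-∷ʳ ys z = lastOr0-++ ys (z ∷ []) refl

lastOr0≤sum : ∀ v → lastOr0 v ≤ sum v
lastOr0≤sum [] = z≤n
lastOr0≤sum (x ∷ []) = ≤-reflexive (sym (+-identityʳ x))
lastOr0≤sum (x ∷ y ∷ v) = ≤-trans (lastOr0≤sum (y ∷ v)) (m≤n+m _ x)

lastOr0-zeros : ∀ n → lastOr0 (replicate n 0) ≡ 0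
lastOr0-zeros zero = refl
lastOr0-zeros (suc zero) = refl
lastOr0-zeros (suc (suc n)) = lastOr0-zeros (suc n)

sum-zeros : ∀ n → sum (replicate n 0) ≡ 0
sum-zeros zero = refl
sum-zeros (suc n) = sum-zeros n

take-exact-++ : ∀ {A : Set} n (xs ys : List A) → length xs ≡ n → take n (xs ++ ys) ≡ xs
take-exact-++ zero [] ys _ = refl
take-exact-++ (suc n) (x ∷ xs) ys l = cong (x ∷_) (take-exact-++ n xs ys (suc-injective l))

drop-exact-++ : ∀ {A : Set} n (xs ys : List A) → length xs ≡ n → drop n (xs ++ ys) ≡ ys
drop-exact-++ zero [] ys _ = refl
drop-exact-++ (suc n) (x ∷ xs) ys l = drop-exact-++ n xs ys (suc-injective l)

length-take-suc : ∀ s (x : List ℕ) → length x ≡ suc s → length (take s x) ≡ s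
length-take-suc zero x l = refl
length-take-suc (suc s) (y ∷ x) l = cong suc (length-take-suc s x (suc-injective l))

-- Cutting a composition after its first s parts: the cut part is x without its last entry, and
-- that last entry is the total of the remaining composition ℓ.
sumBy-weakComps-split : ∀ s n N (h : List ℕ → ℕ) → sumBy (weakComps (s + suc n) N) h ≡
  sumBy (weakComps (suc s) N) (λ x → sumBy (weakComps (suc n) (lastOr0 x)) (λ ℓ → h (take s x ++ ℓ)))
sumBy-weakComps-split zero n N h = sym (sumBy-weakComps-1 N _)
sumBy-weakComps-split (suc s) n N h = begin
  sumBy (weakComps (suc s + suc n) N) h
    ≡⟨ sumBy-weakComps-suc (s + suc n) N h ⟩
  sumUpTo N (λ a → sumBy (weakComps (s + suc n) (N ∸ a)) (λ v → h (a ∷ v)))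
    ≡⟨ sumUpTo-cong N (λ a _ → sumBy-weakComps-split s n (N ∸ a) (λ v → h (a ∷ v))) ⟩
  sumUpTo N (λ a → sumBy (weakComps (suc s) (N ∸ a)) (λ x → inner a x (lastOr0 x)))
    ≡⟨ sumUpTo-cong N (λ a _ → sumBy-congᴬ (weakComps-sound (suc s) (N ∸ a))
         λ x (l , _) → cong (inner a x) (sym (lastOr0-∷ a x l))) ⟩
  sumUpTo N (λ a → sumBy (weakComps (suc s) (N ∸ a)) (λ x → inner a x (lastOr0 (a ∷ x))))
    ≡⟨ sumBy-weakComps-suc (suc s) N _ ⟨
  sumBy (weakComps (suc (suc s)) N) (λ x → sumBy (weakComps (suc n) (lastOr0 x)) (λ ℓ → h (take (suc s) x ++ ℓ))) ∎
  where
  open ≡-Reasoning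
  inner : ℕ → List ℕ → ℕ → ℕ
  inner a x c = sumBy (weakComps (suc n) c) (λ ℓ → h (a ∷ (take s x ++ ℓ)))

head0 : List ℕ → ℕ
head0 [] = 0
head0 (x ∷ _) = x

tail : List ℕ → List ℕ
tail [] = []
tail (_ ∷ xs) = xs

trailingZeros : List ℕ → ℕ
trailingZeros [] = 0
trailingZeros (a ∷ rest) = if sum rest ≡ᵇ 0 then length rest else trailingZeros rest

-- graft λ' ℓ keeps λ' up to its last nonzero entry (its first entry if there is none), adds the
-- first part of ℓ to that entry and replaces the trailingZeros λ' zeros after it by the rest of ℓ.
graft : List ℕ → List ℕ → List ℕ
graft [] ℓ = ℓ
graft (a ∷ rest) ℓ = if sum rest ≡ᵇ 0 then (a + head0 ℓ) ∷ tail ℓ else a ∷ graft rest ℓ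

trailingZeros-zero : ∀ a rest → sum rest ≡ 0 → trailingZeros (a ∷ rest) ≡ length rest
trailingZeros-zero a rest e rewrite e = refl

trailingZeros-nonzero : ∀ a rest → sum rest ≢ 0 → trailingZeros (a ∷ rest) ≡ trailingZeros rest
trailingZeros-nonzero a rest e rewrite ≢⇒≡ᵇ≡false e = refl

graft-zero : ∀ a rest ℓ → sum rest ≡ 0 → graft (a ∷ rest) ℓ ≡ (a + head0 ℓ) ∷ tail ℓ
graft-zero a rest ℓ e rewrite e = refl

graft-nonzero : ∀ a rest ℓ → sum rest ≢ 0 → graft (a ∷ rest) ℓ ≡ a ∷ graft rest ℓ
graft-nonzero a rest ℓ e rewrite ≢⇒≡ᵇ≡false e = refl

<⇒∸≢0 : ∀ {a b} → a < b → b ∸ a ≢ 0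
<⇒∸≢0 a<b e = <⇒≱ a<b (m∸n≡0⇒m≤n e)

-- The interchange of the nested sums

module Interchange (F H : ℕ → ℕ) (F-mono : ∀ {x y} → x ≤ y → F x ≤ F y) (H0 : H 0 ≡ 0) where

  -- With F and H the colour profiles of P and Q, joined c is the profile of P *_x Q when x ends in c.
  joined : ℕ → ℕ → ℕ
  joined c k = if k ≤ᵇ c then F k else F c ⊔ H (k ∸ c)

  joined-≤ : ∀ c k → k ≤ c → joined c k ≡ F k
  joined-≤ c k k≤c rewrite ≤⇒≤ᵇ≡true k≤c = refl

  joined-≰ : ∀ c k → ¬ k ≤ c → joined c k ≡ F c ⊔ H (k ∸ c)
  joined-≰ c k k≰c rewrite ≰⇒≤ᵇ≡false k≰c = refl

  joined-> : ∀ c b → joined c (suc b + c) ≡ F c ⊔ H (suc b)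
  joined-> c b rewrite ≰⇒≤ᵇ≡false (m+1+n≰m c {b} ∘ subst (_≤ c) (+-comm (suc b) c)) | m+n∸n≡m (suc b) c = refl

  lastSum : (ℕ → Bool) → ℕ → ℕ → (List ℕ → ℕ) → ℕ
  lastSum Q t n g = sumBy (weakComps (suc t) n) (λ ℓ → when (Q (F (lastOr0 ℓ))) (g ℓ))

  graftSum : (ℕ → Bool) → ℕ → (List ℕ → ℕ) → List ℕ → ℕ
  graftSum Q c g lam' = lastSum Q (trailingZeros lam') c (g ∘ graft lam')

  graftedSum : (ℕ → Bool) → (ℕ → Bool) → ℕ → ℕ → ℕ → (List ℕ → ℕ) → ℕ
  graftedSum P Q t b c g = sumBy (weakComps (suc t) b) (λ lam' → when (P (H (lastOr0 lam'))) (graftSum Q c g lam'))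

  joinedSum : (ℕ → Bool) → ℕ → ℕ → ℕ → (List ℕ → ℕ) → ℕ
  joinedSum R t c n g = sumBy (weakComps (suc t) n) (λ μ → when (R (joined c (lastOr0 μ))) (g μ))

  lastSum-vanishes : ∀ (Q : ℕ → Bool) (Z : Bool) t c e (g : List ℕ → ℕ) → (∀ k → k ≤ c → Q (F k) ≡ true → Z ≡ true) →
    lastSum Q t (c ∸ e) g ≡ when Z (lastSum Q t (c ∸ e) g)
  lastSum-vanishes Q Z t c e g imp with Z
  ... | true = refl
  ... | false = sumBy-0ᴬ (weakComps-sound (suc t) (c ∸ e)) λ ℓ (_ , s) →
    term≡0 ℓ (≤-trans (lastOr0≤sum ℓ) (≤-trans (≤-reflexive s) (m∸n≤m c e)))
    where
    term≡0 : ∀ ℓ → lastOr0 ℓ ≤ c → when (Q (F (lastOr0 ℓ))) (g ℓ) ≡ 0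
    term≡0 ℓ le with Q (F (lastOr0 ℓ)) in e2
    ... | false = refl
    ... | true with () ← imp _ le e2

  graftSum-nonzero : ∀ (Q : ℕ → Bool) c (g : List ℕ → ℕ) a rest → sum rest ≢ 0 →
    graftSum Q c g (a ∷ rest) ≡ graftSum Q c (g ∘ (a ∷_)) rest
  graftSum-nonzero Q c g a rest nz =
    trans (cong (λ n → lastSum Q n c (g ∘ graft (a ∷ rest))) (trailingZeros-nonzero a rest nz))
          (sumBy-cong (weakComps (suc (trailingZeros rest)) c) λ ℓ →
             cong (λ w → when (Q (F (lastOr0 ℓ))) (g w)) (graft-nonzero a rest ℓ nz))

  graftedSum-head : ∀ (P Q : ℕ → Bool) t a b c (g : List ℕ → ℕ) → a < b →
    sumBy (weakComps (suc t) (b ∸ a)) (λ rest → when (P (H (lastOr0 (a ∷ rest)))) (graftSum Q c g (a ∷ rest)))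
    ≡ graftedSum P Q t (b ∸ a) c (g ∘ (a ∷_))
  graftedSum-head P Q t a b c g a<b = sumBy-congᴬ (weakComps-sound (suc t) (b ∸ a)) λ rest (l , s) →
    cong₂ (λ u v → when (P (H u)) v) (lastOr0-∷ a rest l)
          (graftSum-nonzero Q c g a rest (λ e → <⇒∸≢0 a<b (trans (sym s) e)))

  graftedSum-lastHead : ∀ (P Q : ℕ → Bool) t b c (g : List ℕ → ℕ) →
    sumBy (weakComps (suc t) (b ∸ b)) (λ rest → when (P (H (lastOr0 (b ∷ rest)))) (graftSum Q c g (b ∷ rest)))
    ≡ when (P 0) (sumUpTo c (λ e → lastSum Q t (c ∸ e) (λ ℓ → g ((b + e) ∷ ℓ))))
  graftedSum-lastHead P Q t b c g = begin
    sumBy (weakComps (suc t) (b ∸ b)) f          ≡⟨ cong (λ z → sumBy (weakComps (suc t) z) f) (n∸n≡0 b) ⟩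
    sumBy (weakComps (suc t) 0) f                ≡⟨ sumBy-weakComps-of-0 (suc t) f ⟩
    f zeros                                      ≡⟨ cong₂ (λ u v → when (P u) (lastSum Q v c (g ∘ graft (b ∷ zeros))))
                                                          (trans (cong H (lastOr0-zeros (suc t))) H0) trailing ⟩
    when (P 0) (lastSum Q (suc t) c (g ∘ graft (b ∷ zeros)))
      ≡⟨ cong (when (P 0)) (sumBy-cong (weakComps (suc (suc t)) c) λ ℓ →
           cong (λ w → when (Q (F (lastOr0 ℓ))) (g w)) (graft-zero b zeros ℓ (sum-zeros (suc t)))) ⟩
    when (P 0) (lastSum Q (suc t) c (λ ℓ → g ((b + head0 ℓ) ∷ tail ℓ)))
      ≡⟨ cong (when (P 0)) (sumBy-weakComps-suc (suc t) c _) ⟩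
    when (P 0) (sumUpTo c (λ e → sumBy (weakComps (suc t) (c ∸ e))
                                   (λ ℓ → when (Q (F (lastOr0 (e ∷ ℓ)))) (g ((b + e) ∷ ℓ)))))
      ≡⟨ cong (when (P 0)) (sumUpTo-cong c λ e _ → sumBy-congᴬ (weakComps-sound (suc t) (c ∸ e)) λ ℓ (l , _) →
           cong (λ z → when (Q (F z)) (g ((b + e) ∷ ℓ))) (lastOr0-∷ e ℓ l)) ⟩
    when (P 0) (sumUpTo c (λ e → lastSum Q t (c ∸ e) (λ ℓ → g ((b + e) ∷ ℓ)))) ∎
    where
    open ≡-Reasoning
    zeros : List ℕ
    zeros = replicate (suc t) 0
    f : List ℕ → ℕ
    f rest = when (P (H (lastOr0 (b ∷ rest)))) (graftSum Q c g (b ∷ rest))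
    trailing : trailingZeros (b ∷ zeros) ≡ suc t
    trailing = trans (trailingZeros-zero b zeros (sum-zeros (suc t))) (length-replicate (suc t))

  graftedSum-step : ∀ (P Q : ℕ → Bool) t b c (g : List ℕ → ℕ) →
    graftedSum P Q (suc t) b c g
    ≡ sumBelow b (λ a → graftedSum P Q t (b ∸ a) c (g ∘ (a ∷_)))
      + when (P 0) (sumUpTo c (λ e → lastSum Q t (c ∸ e) (λ ℓ → g ((b + e) ∷ ℓ))))
  graftedSum-step P Q t b c g = begin
    graftedSum P Q (suc t) b c g ≡⟨ sumBy-weakComps-suc (suc t) b _ ⟩
    sumUpTo b byHead             ≡⟨ sumUpTo-last b byHead ⟩
    sumBelow b byHead + byHead b ≡⟨ cong₂ _+_ (sumBelow-cong b λ a → graftedSum-head P Q t a b c g)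
                                              (graftedSum-lastHead P Q t b c g) ⟩
    _                            ∎
    where
    open ≡-Reasoning
    byHead = λ a → sumBy (weakComps (suc t) (b ∸ a))
                         (λ rest → when (P (H (lastOr0 (a ∷ rest)))) (graftSum Q c g (a ∷ rest)))

  joinedSum-step : ∀ (R : ℕ → Bool) (Z : Bool) t b c (g : List ℕ → ℕ) →
    when Z (joinedSum R (suc t) c (b + c) g)
    ≡ sumBelow b (λ a → when Z (joinedSum R t c (b ∸ a + c) (g ∘ (a ∷_))))
      + when Z (sumUpTo c (λ e → lastSum R t (c ∸ e) (λ μ → g ((b + e) ∷ μ))))
  joinedSum-step R Z t b c g = begin
    when Z (joinedSum R (suc t) c (b + c) g)
      ≡⟨ cong (when Z) (trans (sumBy-weakComps-suc (suc t) (b + c) _) (sumUpTo-split b c byHead)) ⟩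
    when Z (sumBelow b byHead + sumUpTo c (λ e → byHead (b + e)))
      ≡⟨ when-+ Z _ _ ⟩
    when Z (sumBelow b byHead) + when Z (sumUpTo c (λ e → byHead (b + e)))
      ≡⟨ cong₂ _+_ (trans (sym (sumBelow-when b Z byHead)) (sumBelow-cong b λ a a<b → cong (when Z) (early a a<b)))
                   (cong (when Z) (sumUpTo-cong c late)) ⟩
    _ ∎
    where
    open ≡-Reasoning
    byHead = λ a → sumBy (weakComps (suc t) (b + c ∸ a)) (λ μ → when (R (joined c (lastOr0 (a ∷ μ)))) (g (a ∷ μ)))
    early : ∀ a → a < b → byHead a ≡ joinedSum R t c (b ∸ a + c) (g ∘ (a ∷_))
    early a a<b rewrite +-∸-comm {b} c {a} (<⇒≤ a<b) = sumBy-congᴬ (weakComps-sound (suc t) (b ∸ a + c)) λ μ (l , _) →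
      cong (λ z → when (R (joined c z)) (g (a ∷ μ))) (lastOr0-∷ a μ l)
    late : ∀ e → e ≤ c → byHead (b + e) ≡ lastSum R t (c ∸ e) (λ μ → g ((b + e) ∷ μ))
    late e e≤c rewrite [m+n]∸[m+o]≡n∸o b c e = sumBy-congᴬ (weakComps-sound (suc t) (c ∸ e)) λ μ (l , s) →
      cong (λ z → when (R z) (g ((b + e) ∷ μ)))
        (trans (cong (joined c) (lastOr0-∷ (b + e) μ l))
               (joined-≤ c (lastOr0 μ) (≤-trans (lastOr0≤sum μ) (≤-trans (≤-reflexive s) (m∸n≤m c e)))))

  graftedSum-single : ∀ (P Q : ℕ → Bool) b c (g : List ℕ → ℕ) →
    graftedSum P Q 0 b c g ≡ when (P (H b)) (when (Q (F c)) (g ((b + c) ∷ [])))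
  graftedSum-single P Q b c g = trans (sumBy-weakComps-1 b _) (cong (when (P (H b))) (sumBy-weakComps-1 c _))

  joinedSum-single : ∀ (R : ℕ → Bool) c n (g : List ℕ → ℕ) → joinedSum R 0 c n g ≡ when (R (joined c n)) (g (n ∷ []))
  joinedSum-single R c n g = sumBy-weakComps-1 n _

  -- For one-part compositions both sides ask for F c ≡ i and H b ≤ i.
  single-≤ : ∀ i b c G → when (H b ≤ᵇ i) (when (F c ≡ᵇ i) G) ≡ when (i ≤ᵇ F c) (when (joined c (b + c) ≡ᵇ i) G)
  single-≤ i zero c G rewrite H0 | joined-≤ c c ≤-refl with F c ≟ i
  ... | yes e rewrite ≡⇒≡ᵇ≡true e | ≤⇒≤ᵇ≡true (≤-reflexive (sym e)) = refl
  ... | no ne rewrite ≢⇒≡ᵇ≡false ne = sym (when-0 _)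
  single-≤ i (suc b) c G rewrite joined-> c b with F c ≟ i
  ... | no ne rewrite ≢⇒≡ᵇ≡false ne | when-0 (H (suc b) ≤ᵇ i) with i ≤? F c
  ...   | no i≰Fc rewrite ≰⇒≤ᵇ≡false i≰Fc = refl
  ...   | yes i≤Fc rewrite ≤⇒≤ᵇ≡true i≤Fc = cong (λ z → when z G) (sym (≢⇒≡ᵇ≡false λ e →
          <-irrefl (sym e) (<-≤-trans (≤∧≢⇒< i≤Fc (ne ∘ sym)) (m≤m⊔n (F c) (H (suc b))))))
  single-≤ i (suc b) c G | yes refl rewrite ≡⇒≡ᵇ≡true {F c} refl | ≤⇒≤ᵇ≡true {F c} ≤-refl with H (suc b) ≤? F c
  ... | yes le rewrite ≤⇒≤ᵇ≡true le | m≥n⇒m⊔n≡m le | ≡⇒≡ᵇ≡true {F c} refl = refl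
  ... | no nle rewrite ≰⇒≤ᵇ≡false nle | m≤n⇒m⊔n≡n (<⇒≤ (≰⇒> nle))
                     | ≢⇒≡ᵇ≡false {H (suc b)} {F c} (nle ∘ ≤-reflexive) = refl

  single-< : ∀ i j → i < j → ∀ b c G →
    when (H b ≡ᵇ j) (when (F c ≡ᵇ i) G) ≡ when (F c ≡ᵇ i) (when (joined c (b + c) ≡ᵇ j) G)
  single-< i j i<j zero c G rewrite H0 | joined-≤ c c ≤-refl with F c ≟ i
  ... | yes refl rewrite ≡⇒≡ᵇ≡true {F c} refl | ≢⇒≡ᵇ≡false {F c} {j} (<⇒≢ i<j) | ≢⇒≡ᵇ≡false {0} {j}
    (<⇒≢ (≤-<-trans z≤n i<j)) = refl
  ... | no ne rewrite ≢⇒≡ᵇ≡false ne = when-0 _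
  single-< i j i<j (suc b) c G rewrite joined-> c b with F c ≟ i
  ... | no ne rewrite ≢⇒≡ᵇ≡false ne = when-0 _
  ... | yes refl rewrite ≡⇒≡ᵇ≡true {F c} refl with H (suc b) ≤? F c
  ...   | yes le rewrite m≥n⇒m⊔n≡m le | ≢⇒≡ᵇ≡false {F c} {j} (<⇒≢ i<j)
                       | ≢⇒≡ᵇ≡false {H (suc b)} {j} (<⇒≢ (≤-<-trans le i<j)) = refl
  ...   | no nle rewrite m≤n⇒m⊔n≡n (<⇒≤ (≰⇒> nle)) = refl

  interchange-≤-core : ∀ i t b c (g : List ℕ → ℕ) →
    graftedSum (_≤ᵇ i) (_≡ᵇ i) t b c g ≡ when (i ≤ᵇ F c) (joinedSum (_≡ᵇ i) t c (b + c) g)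
  interchange-≤-core i zero b c g =
    trans (graftedSum-single (_≤ᵇ i) (_≡ᵇ i) b c g)
          (trans (single-≤ i b c _) (cong (when (i ≤ᵇ F c)) (sym (joinedSum-single (_≡ᵇ i) c (b + c) g))))
  interchange-≤-core i (suc t) b c g = begin
    graftedSum (_≤ᵇ i) (_≡ᵇ i) (suc t) b c g
      ≡⟨ graftedSum-step (_≤ᵇ i) (_≡ᵇ i) t b c g ⟩
    sumBelow b (λ a → graftedSum (_≤ᵇ i) (_≡ᵇ i) t (b ∸ a) c (g ∘ (a ∷_))) + sumUpTo c late
      ≡⟨ cong₂ _+_ (sumBelow-cong b λ a _ → interchange-≤-core i t (b ∸ a) c (g ∘ (a ∷_)))
                   (trans (sumUpTo-cong c λ e _ → lastSum-vanishes (_≡ᵇ i) (i ≤ᵇ F c) t c e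
                     (λ ℓ → g ((b + e) ∷ ℓ)) onlyIfI≤Fc)
                          (sumUpTo-when c (i ≤ᵇ F c) late)) ⟩
    sumBelow b early + when (i ≤ᵇ F c) (sumUpTo c late)
      ≡⟨ joinedSum-step (_≡ᵇ i) (i ≤ᵇ F c) t b c g ⟨
    when (i ≤ᵇ F c) (joinedSum (_≡ᵇ i) (suc t) c (b + c) g) ∎
    where
    open ≡-Reasoning
    early = λ a → when (i ≤ᵇ F c) (joinedSum (_≡ᵇ i) t c (b ∸ a + c) (g ∘ (a ∷_)))
    late = λ e → lastSum (_≡ᵇ i) t (c ∸ e) (λ ℓ → g ((b + e) ∷ ℓ))
    onlyIfI≤Fc : ∀ k → k ≤ c → (F k ≡ᵇ i) ≡ true → (i ≤ᵇ F c) ≡ true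
    onlyIfI≤Fc k k≤c Fk≡i = ≤⇒≤ᵇ≡true (subst (_≤ F c) (≡ᵇ≡true⇒≡ Fk≡i) (F-mono k≤c))

  interchange-<-core : ∀ i j → i < j → ∀ t b c (g : List ℕ → ℕ) →
    graftedSum (_≡ᵇ j) (_≡ᵇ i) t b c g ≡ when (F c ≡ᵇ i) (joinedSum (_≡ᵇ j) t c (b + c) g)
  interchange-<-core i j i<j zero b c g =
    trans (graftedSum-single (_≡ᵇ j) (_≡ᵇ i) b c g)
          (trans (single-< i j i<j b c _) (cong (when (F c ≡ᵇ i)) (sym (joinedSum-single (_≡ᵇ j) c (b + c) g))))
  interchange-<-core i (suc j) i<j (suc t) b c g = begin
    graftedSum (_≡ᵇ suc j) (_≡ᵇ i) (suc t) b c g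
      ≡⟨ graftedSum-step (_≡ᵇ suc j) (_≡ᵇ i) t b c g ⟩
    sumBelow b (λ a → graftedSum (_≡ᵇ suc j) (_≡ᵇ i) t (b ∸ a) c (g ∘ (a ∷_))) + 0
      ≡⟨ cong₂ _+_ (sumBelow-cong b λ a _ → interchange-<-core i (suc j) i<j t (b ∸ a) c (g ∘ (a ∷_)))
        (sym lateVanishes) ⟩
    sumBelow b early + when (F c ≡ᵇ i) (sumUpTo c late)
      ≡⟨ joinedSum-step (_≡ᵇ suc j) (F c ≡ᵇ i) t b c g ⟨
    when (F c ≡ᵇ i) (joinedSum (_≡ᵇ suc j) (suc t) c (b + c) g) ∎
    where
    open ≡-Reasoning
    early = λ a → when (F c ≡ᵇ i) (joinedSum (_≡ᵇ suc j) t c (b ∸ a + c) (g ∘ (a ∷_)))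
    late = λ e → lastSum (_≡ᵇ suc j) t (c ∸ e) (λ ℓ → g ((b + e) ∷ ℓ))
    lateVanishes : when (F c ≡ᵇ i) (sumUpTo c late) ≡ 0
    lateVanishes with F c ≟ i
    ... | no ne rewrite ≢⇒≡ᵇ≡false ne = refl
    ... | yes refl rewrite ≡⇒≡ᵇ≡true {F c} refl = sumUpTo-0 c λ e _ →
      trans (lastSum-vanishes (_≡ᵇ suc j) false t c e (λ ℓ → g ((b + e) ∷ ℓ)) λ k k≤c Fk≡j →
               contradiction (≡ᵇ≡true⇒≡ Fk≡j) (<⇒≢ (≤-<-trans (F-mono k≤c) i<j)))
            refl

  -- The two sides after expansion: λ' and λ, resp. x and μ, are compositions of the top runs b = L(Q)
  -- and a = L(P), and s and t are the numbers of prime factors of Q and R.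
  leftSum : (List ℕ → Bool) → (ℕ → Bool) → ℕ → ℕ → ℕ → ℕ → (List ℕ → ℕ) → ℕ
  leftSum α β s t a b g = sumBy (weakComps (suc t) b) λ lam' → when (α lam')
    (sumBy (weakComps (s + suc (trailingZeros lam')) a)
    λ lam → when (β (F (lastOr0 lam))) (g (take s lam ++ graft lam' (drop s lam))))

  rightSum : (ℕ → Bool) → (ℕ → Bool) → ℕ → ℕ → ℕ → ℕ → (List ℕ → ℕ) → ℕ
  rightSum Y R s t a b g = sumBy (weakComps (suc s) a) λ x →
    when (Y (F (lastOr0 x))) (joinedSum R t (lastOr0 x) (b + lastOr0 x) (λ μ → g (take s x ++ μ)))

  leftSum-split : ∀ (α : List ℕ → Bool) (β : ℕ → Bool) s t a b (g : List ℕ → ℕ) → leftSum α β s t a b g ≡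
    sumBy (weakComps (suc s) a) (λ x → sumBy (weakComps (suc t) b) λ lam' →
      when (α lam') (graftSum β (lastOr0 x) (λ v → g (take s x ++ v)) lam'))
  leftSum-split α β s t a b g = begin
    leftSum α β s t a b g
      ≡⟨ sumBy-cong (weakComps (suc t) b) (λ lam' →
           cong (when (α lam')) (sumBy-weakComps-split s (trailingZeros lam') a (term lam'))) ⟩
    sumBy (weakComps (suc t) b) (λ lam' → when (α lam') (sumBy (weakComps (suc s) a) λ x →
      sumBy (weakComps (suc (trailingZeros lam')) (lastOr0 x)) (λ ℓ → term lam' (take s x ++ ℓ))))
      ≡⟨ sumBy-cong (weakComps (suc t) b) (λ lam' →
           cong (when (α lam')) (sumBy-congᴬ (weakComps-sound (suc s) a)
             (λ x (len-x , _) → reassemble lam' x len-x))) ⟩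
    sumBy (weakComps (suc t) b) (λ lam' → when (α lam') (sumBy (weakComps (suc s) a) (λ x → inner x lam')))
      ≡⟨ sumBy-cong (weakComps (suc t) b) (λ lam' → sumBy-when (weakComps (suc s) a) (α lam') (λ x → inner x lam')) ⟨
    sumBy (weakComps (suc t) b) (λ lam' → sumBy (weakComps (suc s) a) (λ x → when (α lam') (inner x lam')))
      ≡⟨ sumBy-swap (weakComps (suc t) b) (weakComps (suc s) a) _ ⟩
    _ ∎
    where
    open ≡-Reasoning
    term = λ lam' lam → when (β (F (lastOr0 lam))) (g (take s lam ++ graft lam' (drop s lam)))
    inner = λ x lam' → graftSum β (lastOr0 x) (λ v → g (take s x ++ v)) lam'
    reassemble : ∀ lam' x → length x ≡ suc s →
      sumBy (weakComps (suc (trailingZeros lam')) (lastOr0 x)) (λ ℓ → term lam' (take s x ++ ℓ)) ≡ inner x lam'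
    reassemble lam' x len-x = sumBy-congᴬ (weakComps-sound (suc (trailingZeros lam')) (lastOr0 x)) λ ℓ (lℓ , _) →
      cong₂ (λ u v → when (β (F u)) (g v)) (lastOr0-++ (take s x) ℓ lℓ)
        (cong₂ (λ u v → u ++ graft lam' v) (take-exact-++ s (take s x) ℓ taken) (drop-exact-++ s (take s x) ℓ taken))
      where
      taken = length-take-suc s x len-x

  interchange-≤ : ∀ i s t a b (g : List ℕ → ℕ) →
    leftSum (λ lam' → H (lastOr0 lam') ≤ᵇ i) (_≡ᵇ i) s t a b g ≡ rightSum (i ≤ᵇ_) (_≡ᵇ i) s t a b g
  interchange-≤ i s t a b g = trans (leftSum-split (λ lam' → H (lastOr0 lam') ≤ᵇ i) (_≡ᵇ i) s t a b g)
    (sumBy-cong (weakComps (suc s) a) λ x → interchange-≤-core i t b (lastOr0 x) (λ v → g (take s x ++ v)))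

  interchange-< : ∀ i j → i < j → ∀ s t a b (g : List ℕ → ℕ) →
    leftSum (λ lam' → H (lastOr0 lam') ≡ᵇ j) (_≡ᵇ i) s t a b g ≡ rightSum (_≡ᵇ i) (_≡ᵇ j) s t a b g
  interchange-< i j i<j s t a b g = trans (leftSum-split (λ lam' → H (lastOr0 lam') ≡ᵇ j) (_≡ᵇ i) s t a b g)
    (sumBy-cong (weakComps (suc s) a) λ x → interchange-<-core i j i<j t b (lastOr0 x) (λ v → g (take s x ++ v)))

-- Words and interleavings

downs : ℕ → Word
downs k = replicate k false

downs-+ : ∀ x y → downs (x + y) ≡ downs x ++ downs y
downs-+ zero y = refl
downs-+ (suc x) y = cong (false ∷_) (downs-+ x y)

downs-∷ʳ : ∀ k → downs k ++ false ∷ [] ≡ downs (suc k)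
downs-∷ʳ zero = refl
downs-∷ʳ (suc k) = cong (false ∷_) (downs-∷ʳ k)

reverse-downs : ∀ k → reverse (downs k) ≡ downs k
reverse-downs zero = refl
reverse-downs (suc k) =
  trans (reverse-++ (false ∷ []) (downs k)) (trans (cong (_++ false ∷ []) (reverse-downs k)) (downs-∷ʳ k))

size-++ : ∀ A B → size (A ++ B) ≡ size A + size B
size-++ [] B = refl
size-++ (true ∷ A) B = cong suc (size-++ A B)
size-++ (false ∷ A) B = size-++ A B

size-downs : ∀ k → size (downs k) ≡ 0
size-downs zero = refl
size-downs (suc k) = size-downs k

size≡0⇒downs : ∀ w → size w ≡ 0 → w ≡ downs (length w)
size≡0⇒downs [] _ = refl
size≡0⇒downs (false ∷ w) e = cong (false ∷_) (size≡0⇒downs w e)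

size-lastUp : ∀ X → 1 ≤ size (X ++ true ∷ [])
size-lastUp X rewrite size-++ X (true ∷ []) = ≤-trans (s≤s z≤n) (≤-reflexive (sym (+-suc (size X) 0)))

lastUp-split : ∀ w → 1 ≤ size w → Σ Word λ X → Σ ℕ λ k → w ≡ X ++ true ∷ downs k
lastUp-split [] ()
lastUp-split (s ∷ w) p with size w ≟ 0
... | no nz with lastUp-split w (≤∧≢⇒< z≤n (nz ∘ sym))
...   | X , k , e = s ∷ X , k , cong (s ∷_) e
lastUp-split (true ∷ w) p | yes z = [] , length w , cong (true ∷_) (size≡0⇒downs w z)
lastUp-split (false ∷ w) p | yes z rewrite z with () ← p

takeWhile-downs : ∀ k ys → takeWhile (λ b → b BoolP.≟ false) (downs k ++ true ∷ ys) ≡ downs k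
takeWhile-downs zero ys = refl
takeWhile-downs (suc k) ys = cong (false ∷_) (takeWhile-downs k ys)

L-lastUp : ∀ X k → L (X ++ true ∷ downs k) ≡ k
L-lastUp X k = begin
  length (takeWhile isDown (reverse (X ++ true ∷ downs k)))
    ≡⟨ cong (length ∘ takeWhile isDown) (reverse-++ X (true ∷ downs k)) ⟩
  length (takeWhile isDown (reverse (true ∷ downs k) ++ reverse X))
    ≡⟨ cong (λ z → length (takeWhile isDown (z ++ reverse X))) (reverse-++ (true ∷ []) (downs k)) ⟩
  length (takeWhile isDown ((reverse (downs k) ++ true ∷ []) ++ reverse X))
    ≡⟨ cong (λ z → length (takeWhile isDown ((z ++ true ∷ []) ++ reverse X))) (reverse-downs k) ⟩
  length (takeWhile isDown ((downs k ++ true ∷ []) ++ reverse X))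
    ≡⟨ cong (length ∘ takeWhile isDown) (++-assoc (downs k) (true ∷ []) (reverse X)) ⟩
  length (takeWhile isDown (downs k ++ true ∷ reverse X))
    ≡⟨ cong length (takeWhile-downs k (reverse X)) ⟩
  length (downs k)
    ≡⟨ length-replicate k ⟩
  k ∎
  where
  open ≡-Reasoning
  isDown = λ b → b BoolP.≟ false

take-before-downs : ∀ (X : Word) k → take (length (X ++ downs k) ∸ k) (X ++ downs k) ≡ X
take-before-downs X k = take-exact-++ _ X (downs k) (sym length≡)
  where
  length≡ : length (X ++ downs k) ∸ k ≡ length X
  length≡ = trans (cong (_∸ k) (trans (length-++ X) (cong (length X +_) (length-replicate k)))) (m+n∸n≡m (length X) k)

interleave : List ℕ → List Word → Word
interleave [] Bs = []
interleave (a ∷ as) [] = downs a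
interleave (a ∷ as) (B ∷ Bs) = downs a ++ B ++ interleave as Bs

interleaveTail : List Word → List ℕ → Word
interleaveTail (B ∷ Bs) (l ∷ ls) = B ++ downs l ++ interleaveTail Bs ls
interleaveTail _ _ = []

interleavePrefix : List ℕ → List Word → Word
interleavePrefix (a ∷ as) (B ∷ Bs) = downs a ++ B ++ interleavePrefix as Bs
interleavePrefix _ _ = []

++-assoc₃ : ∀ (A B C D : Word) → (A ++ B ++ C) ++ D ≡ A ++ B ++ C ++ D
++-assoc₃ A B C D = trans (++-assoc A (B ++ C) D) (cong (A ++_) (++-assoc B C D))

++-reassoc : ∀ (A B C D E F' : Word) → A ++ B ++ C ++ (D ++ E) ++ F' ≡ (A ++ B ++ C ++ D) ++ E ++ F'
++-reassoc A B C D E F' = begin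
  A ++ B ++ C ++ (D ++ E) ++ F' ≡⟨ cong (λ z → A ++ B ++ C ++ z) (++-assoc D E F') ⟩
  A ++ B ++ C ++ D ++ E ++ F' ≡⟨ cong (λ z → A ++ B ++ z) (sym (++-assoc C D (E ++ F'))) ⟩
  A ++ B ++ (C ++ D) ++ E ++ F' ≡⟨ cong (A ++_) (sym (++-assoc B (C ++ D) (E ++ F'))) ⟩
  A ++ (B ++ C ++ D) ++ E ++ F' ≡⟨ sym (++-assoc A (B ++ C ++ D) (E ++ F')) ⟩
  (A ++ B ++ C ++ D) ++ E ++ F' ∎
  where open ≡-Reasoning

reverse-reverse-++-downs : ∀ (R : Word) a acc → reverse (reverse R ++ downs a ++ acc) ≡ reverse acc ++ downs a ++ R
reverse-reverse-++-downs R a acc = begin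
  reverse (reverse R ++ downs a ++ acc)           ≡⟨ reverse-++ (reverse R) (downs a ++ acc) ⟩
  reverse (downs a ++ acc) ++ reverse (reverse R) ≡⟨ cong₂ _++_ (reverse-++ (downs a) acc) (reverse-involutive R) ⟩
  (reverse acc ++ reverse (downs a)) ++ R         ≡⟨ cong (λ z → (reverse acc ++ z) ++ R) (reverse-downs a) ⟩
  (reverse acc ++ downs a) ++ R                   ≡⟨ ++-assoc (reverse acc) (downs a) R ⟩
  reverse acc ++ downs a ++ R                     ∎
  where open ≡-Reasoning

interleave-∷ : ∀ a as Bs → length as ≡ length Bs → interleave (a ∷ as) Bs ≡ downs a ++ interleaveTail Bs as
interleave-∷ a [] [] _ = sym (++-identityʳ (downs a))
interleave-∷ a (l ∷ ls) (B ∷ Bs) e = cong (λ z → downs a ++ B ++ z) (interleave-∷ l ls Bs (suc-injective e))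

interleave-++ : ∀ y ℓ Bs Cs → length y ≡ length Bs →
  interleave (y ++ ℓ) (Bs ++ Cs) ≡ interleavePrefix y Bs ++ interleave ℓ Cs
interleave-++ [] ℓ [] Cs _ = refl
interleave-++ (a ∷ y) ℓ (B ∷ Bs) Cs e =
  trans (cong (λ z → downs a ++ B ++ z) (interleave-++ y ℓ Bs Cs (suc-injective e))) (sym (++-assoc₃ (downs a) B _ _))

interleavePrefix-∷ʳ : ∀ y v Bs B → length y ≡ length Bs →
  interleavePrefix (y ++ v ∷ []) (Bs ++ B ∷ []) ≡ interleavePrefix y Bs ++ downs v ++ B
interleavePrefix-∷ʳ [] v [] B _ = cong (downs v ++_) (++-identityʳ B)
interleavePrefix-∷ʳ (a ∷ y) v (C ∷ Bs) B e =
  trans (cong (λ z → downs a ++ C ++ z) (interleavePrefix-∷ʳ y v Bs B (suc-injective e)))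
    (sym (++-assoc₃ (downs a) C _ _))

interleavePrefix-extendLast : ∀ y Bs B Z → length y ≡ suc (length Bs) →
  interleavePrefix y (Bs ++ (B ++ Z) ∷ []) ≡ interleavePrefix y (Bs ++ B ∷ []) ++ Z
interleavePrefix-extendLast (a ∷ []) [] B Z _ = begin
  downs a ++ (B ++ Z) ++ []  ≡⟨ cong (downs a ++_) (++-identityʳ (B ++ Z)) ⟩
  downs a ++ B ++ Z          ≡⟨ ++-assoc (downs a) B Z ⟨
  (downs a ++ B) ++ Z        ≡⟨ cong (λ z → (downs a ++ z) ++ Z) (++-identityʳ B) ⟨
  (downs a ++ B ++ []) ++ Z  ∎
  where open ≡-Reasoning
interleavePrefix-extendLast (a ∷ y) (C ∷ Bs) B Z e =
  trans (cong (λ z → downs a ++ C ++ z) (interleavePrefix-extendLast y Bs B Z (suc-injective e)))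
        (sym (++-assoc₃ (downs a) C _ _))

interleave-zeros : ∀ Rs → interleave (replicate (suc (length Rs)) 0) Rs ≡ concat Rs
interleave-zeros [] = refl
interleave-zeros (R ∷ Rs) = cong (R ++_) (interleave-zeros Rs)

×-downs : ∀ X j Q → (X ++ downs j) ×[ j ] Q ≡ X ++ Q ++ downs j
×-downs X j Q = cong (_++ Q ++ downs j) (take-before-downs X j)

starGo-downs : ∀ X Fs ls → length ls ≡ length Fs → starGo (X ++ downs (sum ls)) Fs ls ≡ X ++ interleaveTail Fs ls
starGo-downs X [] [] _ = refl
starGo-downs X (F ∷ Fs) (l ∷ ls) e = begin
  starGo ((X ++ downs (l + sum ls)) ×[ l + sum ls ] F) Fs ls ≡⟨ cong (λ z → starGo z Fs ls)
    (×-downs X (l + sum ls) F) ⟩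
  starGo (X ++ F ++ downs (l + sum ls)) Fs ls                ≡⟨ cong (λ z → starGo (X ++ F ++ z) Fs ls)
    (downs-+ l (sum ls)) ⟩
  starGo (X ++ F ++ downs l ++ downs (sum ls)) Fs ls         ≡⟨ cong (λ z → starGo z Fs ls) (++-assoc₃ X F _ _) ⟨
  starGo ((X ++ F ++ downs l) ++ downs (sum ls)) Fs ls       ≡⟨ starGo-downs (X ++ F ++ downs l) Fs ls
    (suc-injective e) ⟩
  (X ++ F ++ downs l) ++ interleaveTail Fs ls                ≡⟨ ++-assoc₃ X F _ _ ⟩
  X ++ F ++ downs l ++ interleaveTail Fs ls                  ∎
  where open ≡-Reasoning

starλ-interleave : ∀ m X a P Q → P ≡ X ++ downs a → ∀ lam → length lam ≡ suc (length (factors m Q)) → sum lam ≡ a →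
  starλ m P Q lam ≡ X ++ interleave lam (factors m Q)
starλ-interleave m X a P Q refl (l ∷ ls) len s = begin
  starGo (X ++ downs a) Fs ls                 ≡⟨ cong (λ z → starGo (X ++ downs z) Fs ls) s ⟨
  starGo (X ++ downs (l + sum ls)) Fs ls      ≡⟨ cong (λ z → starGo (X ++ z) Fs ls) (downs-+ l (sum ls)) ⟩
  starGo (X ++ downs l ++ downs (sum ls)) Fs ls ≡⟨ cong (λ z → starGo z Fs ls) (++-assoc X _ _) ⟨
  starGo ((X ++ downs l) ++ downs (sum ls)) Fs ls ≡⟨ starGo-downs (X ++ downs l) Fs ls (suc-injective len) ⟩
  (X ++ downs l) ++ interleaveTail Fs ls      ≡⟨ ++-assoc X _ _ ⟩
  X ++ downs l ++ interleaveTail Fs ls        ≡⟨ cong (X ++_) (interleave-∷ l ls Fs (suc-injective len)) ⟨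
  X ++ interleave (l ∷ ls) Fs                 ∎
  where
  open ≡-Reasoning
  Fs = factors m Q

topMult : ℕ → Word → ℕ → ℕ
topMult m X k = maxMult (lastN k (downColors m X))

lastN-suffix : ∀ {A : Set} (l : List A) x y → x ≤ y → Σ (List A) λ pre → lastN y l ≡ pre ++ lastN x l
lastN-suffix l x y x≤y = take d (lastN y l) , sym
  (trans (cong (take d (lastN y l) ++_) dropped) (take++drop≡id d (lastN y l)))
  where
  d = (length l ∸ x) ∸ (length l ∸ y)
  dropped : lastN x l ≡ drop d (lastN y l)
  dropped = sym (trans (drop-drop (length l ∸ y) d l) (cong (λ z → drop z l) (m+[n∸m]≡n (∸-monoʳ-≤ (length l) x≤y))))

topMult-mono : ∀ m X {x y} → x ≤ y → topMult m X x ≤ topMult m X y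
topMult-mono m X {x} {y} le with lastN-suffix (downColors m X) x y le
... | pre , e = subst (λ z → maxMult (lastN x (downColors m X)) ≤ maxMult z) (sym e) (maxMult-suffix pre _)

topMult-0 : ∀ m X → topMult m X 0 ≡ 0
topMult-0 m X = cong maxMult (drop-all (length (downColors m X) ∸ 0) (downColors m X) ≤-refl)

sumBy-filter : ∀ {A : Set} (p : A → Bool) xs f →
  sumBy (filter (λ x → p x BoolP.≟ true) xs) f ≡ sumBy xs (λ x → when (p x) (f x))
sumBy-filter p [] f = refl
sumBy-filter p (x ∷ xs) f with p x
... | true = cong (f x +_) (sumBy-filter p xs f)
... | false = sumBy-filter p xs f

sumBy-starPaths : ∀ m i P Q f → sumBy (starPaths m i P Q) f ≡
  sumBy (weakComps (suc (length (factors m Q))) (L P)) (λ lam → when (inΛ m i P lam) (f (starλ m P Q lam)))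
sumBy-starPaths m i P Q f = trans (sumBy-map (starλ m P Q) (Λ m i (length (factors m Q)) P) f)
  (sumBy-filter (inΛ m i P) (weakComps (suc (length (factors m Q))) (L P)) (f ∘ starλ m P Q))

init-last : ∀ {A : Set} (xs : List A) → 1 ≤ length xs → Σ (List A) λ ys → Σ A λ z → xs ≡ ys ++ z ∷ []
init-last (x ∷ []) _ = [] , x , refl
init-last (x ∷ y ∷ xs) _ with init-last (y ∷ xs) (s≤s z≤n)
... | ys , z , e = x ∷ ys , z , cong (x ∷_) e

length-take-≤ : ∀ {A : Set} n (xs : List A) → n ≤ length xs → length (take n xs) ≡ n
length-take-≤ zero xs _ = refl
length-take-≤ (suc n) (x ∷ xs) (s≤s le) = cong suc (length-take-≤ n xs le)

length-∷ʳ : ∀ {A : Set} (xs : List A) (x : A) → length (xs ++ x ∷ []) ≡ suc (length xs)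
length-∷ʳ xs x = trans (length-++ xs) (+-comm (length xs) 1)

drop-length-++ : ∀ {A : Set} (xs ys : List A) n → drop (length xs + n) (xs ++ ys) ≡ drop n ys
drop-length-++ [] ys n = refl
drop-length-++ (x ∷ xs) ys n = drop-length-++ xs ys n

lastN-++ : ∀ {A : Set} k (xs ys : List A) → k ≤ length ys → lastN k (xs ++ ys) ≡ lastN k ys
lastN-++ k xs ys le =
  trans (cong (λ z → drop z (xs ++ ys)) (trans (cong (_∸ k) (length-++ xs)) (+-∸-assoc (length xs) le)))
        (drop-length-++ xs ys _)

+-+-∸ : ∀ e a s → (e + (a + s)) ∸ a ≡ e + s
+-+-∸ e a s = trans (cong (_∸ a)
  (trans (sym (+-assoc e a s)) (trans (cong (_+ s) (+-comm e a)) (+-assoc a e s)))) (m+n∸m≡n a (e + s))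

<ᵇ-cancel : ∀ e a b → (e + a <ᵇ e + b) ≡ (a <ᵇ b)
<ᵇ-cancel e a b with a <? b
... | yes p = trans (<⇒<ᵇ≡true (+-monoʳ-< e p)) (sym (<⇒<ᵇ≡true p))
... | no p = trans (≮⇒<ᵇ≡false (p ∘ +-cancelˡ-< e a b)) (sym (≮⇒<ᵇ≡false p))

≤ᵇ-cancel : ∀ e a b → (e + a ≤ᵇ e + b) ≡ (a ≤ᵇ b)
≤ᵇ-cancel e a b with a ≤? b
... | yes p = trans (≤⇒≤ᵇ≡true (+-monoʳ-≤ e p)) (sym (≤⇒≤ᵇ≡true p))
... | no p = trans (≰⇒≤ᵇ≡false (p ∘ +-cancelˡ-≤ e a b)) (sym (≰⇒≤ᵇ≡false p))

-- Paths of slope m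

module Slope (m' : ℕ) where
  m = suc m'

  height : ℕ → Word → ℕ
  height h [] = h
  height h (true ∷ w) = height (h + m) w
  height h (false ∷ w) = height (h ∸ 1) w

  aboveAxis : ℕ → Word → Bool
  aboveAxis h [] = true
  aboveAxis h (true ∷ w) = aboveAxis (h + m) w
  aboveAxis zero (false ∷ w) = false
  aboveAxis (suc h) (false ∷ w) = aboveAxis h w

  height-++ : ∀ h A B → height h (A ++ B) ≡ height (height h A) B
  height-++ h [] B = refl
  height-++ h (true ∷ A) B = height-++ (h + m) A B
  height-++ h (false ∷ A) B = height-++ (h ∸ 1) A B

  aboveAxis-++ : ∀ h A B → aboveAxis h (A ++ B) ≡ aboveAxis h A ∧ aboveAxis (height h A) B
  aboveAxis-++ h [] B = refl
  aboveAxis-++ h (true ∷ A) B = aboveAxis-++ (h + m) A B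
  aboveAxis-++ zero (false ∷ A) B = refl
  aboveAxis-++ (suc h) (false ∷ A) B = aboveAxis-++ h A B

  aboveAxis-++ˡ : ∀ h A B → aboveAxis h (A ++ B) ≡ true → aboveAxis h A ≡ true
  aboveAxis-++ˡ h A B e = ∧-conicalˡ _ _ (trans (sym (aboveAxis-++ h A B)) e)

  aboveAxis-++ʳ : ∀ h A B → aboveAxis h (A ++ B) ≡ true → aboveAxis (height h A) B ≡ true
  aboveAxis-++ʳ h A B e = ∧-conicalʳ _ _ (trans (sym (aboveAxis-++ h A B)) e)

  aboveAxis-++⁺ : ∀ h A B → aboveAxis h A ≡ true → aboveAxis (height h A) B ≡ true → aboveAxis h (A ++ B) ≡ true
  aboveAxis-++⁺ h A B e1 e2 rewrite aboveAxis-++ h A B | e1 | e2 = refl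

  valid≡aboveAxis∧height : ∀ h w → valid m h w ≡ (aboveAxis h w ∧ (height h w ≡ᵇ 0))
  valid≡aboveAxis∧height h [] = refl
  valid≡aboveAxis∧height h (true ∷ w) = valid≡aboveAxis∧height (h + m) w
  valid≡aboveAxis∧height zero (false ∷ w) = refl
  valid≡aboveAxis∧height (suc h) (false ∷ w) = valid≡aboveAxis∧height h w

  valid⇒aboveAxis×height : ∀ h w → valid m h w ≡ true → aboveAxis h w ≡ true × height h w ≡ 0
  valid⇒aboveAxis×height h w e = ∧-conicalˡ _ _ e' , ≡ᵇ≡true⇒≡ (∧-conicalʳ _ _ e')
    where e' = trans (sym (valid≡aboveAxis∧height h w)) e

  height-shift : ∀ e h0 w → aboveAxis h0 w ≡ true → height (e + h0) w ≡ e + height h0 w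
  height-shift e h0 [] _ = refl
  height-shift e h0 (true ∷ w) o rewrite +-assoc e h0 m = height-shift e (h0 + m) w o
  height-shift e (suc h0) (false ∷ w) o rewrite +-suc e h0 = height-shift e h0 w o

  aboveAxis-shift : ∀ e h0 w → aboveAxis h0 w ≡ true → aboveAxis (e + h0) w ≡ true
  aboveAxis-shift e h0 [] _ = refl
  aboveAxis-shift e h0 (true ∷ w) o rewrite +-assoc e h0 m = aboveAxis-shift e (h0 + m) w o
  aboveAxis-shift e (suc h0) (false ∷ w) o rewrite +-suc e h0 = aboveAxis-shift e h0 w o

  height-downs : ∀ h k → height h (downs k) ≡ h ∸ k
  height-downs h zero = refl
  height-downs h (suc k) = trans (height-downs (h ∸ 1) k) (∸-+-assoc h 1 k)

  aboveAxis-downs : ∀ h k → k ≤ h → aboveAxis h (downs k) ≡ true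
  aboveAxis-downs h zero _ = refl
  aboveAxis-downs (suc h) (suc k) (s≤s le) = aboveAxis-downs h k le

  aboveAxis-downs⁻ : ∀ h k → aboveAxis h (downs k) ≡ true → k ≤ h
  aboveAxis-downs⁻ h zero _ = z≤n
  aboveAxis-downs⁻ (suc h) (suc k) e = s≤s (aboveAxis-downs⁻ h k e)

  IsPath : Word → Set
  IsPath B = valid m 0 B ≡ true

  path-height : ∀ B → IsPath B → ∀ e → height e B ≡ e
  path-height B b e = begin
    height e B           ≡⟨ cong (λ z → height z B) (+-identityʳ e) ⟨
    height (e + 0) B     ≡⟨ height-shift e 0 B (proj₁ (valid⇒aboveAxis×height 0 B b)) ⟩
    e + height 0 B       ≡⟨ cong (e +_) (proj₂ (valid⇒aboveAxis×height 0 B b)) ⟩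
    e + 0                ≡⟨ +-identityʳ e ⟩
    e                    ∎
    where open ≡-Reasoning

  path-aboveAxis : ∀ B → IsPath B → ∀ e → aboveAxis e B ≡ true
  path-aboveAxis B b e =
    subst (λ z → aboveAxis z B ≡ true) (+-identityʳ e) (aboveAxis-shift e 0 B (proj₁ (valid⇒aboveAxis×height 0 B b)))

  topPart-height : ∀ X k → valid m 0 (X ++ true ∷ downs k) ≡ true →
    height 0 (X ++ true ∷ []) ≡ k × aboveAxis 0 (X ++ true ∷ []) ≡ true
  topPart-height X k v = ≤-antisym fallsToZero staysAbove , aboveAxis-++ˡ 0 top (downs k) above
    where
    top = X ++ true ∷ []
    split : X ++ true ∷ downs k ≡ top ++ downs k
    split = sym (++-assoc X (true ∷ []) (downs k))
    above : aboveAxis 0 (top ++ downs k) ≡ true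
    above = subst (λ z → aboveAxis 0 z ≡ true) split (proj₁ (valid⇒aboveAxis×height 0 (X ++ true ∷ downs k) v))
    ends : height (height 0 top) (downs k) ≡ 0
    ends = trans (sym (height-++ 0 top (downs k)))
      (trans (cong (height 0) (sym split)) (proj₂ (valid⇒aboveAxis×height 0 (X ++ true ∷ downs k) v)))
    fallsToZero : height 0 top ≤ k
    fallsToZero = m∸n≡0⇒m≤n (trans (sym (height-downs _ k)) ends)
    staysAbove : k ≤ height 0 top
    staysAbove = aboveAxis-downs⁻ _ k (aboveAxis-++ʳ 0 top (downs k) above)

  UpSteps = List (ℕ × ℕ)

  -- The up steps met when reading w from height h, ranked from r + 1, as (rank, starting height)
  -- pairs, most recent first: the stack searched by colorsAux.
  upSteps : ℕ → ℕ → Word → UpSteps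
  upSteps h r [] = []
  upSteps h r (true ∷ w) = upSteps (h + m) (suc r) w ++ (suc r , h) ∷ []
  upSteps h r (false ∷ w) = upSteps (h ∸ 1) r w

  colorsAux-++ : ∀ h r ups A B →
    colorsAux m h r ups (A ++ B) ≡ colorsAux m h r ups A ++ colorsAux m (height h A) (r + size A)
    (upSteps h r A ++ ups) B
  colorsAux-++ h r ups [] B = cong (λ z → colorsAux m h z ups B) (sym (+-identityʳ r))
  colorsAux-++ h r ups (true ∷ A) B rewrite colorsAux-++ (h + m) (suc r) ((suc r , h) ∷ ups) A B | +-suc r (size A)
    | ++-assoc (upSteps (h + m) (suc r) A) ((suc r , h) ∷ []) ups = refl
  colorsAux-++ h r ups (false ∷ A) B = cong (findUp m h ups ∷_) (colorsAux-++ (h ∸ 1) r ups A B)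

  runColors : UpSteps → ℕ → ℕ → List ℕ
  runColors U h zero = []
  runColors U h (suc k) = findUp m h U ∷ runColors U (h ∸ 1) k

  colorsAux-downs : ∀ h r ups k → colorsAux m h r ups (downs k) ≡ runColors ups h k
  colorsAux-downs h r ups zero = refl
  colorsAux-downs h r ups (suc k) = cong (findUp m h ups ∷_) (colorsAux-downs (h ∸ 1) r ups k)

  length-runColors : ∀ U h k → length (runColors U h k) ≡ k
  length-runColors U h zero = refl
  length-runColors U h (suc k) = cong suc (length-runColors U (h ∸ 1) k)

  runColors-+ : ∀ U h n1 n2 → runColors U h (n1 + n2) ≡ runColors U h n1 ++ runColors U (h ∸ n1) n2
  runColors-+ U h zero n2 = refl
  runColors-+ U h (suc n1) n2 = cong (findUp m h U ∷_)
    (trans (runColors-+ U (h ∸ 1) n1 n2) (cong (λ z → runColors U (h ∸ 1) n1 ++ runColors U z n2) (∸-+-assoc h 1 n1)))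

  drop-runColors : ∀ U j k → drop j (runColors U (j + k) (j + k)) ≡ runColors U k k
  drop-runColors U zero k = refl
  drop-runColors U (suc j) k = drop-runColors U j k

  lastN-runColors : ∀ U h k → k ≤ h → lastN k (runColors U h h) ≡ runColors U k k
  lastN-runColors U h k le rewrite length-runColors U h h = subst
    (λ z → drop (z ∸ k) (runColors U z z) ≡ runColors U k k) (m∸n+n≡m le)
    (trans (cong (λ z → drop z (runColors U (h ∸ k + k) (h ∸ k + k))) (m+n∸n≡m (h ∸ k) k))
      (drop-runColors U (h ∸ k) k))

  upSteps-downs : ∀ h r k → upSteps h r (downs k) ≡ []
  upSteps-downs h r zero = refl
  upSteps-downs h r (suc k) = upSteps-downs (h ∸ 1) r k

  upSteps-++ : ∀ h r A B → upSteps h r (A ++ B) ≡ upSteps (height h A) (r + size A) B ++ upSteps h r A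
  upSteps-++ h r [] B = trans (cong (λ z → upSteps h z B) (sym (+-identityʳ r))) (sym (++-identityʳ _))
  upSteps-++ h r (true ∷ A) B rewrite upSteps-++ (h + m) (suc r) A B | +-suc r (size A) = ++-assoc
    (upSteps (height (h + m) A) (suc (r + size A)) B) (upSteps (h + m) (suc r) A) _
  upSteps-++ h r (false ∷ A) B = upSteps-++ (h ∸ 1) r A B

  lastColors : ∀ X Lx → height 0 X ≡ Lx → ∀ k → k ≤ Lx →
    lastN k (downColors m (X ++ downs Lx)) ≡ runColors (upSteps 0 0 X) k k
  lastColors X Lx f k le = begin
    lastN k (colorsAux m 0 0 [] (X ++ downs Lx)) ≡⟨ cong (lastN k) (colorsAux-++ 0 0 [] X (downs Lx)) ⟩
    lastN k (colorsAux m 0 0 [] X ++ colorsAux m (height 0 X) (size X) (upSteps 0 0 X ++ []) (downs Lx)) ≡⟨ cong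
      (λ z → lastN k (colorsAux m 0 0 [] X ++ z)) (colorsAux-downs (height 0 X) (size X) (upSteps 0 0 X ++ []) Lx) ⟩
    lastN k (colorsAux m 0 0 [] X ++ runColors (upSteps 0 0 X ++ []) (height 0 X) Lx) ≡⟨ cong₂
      (λ u v → lastN k (colorsAux m 0 0 [] X ++ runColors v u Lx)) f (++-identityʳ _) ⟩
    lastN k (colorsAux m 0 0 [] X ++ runColors (upSteps 0 0 X) Lx Lx)
      ≡⟨ trans (lastN-++ k (colorsAux m 0 0 [] X) (runColors (upSteps 0 0 X) Lx Lx)
        (subst (k ≤_) (sym (length-runColors _ Lx Lx)) le)) (lastN-runColors _ Lx k le) ⟩
    runColors (upSteps 0 0 X) k k ∎
    where open ≡-Reasoning

  hits : ℕ → ℕ × ℕ → Bool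
  hits z (x , y) = (y <ᵇ z) ∧ (z ≤ᵇ y + m)

  Hits : ℕ → ℕ × ℕ → Set
  Hits z p = hits z p ≡ true

  findUp-skip : ∀ k z (U1 U2 : UpSteps) → All (λ p → k ≤ proj₂ p) U1 → z ≤ k → findUp m z (U1 ++ U2) ≡ findUp m z U2
  findUp-skip k z [] U2 _ _ = refl
  findUp-skip k z ((x , y) ∷ U1) U2 (p ∷ ps) z≤k rewrite ≮⇒<ᵇ≡false {y} {z}
    (λ y<z → <⇒≱ y<z (≤-trans z≤k p)) = findUp-skip k z U1 U2 ps z≤k

  hit-exists : ∀ h r w z → h < z → z ≤ height h w → Any (Hits z) (upSteps h r w)
  hit-exists h r [] z h<z z≤ = ⊥-elim (<⇒≱ h<z z≤)
  hit-exists h r (true ∷ w) z h<z z≤ with z ≤? h + m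
  ... | yes le = AnyP.++⁺ʳ (upSteps (h + m) (suc r) w) (here (cong₂ _∧_ (<⇒<ᵇ≡true h<z) (≤⇒≤ᵇ≡true le)))
  ... | no nle = AnyP.++⁺ˡ (hit-exists (h + m) (suc r) w z (≰⇒> nle) z≤)
  hit-exists h r (false ∷ w) z h<z z≤ = hit-exists (h ∸ 1) r w z (≤-<-trans (m∸n≤m h 1) h<z) z≤

  upSteps-ranks : ∀ h r w → All (λ p → r < proj₁ p × proj₁ p ≤ r + size w) (upSteps h r w)
  upSteps-ranks h r [] = []
  upSteps-ranks h r (true ∷ w) = AllP.++⁺
    (All.map (λ (a , b) → <-trans (n<1+n r) a , ≤-trans b (≤-reflexive (sym (+-suc r (size w)))))
    (upSteps-ranks (h + m) (suc r) w))
                                   ((n<1+n r , ≤-trans (s≤s (m≤m+n r (size w)))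
                                     (≤-reflexive (sym (+-suc r (size w))))) ∷ [])
  upSteps-ranks h r (false ∷ w) = upSteps-ranks (h ∸ 1) r w

  findUp-range : ∀ z (U : UpSteps) {lo hi} → Any (Hits z) U → All (λ p → lo < proj₁ p × proj₁ p ≤ hi) U →
    lo < findUp m z U × findUp m z U ≤ hi
  findUp-range z ((x , y) ∷ U) a (p ∷ ps) with hits z (x , y) in e
  ... | true = p
  findUp-range z ((x , y) ∷ U) (here mt) (p ∷ ps) | false with () ← trans (sym mt) e
  findUp-range z ((x , y) ∷ U) (there a) (p ∷ ps) | false = findUp-range z U a ps

  shiftUp : ℕ → ℕ → ℕ × ℕ → ℕ × ℕ
  shiftUp e r0 (x , y) = (r0 + x , e + y)

  hits-shiftUp : ∀ e r0 z p → hits (e + z) (shiftUp e r0 p) ≡ hits z p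
  hits-shiftUp e r0 z (x , y) rewrite +-assoc e y m = cong₂ _∧_ (<ᵇ-cancel e y z) (≤ᵇ-cancel e z (y + m))

  findUp-shift : ∀ e r0 z (U U' : UpSteps) → Any (Hits z) U →
    findUp m (e + z) (map (shiftUp e r0) U ++ U') ≡ r0 + findUp m z U
  findUp-shift e r0 z ((x , y) ∷ U) U' a rewrite hits-shiftUp e r0 z (x , y) with hits z (x , y) in eq
  ... | true = refl
  findUp-shift e r0 z ((x , y) ∷ U) U' (here mt) | false with () ← trans (sym mt) eq
  findUp-shift e r0 z ((x , y) ∷ U) U' (there a) | false = findUp-shift e r0 z U U' a

  upSteps-shift : ∀ e r0 h0 r w → aboveAxis h0 w ≡ true →
    upSteps (e + h0) (r0 + r) w ≡ map (shiftUp e r0) (upSteps h0 r w)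
  upSteps-shift e r0 h0 r [] _ = refl
  upSteps-shift e r0 h0 r (true ∷ w) o rewrite +-assoc e h0 m | sym (+-suc r0 r) | upSteps-shift e r0 (h0 + m)
    (suc r) w o
    | map-++ (shiftUp e r0) (upSteps (h0 + m) (suc r) w) ((suc r , h0) ∷ []) = refl
  upSteps-shift e r0 (suc h0) r (false ∷ w) o rewrite +-suc e h0 = upSteps-shift e r0 h0 r w o

  shiftUp-above : ∀ e r0 U → All (λ p → e ≤ proj₂ p) (map (shiftUp e r0) U)
  shiftUp-above e r0 [] = []
  shiftUp-above e r0 ((x , y) ∷ U) = m≤m+n e y ∷ shiftUp-above e r0 U

  path-upSteps : ∀ B → IsPath B → ∀ e r → upSteps e r B ≡ map (shiftUp e r) (upSteps 0 0 B)
  path-upSteps B b e r = subst₂ (λ u v → upSteps u v B ≡ map (shiftUp e r) (upSteps 0 0 B)) (+-identityʳ e)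
    (+-identityʳ r)
    (upSteps-shift e r 0 0 B (proj₁ (valid⇒aboveAxis×height 0 B b)))

  path-upSteps-above : ∀ B → IsPath B → ∀ e r → All (λ p → e ≤ proj₂ p) (upSteps e r B)
  path-upSteps-above B b e r rewrite path-upSteps B b e r = shiftUp-above e r _

  interleavePrefix-height : ∀ y Bs → All IsPath Bs → length y ≡ length Bs → ∀ e →
    height (e + sum y) (interleavePrefix y Bs) ≡ e × aboveAxis (e + sum y) (interleavePrefix y Bs) ≡ true
  interleavePrefix-height [] [] _ _ e = +-identityʳ e , refl
  interleavePrefix-height (a ∷ y) (B ∷ Bs) (b ∷ bs) len e = f , o
    where
    IH = interleavePrefix-height y Bs bs (suc-injective len) e
    h1 : height (e + (a + sum y)) (downs a) ≡ e + sum y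
    h1 = trans (height-downs _ a) (+-+-∸ e a (sum y))
    h2 : height (e + sum y) B ≡ e + sum y
    h2 = path-height B b (e + sum y)
    f : height (e + (a + sum y)) (downs a ++ B ++ interleavePrefix y Bs) ≡ e
    f rewrite height-++ (e + (a + sum y)) (downs a) (B ++ interleavePrefix y Bs) | h1 | height-++ (e + sum y) B
      (interleavePrefix y Bs) | h2 = proj₁ IH
    o : aboveAxis (e + (a + sum y)) (downs a ++ B ++ interleavePrefix y Bs) ≡ true
    o = aboveAxis-++⁺ _ (downs a) _ (aboveAxis-downs _ a (≤-trans (m≤m+n a (sum y)) (m≤n+m _ e)))
          (subst (λ z → aboveAxis z (B ++ interleavePrefix y Bs) ≡ true) (sym h1)
            (aboveAxis-++⁺ _ B _ (path-aboveAxis B b _)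
            (subst (λ z → aboveAxis z (interleavePrefix y Bs) ≡ true) (sym h2) (proj₂ IH))))

  interleavePrefix-upSteps-above : ∀ y Bs → All IsPath Bs → length y ≡ length Bs → ∀ e r →
    All (λ p → e ≤ proj₂ p) (upSteps (e + sum y) r (interleavePrefix y Bs))
  interleavePrefix-upSteps-above [] [] _ _ e r = []
  interleavePrefix-upSteps-above (a ∷ y) (B ∷ Bs) (b ∷ bs) len e r rewrite upSteps-++ (e + (a + sum y)) r
    (downs a) (B ++ interleavePrefix y Bs)
    | upSteps-downs (e + (a + sum y)) r a | ++-identityʳ
      (upSteps (height (e + (a + sum y)) (downs a)) (r + size (downs a)) (B ++ interleavePrefix y Bs))
    | height-downs (e + (a + sum y)) a | +-+-∸ e a (sum y) | upSteps-++ (e + sum y) (r + size (downs a)) B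
      (interleavePrefix y Bs) | path-height B b (e + sum y)
    = AllP.++⁺ (interleavePrefix-upSteps-above y Bs bs (suc-injective len) e _)
      (All.map (λ le → ≤-trans (m≤m+n e (sum y)) le) (path-upSteps-above B b (e + sum y) _))

  runColors-All : ∀ (P : ℕ → Set) U k → (∀ z → 1 ≤ z → z ≤ k → P (findUp m z U)) → All P (runColors U k k)
  runColors-All P U zero f = []
  runColors-All P U (suc k) f = f (suc k) (s≤s z≤n) ≤-refl ∷ runColors-All P U k
    (λ z a b → f z a (≤-trans b (n≤1+n k)))

  runColors-cong : ∀ U V k → (∀ z → 1 ≤ z → z ≤ k → findUp m z U ≡ findUp m z V) → runColors U k k ≡ runColors V k k
  runColors-cong U V zero f = refl
  runColors-cong U V (suc k) f = cong₂ _∷_ (f (suc k) (s≤s z≤n) ≤-refl)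
    (runColors-cong U V k (λ z a b → f z a (≤-trans b (n≤1+n k))))

  runColors-shift : ∀ U V c r k → (∀ z → 1 ≤ z → z ≤ k → findUp m (c + z) U ≡ r + findUp m z V) →
    runColors U (c + k) k ≡ map (r +_) (runColors V k k)
  runColors-shift U V c r zero f = refl
  runColors-shift U V c r (suc k) f = cong₂ _∷_ (f (suc k) (s≤s z≤n) ≤-refl)
    (trans (cong (λ z → runColors U z k) (trans (cong (_∸ 1) (+-suc c k)) refl))
      (runColors-shift U V c r k (λ z a b → f z a (≤-trans b (n≤1+n k)))))

  runColors-range : ∀ X Lx → height 0 X ≡ Lx → ∀ k → k ≤ Lx →
    All (λ a → 1 ≤ a × a ≤ size X) (runColors (upSteps 0 0 X) k k)
  runColors-range X Lx f k le = runColors-All _ (upSteps 0 0 X) k λ z a b →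
    findUp-range z (upSteps 0 0 X) (hit-exists 0 0 X z a (≤-trans b (≤-trans le (≤-reflexive (sym f)))))
      (upSteps-ranks 0 0 X)

  inΛ≡topMult : ∀ i X Lx lam → height 0 X ≡ Lx → 1 ≤ size X → lastOr0 lam ≤ Lx →
    inΛ m i (X ++ downs Lx) lam ≡ (topMult m (X ++ downs Lx) (lastOr0 lam) ≡ᵇ i)
  inΛ≡topMult i X Lx lam f s le rewrite size-++ X (downs Lx) | size-downs Lx | +-identityʳ (size X)
    = Λ-test≡maxMult i (size X) (lastN (lastOr0 lam) (downColors m (X ++ downs Lx))) s
        (subst (All (λ a → 1 ≤ a × a ≤ size X)) (sym (lastColors X Lx f (lastOr0 lam) le))
          (runColors-range X Lx f (lastOr0 lam) le))

  topMult≡maxMult-runColors : ∀ X Lx → height 0 X ≡ Lx → ∀ k → k ≤ Lx →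
    topMult m (X ++ downs Lx) k ≡ maxMult (runColors (upSteps 0 0 X) k k)
  topMult≡maxMult-runColors X Lx f k le = cong maxMult (lastColors X Lx f k le)

  UniqueRanks : UpSteps → Set
  UniqueRanks U = ∀ {p q} → p ∈ U → q ∈ U → proj₁ p ≡ proj₁ q → p ≡ q

  upSteps-unique : ∀ h r w → UniqueRanks (upSteps h r w)
  upSteps-unique h r [] ()
  upSteps-unique h r (true ∷ w) pm qm e with AnyP.++⁻ (upSteps (h + m) (suc r) w) pm | AnyP.++⁻
    (upSteps (h + m) (suc r) w) qm
  ... | inj₁ a | inj₁ b = upSteps-unique (h + m) (suc r) w a b e
  ... | inj₂ (here refl) | inj₂ (here refl) = refl
  ... | inj₁ a | inj₂ (here refl) = ⊥-elim (<-irrefl (sym e) (proj₁ (All.lookup (upSteps-ranks (h + m) (suc r) w) a)))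
  ... | inj₂ (here refl) | inj₁ b = ⊥-elim (<-irrefl e (proj₁ (All.lookup (upSteps-ranks (h + m) (suc r) w) b)))
  upSteps-unique h r (false ∷ w) = upSteps-unique (h ∸ 1) r w

  findUp-∈ : ∀ z (U : UpSteps) → Any (Hits z) U → Σ (ℕ × ℕ) λ p → p ∈ U × Hits z p × proj₁ p ≡ findUp m z U
  findUp-∈ z ((x , y) ∷ U) a with hits z (x , y) in e
  ... | true = (x , y) , here refl , e , refl
  findUp-∈ z ((x , y) ∷ U) (here mt) | false with () ← trans (sym mt) e
  findUp-∈ z ((x , y) ∷ U) (there a) | false with findUp-∈ z U a
  ... | p , pm , mt , r = p , there pm , mt , r

  indicator : Bool → ℕ
  indicator true = 1
  indicator false = 0

  hitCount : ℕ → ℕ × ℕ → ℕ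
  hitCount zero p = 0
  hitCount (suc k) p = indicator (hits (suc k) p) + hitCount k p

  hitCount-∸ : ∀ k x Y → hitCount k (x , Y) ≤ k ∸ Y
  hitCount-∸ zero x Y = z≤n
  hitCount-∸ (suc k) x Y with Y <? suc k
  ... | yes (s≤s Y≤k) rewrite +-∸-assoc 1 Y≤k with hits (suc k) (x , Y)
  ...   | true = s≤s (hitCount-∸ k x Y)
  ...   | false = ≤-trans (hitCount-∸ k x Y) (n≤1+n _)
  hitCount-∸ (suc k) x Y | no nlt rewrite ≮⇒<ᵇ≡false nlt = ≤-trans (hitCount-∸ k x Y) (∸-monoˡ-≤ Y (n≤1+n k))

  -- An up step of height m meets the half-lines of at most m steps of a run, hence topMult ≤ m.
  hitCount≤m : ∀ k x Y → hitCount k (x , Y) ≤ m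
  hitCount≤m zero x Y = z≤n
  hitCount≤m (suc k) x Y with suc k ≤? Y + m
  ... | yes le = ≤-trans (hitCount-∸ (suc k) x Y) (≤-trans (∸-monoˡ-≤ Y le) (≤-reflexive (m+n∸m≡n Y m)))
  ... | no nle rewrite ≰⇒≤ᵇ≡false nle with Y <ᵇ suc k
  ...   | true = hitCount≤m k x Y
  ...   | false = hitCount≤m k x Y

  count-runColors≤hitCount : ∀ U x p0 → p0 ∈ U → proj₁ p0 ≡ x → UniqueRanks U → ∀ k →
    (∀ z → 1 ≤ z → z ≤ k → Any (Hits z) U) → count x (runColors U k k) ≤ hitCount k p0
  count-runColors≤hitCount U x p0 p0m px uq zero cv = z≤n
  count-runColors≤hitCount U x p0 p0m px uq (suc k) cv with x ≟ findUp m (suc k) U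
  ... | no ne rewrite ≢⇒≡ᵇ≡false ne = ≤-trans
    (count-runColors≤hitCount U x p0 p0m px uq k (λ z a b → cv z a (≤-trans b (n≤1+n k)))) (m≤n+m _ _)
  ... | yes e rewrite ≡⇒≡ᵇ≡true e with findUp-∈ (suc k) U (cv (suc k) (s≤s z≤n) ≤-refl)
  ...   | p , pm , mt , r with uq pm p0m (trans r (trans (sym e) (sym px)))
  ...     | refl rewrite mt = s≤s
    (count-runColors≤hitCount U x p0 p0m px uq k (λ z a b → cv z a (≤-trans b (n≤1+n k))))

  topMult≤m : ∀ X Lx → height 0 X ≡ Lx → ∀ k → k ≤ Lx → topMult m (X ++ downs Lx) k ≤ m
  topMult≤m X Lx f k le rewrite topMult≡maxMult-runColors X Lx f k le = maxCountOn-lub (runColors U k k)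
    (runColors U k k) (runColors-All _ U k λ z a b →
      let (p , pm , mt , r) = findUp-∈ z U (cv z a b) in
      ≤-trans (count-runColors≤hitCount U (findUp m z U) p pm r (upSteps-unique 0 0 X) k cv)
        (hitCount≤m k (proj₁ p) (proj₂ p)))
    where
    U = upSteps 0 0 X
    cv : ∀ z → 1 ≤ z → z ≤ k → Any (Hits z) U
    cv z a b = hit-exists 0 0 X z a (≤-trans b (≤-trans le (≤-reflexive (sym f))))

  concat-paths-height : ∀ Bs → All IsPath Bs → ∀ e → height e (concat Bs) ≡ e × aboveAxis e (concat Bs) ≡ true
  concat-paths-height [] [] e = refl , refl
  concat-paths-height (B ∷ Bs) (b ∷ bs) e rewrite height-++ e B (concat Bs) | path-height B b e =
    proj₁ (concat-paths-height Bs bs e) , aboveAxis-++⁺ e B (concat Bs) (path-aboveAxis B b e)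
      (subst (λ z → aboveAxis z (concat Bs) ≡ true) (sym (path-height B b e)) (proj₂ (concat-paths-height Bs bs e)))

  module LastFactorColors (Qinit : List Word) (Qinit-paths : All IsPath Qinit)
                          (Qtop : Word) (b : ℕ) (aboveAxis-Qtop : aboveAxis 0 Qtop ≡ true) (height-Qtop : height 0 Qtop ≡ b) where
    topQ = concat Qinit ++ Qtop
    height-topQ : height 0 topQ ≡ b
    height-topQ rewrite height-++ 0 (concat Qinit) Qtop | proj₁
      (concat-paths-height Qinit Qinit-paths 0) = height-Qtop
    upsQ = upSteps 0 0 Qtop
    topMult-topQ : ∀ k → k ≤ b → topMult m (topQ ++ downs b) k ≡ maxMult (runColors upsQ k k)
    topMult-topQ k le = trans (topMult≡maxMult-runColors topQ b height-topQ k le)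
      (trans (cong maxMult (runColors-shift (upSteps 0 0 topQ) upsQ 0 (size (concat Qinit)) k shiftedHit))
      (maxMult-shift (size (concat Qinit)) (runColors upsQ k k)))
      where
      upSteps-topQ : upSteps 0 0 topQ ≡ map (shiftUp 0 (size (concat Qinit))) upsQ ++ upSteps 0 0 (concat Qinit)
      upSteps-topQ rewrite upSteps-++ 0 0 (concat Qinit) Qtop | proj₁ (concat-paths-height Qinit Qinit-paths 0) =
        cong (_++ upSteps 0 0 (concat Qinit))
          (subst (λ w → upSteps 0 w Qtop ≡ map (shiftUp 0 (size (concat Qinit))) upsQ) (+-identityʳ _)
          (upSteps-shift 0 (size (concat Qinit)) 0 0 Qtop aboveAxis-Qtop))
      shiftedHit : ∀ z → 1 ≤ z → z ≤ k → findUp m (0 + z) (upSteps 0 0 topQ) ≡ size (concat Qinit) + findUp m z upsQ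
      shiftedHit z a bz rewrite upSteps-topQ = findUp-shift 0 (size (concat Qinit)) z upsQ _
        (hit-exists 0 0 Qtop z a (≤-trans bz (≤-trans le (≤-reflexive (sym height-Qtop)))))

  module ConcatColors (topP : Word) (a : ℕ) (height-top-P : height 0 topP ≡ a)
                      (Qinit : List Word) (Qinit-paths : All IsPath Qinit)
                      (Qtop : Word) (b : ℕ) (aboveAxis-Qtop : aboveAxis 0 Qtop ≡ true) (height-Qtop : height 0 Qtop ≡ b)
                      (y : List ℕ) (v c : ℕ) (len : length y ≡ length Qinit) (a-split : a ≡ (v + c) + sum y) where
    open LastFactorColors Qinit Qinit-paths Qtop b aboveAxis-Qtop height-Qtop public
    topT = topP ++ interleavePrefix y Qinit ++ downs v ++ Qtop
    upsP = upSteps 0 0 topP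
    rankOffset = size topP + size (interleavePrefix y Qinit)
    upsMiddle = upSteps a (size topP) (interleavePrefix y Qinit)

    height-middle : height a (interleavePrefix y Qinit) ≡ v + c
    height-middle rewrite a-split = proj₁ (interleavePrefix-height y Qinit Qinit-paths len (v + c))
    height-gap : height (v + c) (downs v) ≡ c
    height-gap = trans (height-downs (v + c) v) (m+n∸m≡n v c)

    height-topT : height 0 topT ≡ b + c
    height-topT rewrite height-++ 0 topP (interleavePrefix y Qinit ++ downs v ++ Qtop) | height-top-P | height-++ a
      (interleavePrefix y Qinit) (downs v ++ Qtop) | height-middle
       | height-++ (v + c) (downs v) Qtop | height-gap = trans
         (subst (λ z → height z Qtop ≡ c + height 0 Qtop) (+-identityʳ c) (height-shift c 0 Qtop aboveAxis-Qtop))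
         (trans (cong (c +_) height-Qtop) (+-comm c b))

    upSteps-topT : upSteps 0 0 topT ≡ map (shiftUp c rankOffset) upsQ ++ (upsMiddle ++ upsP)
    upSteps-topT rewrite upSteps-++ 0 0 topP (interleavePrefix y Qinit ++ downs v ++ Qtop) | height-top-P |
      upSteps-++ a (size topP)
      (interleavePrefix y Qinit) (downs v ++ Qtop) | height-middle
       | upSteps-++ (v + c) (size topP + size (interleavePrefix y Qinit)) (downs v) Qtop | height-gap | upSteps-downs
         (v + c) (size topP + size (interleavePrefix y Qinit)) v
       | ++-identityʳ (upSteps c (size topP + size (interleavePrefix y Qinit) + size (downs v)) Qtop) | size-downs
         v | +-identityʳ (size topP + size (interleavePrefix y Qinit))
       = trans (++-assoc (upSteps c rankOffset Qtop) upsMiddle upsP)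
         (cong (_++ (upsMiddle ++ upsP))
           (subst₂ (λ u w → upSteps u w Qtop ≡ map (shiftUp c rankOffset) upsQ) (+-identityʳ c)
           (+-identityʳ rankOffset) (upSteps-shift c rankOffset 0 0 Qtop aboveAxis-Qtop)))

    upsMiddle-above : All (λ p → c ≤ proj₂ p) upsMiddle
    upsMiddle-above rewrite a-split = All.map (λ le → ≤-trans (m≤n+m c v) le)
      (interleavePrefix-upSteps-above y Qinit Qinit-paths len (v + c) (size topP))

    runColors-topT-low : ∀ k → k ≤ c → runColors (upSteps 0 0 topT) k k ≡ runColors upsP k k
    runColors-topT-low k le rewrite upSteps-topT = runColors-cong _ upsP k λ z _ zk →
      trans (findUp-skip c z (map (shiftUp c rankOffset) upsQ) (upsMiddle ++ upsP)
        (shiftUp-above c rankOffset upsQ) (≤-trans zk le))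
            (findUp-skip c z upsMiddle upsP upsMiddle-above (≤-trans zk le))

    runColors-topT-high : ∀ k' → k' ≤ b →
      runColors (upSteps 0 0 topT) (c + k') (c + k') ≡ map (rankOffset +_)
      (runColors upsQ k' k') ++ runColors upsP c c
    runColors-topT-high k' le = begin
      runColors U (c + k') (c + k') ≡⟨ cong (runColors U (c + k')) (+-comm c k') ⟩
      runColors U (c + k') (k' + c) ≡⟨ runColors-+ U (c + k') k' c ⟩
      runColors U (c + k') k' ++ runColors U ((c + k') ∸ k') c ≡⟨ cong
        (λ z → runColors U (c + k') k' ++ runColors U z c) (m+n∸n≡m c k') ⟩
      runColors U (c + k') k' ++ runColors U c c ≡⟨ cong₂ _++_ (runColors-shift U upsQ c rankOffset k' shiftedHit)
        (runColors-topT-low c ≤-refl) ⟩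
      map (rankOffset +_) (runColors upsQ k' k') ++ runColors upsP c c ∎
      where
      open ≡-Reasoning
      U = upSteps 0 0 topT
      shiftedHit : ∀ z → 1 ≤ z → z ≤ k' → findUp m (c + z) U ≡ rankOffset + findUp m z upsQ
      shiftedHit z a bz rewrite upSteps-topT = findUp-shift c rankOffset z upsQ (upsMiddle ++ upsP)
        (hit-exists 0 0 Qtop z a (≤-trans bz (≤-trans le (≤-reflexive (sym height-Qtop)))))

    c≤a : c ≤ a
    c≤a = ≤-trans (m≤n+m c v) (≤-trans (m≤m+n (v + c) (sum y)) (≤-reflexive (sym a-split)))

    topMult-topT-low : ∀ k → k ≤ c → topMult m (topT ++ downs (b + c)) k ≡ topMult m (topP ++ downs a) k
    topMult-topT-low k k≤c = trans (topMult≡maxMult-runColors topT (b + c) height-topT k (≤-trans k≤c (m≤n+m c b)))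
      (trans (cong maxMult (runColors-topT-low k k≤c))
             (sym (topMult≡maxMult-runColors topP a height-top-P k (≤-trans k≤c c≤a))))

    -- The colours of the last c steps are ranks of P, those before them ranks of Q shifted past all of
    -- P's up steps, so the two maximal multiplicities do not interact.
    topMult-topT-high : ∀ k' → k' ≤ b →
      topMult m (topT ++ downs (b + c)) (c + k') ≡ topMult m (topP ++ downs a) c ⊔ topMult m (topQ ++ downs b) k'
    topMult-topT-high k' k'≤b = begin
      topMult m (topT ++ downs (b + c)) (c + k')
        ≡⟨ topMult≡maxMult-runColors topT (b + c) height-topT (c + k') (subst (_≤ b + c) (+-comm k' c) (+-monoˡ-≤ c k'≤b)) ⟩
      maxMult (runColors (upSteps 0 0 topT) (c + k') (c + k'))
        ≡⟨ cong maxMult (runColors-topT-high k' k'≤b) ⟩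
      maxMult (map (rankOffset +_) (runColors upsQ k' k') ++ runColors upsP c c)
        ≡⟨ maxMult-++-separated rankOffset _ _ fromQ fromP ⟩
      maxMult (map (rankOffset +_) (runColors upsQ k' k')) ⊔ maxMult (runColors upsP c c)
        ≡⟨ cong (_⊔ maxMult (runColors upsP c c)) (maxMult-shift rankOffset (runColors upsQ k' k')) ⟩
      maxMult (runColors upsQ k' k') ⊔ maxMult (runColors upsP c c)
        ≡⟨ ⊔-comm (maxMult (runColors upsQ k' k')) (maxMult (runColors upsP c c)) ⟩
      maxMult (runColors upsP c c) ⊔ maxMult (runColors upsQ k' k')
        ≡⟨ cong₂ _⊔_ (topMult≡maxMult-runColors topP a height-top-P c c≤a) (topMult-topQ k' k'≤b) ⟨
      topMult m (topP ++ downs a) c ⊔ topMult m (topQ ++ downs b) k' ∎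
      where
      open ≡-Reasoning
      fromQ : All (rankOffset <_) (map (rankOffset +_) (runColors upsQ k' k'))
      fromQ = AllP.map⁺ (All.map (λ {x} (1≤x , _) → subst (_≤ rankOffset + x) (+-comm rankOffset 1) (+-monoʳ-≤ rankOffset 1≤x))
                                 (runColors-range Qtop b height-Qtop k' k'≤b))
      fromP : All (_≤ rankOffset) (runColors upsP c c)
      fromP = All.map (λ (_ , x≤size) → ≤-trans x≤size (m≤m+n (size topP) _)) (runColors-range topP a height-top-P c c≤a)

  positive : ℕ → Word → Bool
  positive h [] = true
  positive h (true ∷ w) = positive (h + m) w
  positive zero (false ∷ w) = false
  positive (suc zero) (false ∷ w) = false
  positive (suc (suc h)) (false ∷ w) = positive (suc h) w

  positive-++ : ∀ h A B → positive h (A ++ B) ≡ positive h A ∧ positive (height h A) B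
  positive-++ h [] B = refl
  positive-++ h (true ∷ A) B = positive-++ (h + m) A B
  positive-++ zero (false ∷ A) B = refl
  positive-++ (suc zero) (false ∷ A) B = refl
  positive-++ (suc (suc h)) (false ∷ A) B = positive-++ (suc h) A B

  positive⇒aboveAxis : ∀ h w → positive h w ≡ true → aboveAxis h w ≡ true
  positive⇒aboveAxis h [] _ = refl
  positive⇒aboveAxis h (true ∷ w) p = positive⇒aboveAxis (h + m) w p
  positive⇒aboveAxis (suc (suc h)) (false ∷ w) p = positive⇒aboveAxis (suc h) w p

  aboveAxis⇒positive : ∀ j h w → aboveAxis h w ≡ true → positive (suc j + h) w ≡ true
  aboveAxis⇒positive j h [] _ = refl
  aboveAxis⇒positive j h (true ∷ w) o rewrite +-assoc (suc j) h m = aboveAxis⇒positive j (h + m) w o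
  aboveAxis⇒positive j (suc h) (false ∷ w) o rewrite +-suc j h = aboveAxis⇒positive j h w o

  factorsAux-step : ∀ h acc s w h' → (if s then h + m else h ∸ 1) ≡ suc h' →
    factorsAux m h acc (s ∷ w) ≡ factorsAux m (suc h') (s ∷ acc) w
  factorsAux-step h acc s w h' e with (if s then h + m else h ∸ 1)
  factorsAux-step h acc s w h' refl | .(suc h') = refl

  factorsAux-positive : ∀ h acc Y Z → positive h Y ≡ true →
    factorsAux m h acc (Y ++ Z) ≡ factorsAux m (height h Y) (reverse Y ++ acc) Z
  factorsAux-positive h acc [] Z _ = refl
  factorsAux-positive h acc (true ∷ Y) Z p = begin
    factorsAux m h acc (true ∷ Y ++ Z) ≡⟨ factorsAux-step h acc true (Y ++ Z) (h + m') (+-suc h m') ⟩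
    factorsAux m (suc (h + m')) (true ∷ acc) (Y ++ Z) ≡⟨ cong (λ z → factorsAux m z (true ∷ acc) (Y ++ Z))
      (sym (+-suc h m')) ⟩
    factorsAux m (h + m) (true ∷ acc) (Y ++ Z) ≡⟨ factorsAux-positive (h + m) (true ∷ acc) Y Z p ⟩
    factorsAux m (height (h + m) Y) (reverse Y ++ true ∷ acc) Z ≡⟨ cong
      (λ z → factorsAux m (height (h + m) Y) z Z)
      (trans (sym (++-assoc (reverse Y) (true ∷ []) acc)) (cong (_++ acc) (sym (unfold-reverse true Y)))) ⟩
    factorsAux m (height (h + m) Y) (reverse (true ∷ Y) ++ acc) Z ∎
    where open ≡-Reasoning
  factorsAux-positive (suc (suc h)) acc (false ∷ Y) Z p = trans (factorsAux-positive (suc h) (false ∷ acc) Y Z p)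
    (cong (λ z → factorsAux m (height (suc h) Y) z Z)
      (trans (sym (++-assoc (reverse Y) (false ∷ []) acc)) (cong (_++ acc) (sym (unfold-reverse false Y)))))

  -- A prime path returns to the axis only at its end.
  IsPrime : Word → Set
  IsPrime F = Σ Word λ U → F ≡ U ++ false ∷ [] × positive 0 U ≡ true × height 0 U ≡ 1

  factorsAux-prime : ∀ F Z → IsPrime F → factorsAux m 0 [] (F ++ Z) ≡ F ∷ factorsAux m 0 [] Z
  factorsAux-prime F Z (U , refl , p , f) rewrite ++-assoc U (false ∷ []) Z | factorsAux-positive 0 [] U
    (false ∷ Z) p | f | ++-identityʳ (reverse U)
    = cong (_∷ factorsAux m 0 [] Z)
      (trans (unfold-reverse false (reverse U)) (cong (_++ false ∷ []) (reverse-involutive U)))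

  factors-concat : ∀ Fs Z → All IsPrime Fs →
    factorsAux m 0 [] (concat Fs ++ Z) ≡ Fs ++ factorsAux m 0 [] Z
  factors-concat [] Z _ = refl
  factors-concat (F ∷ Fs) Z (p ∷ ps) rewrite ++-assoc F (concat Fs) Z | factorsAux-prime F
    (concat Fs ++ Z) p = cong (F ∷_) (factors-concat Fs Z ps)

  prime⇒path : ∀ F → IsPrime F → IsPath F
  prime⇒path F (U , refl , p , f) rewrite valid≡aboveAxis∧height 0 (U ++ false ∷ []) | aboveAxis-++ 0 U
    (false ∷ []) | positive⇒aboveAxis 0 U p | height-++ 0 U (false ∷ []) | f = refl

  FactorInv : ℕ → Word → Set
  FactorInv h acc = (h ≡ 0 × acc ≡ []) ⊎ (1 ≤ h × positive 0 (reverse acc) ≡ true × height 0 (reverse acc) ≡ h)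

  factorInv-up : ∀ h acc → FactorInv h acc → FactorInv (suc (h + m')) (true ∷ acc)
  factorInv-up h acc (inj₁ (refl , refl)) = inj₂ (s≤s z≤n , refl , refl)
  factorInv-up h acc (inj₂ (_ , p , f)) rewrite unfold-reverse true acc | positive-++ 0 (reverse acc)
    (true ∷ []) | p | height-++ 0 (reverse acc) (true ∷ []) | f = inj₂ (s≤s z≤n , refl , +-suc h m')

  factorsAux-sound : ∀ w h acc → FactorInv h acc → valid m h w ≡ true →
    All IsPrime (factorsAux m h acc w) × concat (factorsAux m h acc w) ≡ reverse acc ++ w
  factorsAux-sound [] h acc (inj₁ (refl , refl)) v = [] , refl
  factorsAux-sound [] zero acc (inj₂ (() , _)) v
  factorsAux-sound [] (suc h) acc (inj₂ _) ()
  factorsAux-sound (true ∷ w) h acc iv v rewrite factorsAux-step h acc true w (h + m')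
    (+-suc h m') with factorsAux-sound w (suc (h + m')) (true ∷ acc) (factorInv-up h acc iv)
    (subst (λ z → valid m z w ≡ true) (+-suc h m') v)
  ... | ap , ce = ap , trans ce (trans (cong (_++ w) (unfold-reverse true acc)) (++-assoc (reverse acc) (true ∷ []) w))
  factorsAux-sound (false ∷ w) zero acc iv ()
  factorsAux-sound (false ∷ w) (suc zero) acc (inj₂ (_ , p , f)) v with factorsAux-sound w 0 [] (inj₁ (refl , refl)) v
  ... | ap , ce = (reverse acc , unfold-reverse false acc , p , f) ∷ ap , trans (cong (reverse (false ∷ acc) ++_) ce)
    (trans (cong (_++ w) (unfold-reverse false acc)) (++-assoc (reverse acc) (false ∷ []) w))
  factorsAux-sound (false ∷ w) (suc (suc h)) acc (inj₂ (_ , p , f)) v with factorsAux-sound w (suc h)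
    (false ∷ acc) iv' v
    where
    iv' : FactorInv (suc h) (false ∷ acc)
    iv' rewrite unfold-reverse false acc | positive-++ 0 (reverse acc) (false ∷ []) | p | height-++ 0 (reverse acc)
      (false ∷ []) | f = inj₂ (s≤s z≤n , refl , refl)
  ... | ap , ce = ap , trans ce (trans (cong (_++ w) (unfold-reverse false acc)) (++-assoc (reverse acc) (false ∷ []) w))

  factors-sound : ∀ Q → valid m 0 Q ≡ true → All IsPrime (factors m Q) × concat (factors m Q) ≡ Q
  factors-sound Q v = factorsAux-sound Q 0 [] (inj₁ (refl , refl)) v

  downs-++-∷ : ∀ k (acc : Word) → downs k ++ false ∷ acc ≡ false ∷ downs k ++ acc
  downs-++-∷ zero acc = refl
  downs-++-∷ (suc k) acc = cong (false ∷_) (downs-++-∷ k acc)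

  factorsAux-downs : ∀ k j acc Z →
    factorsAux m (k + suc j) acc (downs k ++ Z) ≡ factorsAux m (suc j) (downs k ++ acc) Z
  factorsAux-downs zero j acc Z = refl
  factorsAux-downs (suc k) j acc Z = begin
    factorsAux m (suc (k + suc j)) acc (false ∷ downs k ++ Z) ≡⟨ factorsAux-step (suc (k + suc j)) acc false
      (downs k ++ Z) (k + j) (+-suc k j) ⟩
    factorsAux m (suc (k + j)) (false ∷ acc) (downs k ++ Z) ≡⟨ cong
      (λ z → factorsAux m z (false ∷ acc) (downs k ++ Z)) (sym (+-suc k j)) ⟩
    factorsAux m (k + suc j) (false ∷ acc) (downs k ++ Z) ≡⟨ factorsAux-downs k j (false ∷ acc) Z ⟩
    factorsAux m (suc j) (downs k ++ false ∷ acc) Z ≡⟨ cong (λ z → factorsAux m (suc j) z Z) (downs-++-∷ k acc) ⟩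
    factorsAux m (suc j) (false ∷ downs k ++ acc) Z ∎
    where open ≡-Reasoning

  factorsAux-close : ∀ k acc Z →
    factorsAux m (suc k) acc (downs (suc k) ++ Z) ≡ (reverse acc ++ downs (suc k)) ∷ factorsAux m 0 [] Z
  factorsAux-close k acc Z = begin
    factorsAux m (suc k) acc (downs (suc k) ++ Z) ≡⟨ cong₂ (λ u v → factorsAux m u acc (v ++ Z))
      (trans (cong suc (sym (+-identityʳ k))) (sym (+-suc k 0))) (sym (downs-∷ʳ k)) ⟩
    factorsAux m (k + 1) acc ((downs k ++ false ∷ []) ++ Z) ≡⟨ cong (factorsAux m (k + 1) acc)
      (++-assoc (downs k) (false ∷ []) Z) ⟩
    factorsAux m (k + 1) acc (downs k ++ false ∷ Z) ≡⟨ factorsAux-downs k 0 acc (false ∷ Z) ⟩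
    reverse (false ∷ downs k ++ acc) ∷ factorsAux m 0 [] Z ≡⟨ cong (_∷ factorsAux m 0 [] Z)
      (trans (reverse-++ (downs (suc k)) acc) (cong (reverse acc ++_) (reverse-downs (suc k)))) ⟩
    (reverse acc ++ downs (suc k)) ∷ factorsAux m 0 [] Z ∎
    where open ≡-Reasoning

  -- In Q *_λ' R the last prime factor of Q is followed by the factors of R up to the last nonzero
  -- part of λ' (firstFactorTail), and the remaining factors of R stay prime (laterFactors).
  firstFactorTail : List ℕ → List Word → Word
  firstFactorTail [] _ = []
  firstFactorTail (a ∷ as) [] = downs a
  firstFactorTail (a ∷ as) (R ∷ Rs) = if sum as ≡ᵇ 0 then downs a else downs a ++ R ++ firstFactorTail as Rs

  laterFactors : List ℕ → List Word → List Word
  laterFactors (a ∷ as) (R ∷ Rs) = if sum as ≡ᵇ 0 then R ∷ Rs else laterFactors as Rs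
  laterFactors _ _ = []

  sum≡0⇒zeros : ∀ (as : List ℕ) → sum as ≡ 0 → as ≡ replicate (length as) 0
  sum≡0⇒zeros [] _ = refl
  sum≡0⇒zeros (zero ∷ as) e = cong (0 ∷_) (sum≡0⇒zeros as e)

  factorsAux-run-prime : ∀ a j acc R Z → IsPath R →
    factorsAux m (a + suc j) acc (downs a ++ R ++ Z) ≡ factorsAux m (suc j) (reverse R ++ downs a ++ acc) Z
  factorsAux-run-prime a j acc R Z pathR = begin
    factorsAux m (a + suc j) acc (downs a ++ R ++ Z)
      ≡⟨ factorsAux-downs a j acc (R ++ Z) ⟩
    factorsAux m (suc j) (downs a ++ acc) (R ++ Z)
      ≡⟨ factorsAux-positive (suc j) (downs a ++ acc) R Z (subst (λ z → positive z R ≡ true) (+-identityʳ (suc j))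
                                                                 (aboveAxis⇒positive j 0 R (path-aboveAxis R pathR 0))) ⟩
    factorsAux m (height (suc j) R) (reverse R ++ downs a ++ acc) Z
      ≡⟨ cong (λ z → factorsAux m z (reverse R ++ downs a ++ acc) Z) (path-height R pathR (suc j)) ⟩
    factorsAux m (suc j) (reverse R ++ downs a ++ acc) Z ∎
    where open ≡-Reasoning

  factorsAux-run-close : ∀ k acc R Rs as → All IsPrime (R ∷ Rs) → sum as ≡ 0 → length as ≡ suc (length Rs) →
    factorsAux m (suc k) acc (downs (suc k) ++ R ++ interleave as Rs) ≡ (reverse acc ++ downs (suc k)) ∷ R ∷ Rs
  factorsAux-run-close k acc R Rs as primes z len = begin
    factorsAux m (suc k) acc (downs (suc k) ++ R ++ interleave as Rs)
      ≡⟨ factorsAux-close k acc (R ++ interleave as Rs) ⟩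
    closed ∷ factorsAux m 0 [] (R ++ interleave as Rs)
      ≡⟨ cong (λ w → closed ∷ factorsAux m 0 [] (R ++ interleave w Rs))
              (trans (sum≡0⇒zeros as z) (cong (λ l → replicate l 0) len)) ⟩
    closed ∷ factorsAux m 0 [] (R ++ interleave (replicate (suc (length Rs)) 0) Rs)
      ≡⟨ cong (λ w → closed ∷ factorsAux m 0 [] (R ++ w)) (interleave-zeros Rs) ⟩
    closed ∷ factorsAux m 0 [] (R ++ concat Rs)
      ≡⟨ cong (λ w → closed ∷ factorsAux m 0 [] w) (++-identityʳ (R ++ concat Rs)) ⟨
    closed ∷ factorsAux m 0 [] ((R ++ concat Rs) ++ [])
      ≡⟨ cong (closed ∷_) (trans (factors-concat (R ∷ Rs) [] primes) (++-identityʳ (R ∷ Rs))) ⟩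
    closed ∷ R ∷ Rs ∎
    where
    open ≡-Reasoning
    closed = reverse acc ++ downs (suc k)

  factors-interleave : ∀ lam' Rs acc h → All IsPrime Rs → length lam' ≡ suc (length Rs) → h ≡ sum lam' → 1 ≤ h →
    factorsAux m h acc (interleave lam' Rs) ≡ (reverse acc ++ firstFactorTail lam' Rs) ∷ laterFactors lam' Rs
  factors-interleave (a ∷ []) [] acc h _ _ e h≥1 = trans
    (cong (λ z → factorsAux m z acc (downs a)) (trans e (+-identityʳ a)))
    (single a (subst (1 ≤_) (trans e (+-identityʳ a)) h≥1))
    where
    single : ∀ a → 1 ≤ a → factorsAux m a acc (downs a) ≡ (reverse acc ++ downs a) ∷ []
    single (suc k) _ = trans (cong (factorsAux m (suc k) acc) (sym (++-identityʳ (downs (suc k)))))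
      (factorsAux-close k acc [])
  factors-interleave (a ∷ as) (R ∷ Rs) acc h (pR ∷ ps) len e h≥1 with sum as ≟ 0
  ... | yes z rewrite z | e | +-identityʳ a = closing a h≥1
    where
    closing : ∀ a → 1 ≤ a → factorsAux m a acc (downs a ++ R ++ interleave as Rs) ≡ (reverse acc ++ downs a) ∷ R ∷ Rs
    closing (suc k) _ = factorsAux-run-close k acc R Rs as (pR ∷ ps) z (suc-injective len)
  ... | no nz rewrite ≢⇒≡ᵇ≡false nz = continuing (sum as) refl
    where
    continuing : ∀ s → s ≡ sum as → factorsAux m h acc (downs a ++ R ++ interleave as Rs)
                                    ≡ (reverse acc ++ downs a ++ R ++ firstFactorTail as Rs) ∷ laterFactors as Rs
    continuing zero s0 = ⊥-elim (nz (sym s0))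
    continuing (suc j) sj = begin
      factorsAux m h acc (downs a ++ R ++ interleave as Rs)
        ≡⟨ cong (λ z → factorsAux m z acc (downs a ++ R ++ interleave as Rs)) (trans e (cong (a +_) (sym sj))) ⟩
      factorsAux m (a + suc j) acc (downs a ++ R ++ interleave as Rs)
        ≡⟨ factorsAux-run-prime a j acc R (interleave as Rs) (prime⇒path R pR) ⟩
      factorsAux m (suc j) (reverse R ++ downs a ++ acc) (interleave as Rs)
        ≡⟨ factors-interleave as Rs (reverse R ++ downs a ++ acc) (suc j) ps (suc-injective len) sj (s≤s z≤n) ⟩
      (reverse (reverse R ++ downs a ++ acc) ++ firstFactorTail as Rs) ∷ laterFactors as Rs
        ≡⟨ cong (λ z → (z ++ firstFactorTail as Rs) ∷ laterFactors as Rs) (reverse-reverse-++-downs R a acc) ⟩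
      ((reverse acc ++ downs a ++ R) ++ firstFactorTail as Rs) ∷ laterFactors as Rs
        ≡⟨ cong (_∷ laterFactors as Rs) (++-assoc₃ (reverse acc) (downs a) R (firstFactorTail as Rs)) ⟩
      (reverse acc ++ downs a ++ R ++ firstFactorTail as Rs) ∷ laterFactors as Rs ∎
      where open ≡-Reasoning

  length-laterFactors : ∀ lam' Rs → length lam' ≡ suc (length Rs) → length (laterFactors lam' Rs) ≡ trailingZeros lam'
  length-laterFactors (a ∷ []) [] _ = refl
  length-laterFactors (a ∷ as) (R ∷ Rs) len with sum as ≟ 0
  ... | yes z rewrite z = sym (suc-injective len)
  ... | no nz rewrite ≢⇒≡ᵇ≡false nz = length-laterFactors as Rs (suc-injective len)

  firstFactorTail-graft : ∀ lam' Rs ℓ → length lam' ≡ suc (length Rs) → length ℓ ≡ suc (trailingZeros lam') →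
    firstFactorTail lam' Rs ++ interleave ℓ (laterFactors lam' Rs) ≡ interleave (graft lam' ℓ) Rs
  firstFactorTail-graft (a ∷ []) [] (e ∷ []) _ _ = sym (downs-+ a e)
  firstFactorTail-graft (a ∷ as) (R ∷ Rs) ℓ len lℓ with sum as ≟ 0
  firstFactorTail-graft (a ∷ as) (R ∷ Rs) (e ∷ ℓ') len lℓ | yes z rewrite z = trans
    (sym (++-assoc (downs a) (downs e) _)) (cong (_++ R ++ interleave ℓ' Rs) (sym (downs-+ a e)))
  firstFactorTail-graft (a ∷ as) (R ∷ Rs) ℓ len lℓ | no nz rewrite ≢⇒≡ᵇ≡false nz =
    trans (trans (++-assoc (downs a) _ _) (cong (downs a ++_) (++-assoc R _ _)))
      (cong (λ z → downs a ++ R ++ z) (firstFactorTail-graft as Rs ℓ (suc-injective len) lℓ))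

  record TopSplit (X : Word) : Set where
    field
      top : Word
      run : ℕ
      split : X ≡ top ++ downs run
      L≡run : L X ≡ run
      height-top : height 0 top ≡ run
      size-top : 1 ≤ size top

  topSplit : ∀ X → IsDyck m X → TopSplit X
  topSplit X (v , s) with lastUp-split X s
  ... | Y , k , e = record
    { top = Y ++ true ∷ [] ; run = k ; split = trans e (sym (++-assoc Y (true ∷ []) (downs k)))
    ; L≡run = trans (cong L e) (L-lastUp Y k)
    ; height-top = proj₁ (topPart-height Y k (subst (λ z → valid m 0 z ≡ true) e v))
    ; size-top = size-lastUp Y }

  record LastFactorSplit (Q : Word) : Set where
    field
      Qinit : List Word
      Qlast : Word
      factors-Q : factors m Q ≡ Qinit ++ Qlast ∷ []
      Qinit-prime : All IsPrime Qinit
      Qbody : Word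
      b : ℕ
      Qlast-split : Qlast ≡ Qbody ++ true ∷ downs b
    Qtop : Word
    Qtop = Qbody ++ true ∷ []
    topQ : Word
    topQ = concat Qinit ++ Qtop
    field
      Q-split : Q ≡ topQ ++ downs b
      L-Q : L Q ≡ b
      height-Qtop : height 0 Qtop ≡ b
      aboveAxis-Qtop : aboveAxis 0 Qtop ≡ true
      positive-Qtop : positive 0 Qtop ≡ true
      b≥1 : 1 ≤ b
      size-topQ : 1 ≤ size topQ

  concat-∷ʳ : ∀ (Qinit : List Word) Qlast → concat (Qinit ++ Qlast ∷ []) ≡ concat Qinit ++ Qlast
  concat-∷ʳ [] Qlast = ++-identityʳ Qlast
  concat-∷ʳ (F ∷ Qinit) Qlast = trans (cong (F ++_) (concat-∷ʳ Qinit Qlast)) (sym (++-assoc F _ _))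

  lastFactor-positive : ∀ Qlast Qbody b → IsPrime Qlast → Qlast ≡ Qbody ++ true ∷ downs b →
    positive 0 (Qbody ++ true ∷ []) ≡ true × 1 ≤ b
  lastFactor-positive Qlast Qbody zero (U , fB , pB , _) fe with () ← proj₂ (∷ʳ-injective U Qbody (trans (sym fB) fe))
  lastFactor-positive Qlast Qbody (suc b') (U , fB , pB , _) fe = ∧-conicalˡ _ _
    (trans (sym (positive-++ 0 (Qbody ++ true ∷ []) (downs b'))) (subst (λ z → positive 0 z ≡ true) e2 pB)) , s≤s z≤n
    where
    e1 : U ∷ʳ false ≡ (Qbody ++ true ∷ downs b') ∷ʳ false
    e1 = trans (sym fB) (trans fe (trans (cong (λ z → Qbody ++ true ∷ z) (sym (downs-∷ʳ b')))
                                         (sym (++-assoc Qbody (true ∷ downs b') (false ∷ [])))))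
    e2 : U ≡ (Qbody ++ true ∷ []) ++ downs b'
    e2 = trans (proj₁ (∷ʳ-injective U _ e1)) (sym (++-assoc Qbody (true ∷ []) (downs b')))

  size-prime : ∀ F → IsPrime F → 1 ≤ size F
  size-prime _ (true ∷ _ , refl , _ , _) = s≤s z≤n
  size-prime _ (false ∷ _ , refl , () , _)
  size-prime _ ([] , refl , _ , ())

  lastFactorSplit : ∀ Q → IsDyck m Q → LastFactorSplit Q
  lastFactorSplit Q (valid-Q , size-Q) = build (factors m Q) refl
    where
    sound = factors-sound Q valid-Q
    build : ∀ Fs → factors m Q ≡ Fs → LastFactorSplit Q
    build [] e = ⊥-elim (<⇒≱ size-Q (≤-reflexive (cong size (trans (sym (proj₂ sound)) (cong concat e)))))
    build (F ∷ Fs) e with init-last (F ∷ Fs) (s≤s z≤n)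
    ... | Qinit , Qlast , e' = record
        { Qinit = Qinit ; Qlast = Qlast ; factors-Q = factors≡ ; Qinit-prime = proj₁ primes
        ; Qbody = Qbody ; b = b ; Qlast-split = last-split ; Q-split = Q-split
        ; L-Q = trans (cong L (trans Q-concat (trans (cong (concat Qinit ++_) last-split) (sym (++-assoc (concat Qinit) Qbody _)))))
                      (L-lastUp (concat Qinit ++ Qbody) b)
        ; height-Qtop = proj₁ top ; aboveAxis-Qtop = proj₂ top
        ; positive-Qtop = proj₁ positivity ; b≥1 = proj₂ positivity
        ; size-topQ = subst (1 ≤_) (sym (size-++ (concat Qinit) (Qbody ++ true ∷ []))) (≤-trans (size-lastUp Qbody) (m≤n+m _ _)) }
      where
      factors≡ = trans e e'
      primes = AllP.++⁻ Qinit (subst (All IsPrime) factors≡ (proj₁ sound))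
      Qlast-prime : IsPrime Qlast
      Qlast-prime with proj₂ primes
      ... | p ∷ [] = p
      Q-concat : Q ≡ concat Qinit ++ Qlast
      Q-concat = trans (sym (proj₂ sound)) (trans (cong concat factors≡) (concat-∷ʳ Qinit Qlast))
      lastUp = lastUp-split Qlast (size-prime Qlast Qlast-prime)
      Qbody = proj₁ lastUp
      b = proj₁ (proj₂ lastUp)
      last-split : Qlast ≡ Qbody ++ true ∷ downs b
      last-split = proj₂ (proj₂ lastUp)
      top = topPart-height Qbody b (subst (λ z → valid m 0 z ≡ true) last-split (prime⇒path Qlast Qlast-prime))
      Q-split : Q ≡ (concat Qinit ++ Qbody ++ true ∷ []) ++ downs b
      Q-split = trans Q-concat (trans (cong (concat Qinit ++_) (trans last-split (sym (++-assoc Qbody (true ∷ []) (downs b)))))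
                                      (sym (++-assoc (concat Qinit) _ _)))
      positivity = lastFactor-positive Qlast Qbody b Qlast-prime last-split

-- Expansion of both sides

-- The weight g' of a word is arbitrary; it is instantiated with the indicator of a fixed word.
module Expansion (m' : ℕ) (P Q R : Word) (dP : IsDyck (suc m') P) (dQ : IsDyck (suc m') Q) (dR : IsDyck (suc m') R)
                 (g' : Word → ℕ) where
  open Slope m'
  open TopSplit (topSplit P dP) renaming (top to topP; run to a; split to P-split; L≡run to L-P;
                                          height-top to height-topP; size-top to size-topP)
  open LastFactorSplit (lastFactorSplit Q dQ)
  Qinit-paths : All IsPath Qinit
  Qinit-paths = All.map (λ {F} p → prime⇒path F p) Qinit-prime
  open LastFactorColors Qinit Qinit-paths Qtop b aboveAxis-Qtop height-Qtop using (height-topQ)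
  Rs = factors m R
  pRs : All IsPrime Rs
  pRs = proj₁ (factors-sound R (proj₁ dR))
  s = suc (length Qinit)
  t = length Rs
  Blocks = Qinit ++ Qtop ∷ Rs
  g : List ℕ → ℕ
  g v = g' (topP ++ interleave v Blocks)
  multP = topMult m P
  multQ = topMult m Q
  open Interchange multP multQ (topMult-mono m P) (topMult-0 m Q) public

  inΛ-P : ∀ i lam → lastOr0 lam ≤ a → inΛ m i P lam ≡ (multP (lastOr0 lam) ≡ᵇ i)
  inΛ-P i lam le = subst (λ X → inΛ m i X lam ≡ (topMult m X (lastOr0 lam) ≡ᵇ i)) (sym P-split)
    (inΛ≡topMult i topP a lam height-topP size-topP le)

  inΛ-Q : ∀ i lam → lastOr0 lam ≤ b → inΛ m i Q lam ≡ (multQ (lastOr0 lam) ≡ᵇ i)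
  inΛ-Q i lam le = subst (λ X → inΛ m i X lam ≡ (topMult m X (lastOr0 lam) ≡ᵇ i)) (sym Q-split)
    (inΛ≡topMult i topQ b lam height-topQ size-topQ le)

  rightFactors : List ℕ → List Word
  rightFactors lam' = Qinit ++ (Qtop ++ firstFactorTail lam' Rs) ∷ laterFactors lam' Rs

  factors-right : ∀ lam' → length lam' ≡ suc t → sum lam' ≡ b →
    factors m (topQ ++ interleave lam' Rs) ≡ rightFactors lam'
  factors-right lam' len sm = begin
    factorsAux m 0 [] ((concat Qinit ++ Qtop) ++ interleave lam' Rs) ≡⟨ cong (factorsAux m 0 [])
      (++-assoc (concat Qinit) Qtop _) ⟩
    factorsAux m 0 [] (concat Qinit ++ Qtop ++ interleave lam' Rs) ≡⟨ factors-concat Qinit _ Qinit-prime ⟩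
    Qinit ++ factorsAux m 0 [] (Qtop ++ interleave lam' Rs) ≡⟨ cong (Qinit ++_)
      (factorsAux-positive 0 [] Qtop (interleave lam' Rs) positive-Qtop) ⟩
    Qinit ++ factorsAux m (height 0 Qtop) (reverse Qtop ++ []) (interleave lam' Rs) ≡⟨ cong₂
      (λ u w → Qinit ++ factorsAux m u w (interleave lam' Rs)) height-Qtop (++-identityʳ _) ⟩
    Qinit ++ factorsAux m b (reverse Qtop) (interleave lam' Rs) ≡⟨ cong (Qinit ++_)
      (factors-interleave lam' Rs (reverse Qtop) b pRs len (sym sm) b≥1) ⟩
    Qinit ++ (reverse (reverse Qtop) ++ firstFactorTail lam' Rs) ∷ laterFactors lam' Rs ≡⟨ cong
      (λ z → Qinit ++ (z ++ firstFactorTail lam' Rs) ∷ laterFactors lam' Rs) (reverse-involutive Qtop) ⟩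
    rightFactors lam' ∎
    where open ≡-Reasoning

  length-rightFactors : ∀ lam' → length lam' ≡ suc t →
    length (rightFactors lam') ≡ length Qinit + suc (trailingZeros lam')
  length-rightFactors lam' len = trans (length-++ Qinit)
    (cong (λ z → length Qinit + suc z) (length-laterFactors lam' Rs len))

  interleave-graft : ∀ lam' lam → length lam' ≡ suc t → length lam ≡ s + suc (trailingZeros lam') →
    interleave lam (rightFactors lam') ≡ interleave (take s lam ++ graft lam' (drop s lam)) Blocks
  interleave-graft lam' lam len lenl = begin
    interleave lam (Qinit ++ G ∷ laterFactors lam' Rs) ≡⟨ cong₂ interleave (sym (take++drop≡id s lam))
      (sym (++-assoc Qinit (G ∷ []) (laterFactors lam' Rs))) ⟩
    interleave (take s lam ++ drop s lam) ((Qinit ++ G ∷ []) ++ laterFactors lam' Rs) ≡⟨ interleave-++ (take s lam)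
      (drop s lam) (Qinit ++ G ∷ []) (laterFactors lam' Rs) (trans lt (sym (length-∷ʳ Qinit G))) ⟩
    interleavePrefix (take s lam) (Qinit ++ G ∷ []) ++ interleave (drop s lam) (laterFactors lam' Rs) ≡⟨ cong
      (_++ interleave (drop s lam) (laterFactors lam' Rs))
      (interleavePrefix-extendLast (take s lam) Qinit Qtop (firstFactorTail lam' Rs) lt) ⟩
    (interleavePrefix (take s lam) (Qinit ++ Qtop ∷ []) ++ firstFactorTail lam' Rs) ++ interleave (drop s lam)
      (laterFactors lam' Rs) ≡⟨ ++-assoc (interleavePrefix (take s lam) (Qinit ++ Qtop ∷ [])) _ _ ⟩
    interleavePrefix (take s lam) (Qinit ++ Qtop ∷ []) ++ firstFactorTail lam' Rs ++ interleave (drop s lam)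
      (laterFactors lam' Rs) ≡⟨ cong (interleavePrefix (take s lam) (Qinit ++ Qtop ∷ []) ++_)
      (firstFactorTail-graft lam' Rs (drop s lam) len ld) ⟩
    interleavePrefix (take s lam) (Qinit ++ Qtop ∷ []) ++ interleave (graft lam' (drop s lam)) Rs ≡⟨ sym
      (interleave-++ (take s lam) _ (Qinit ++ Qtop ∷ []) Rs (trans lt (sym (length-∷ʳ Qinit Qtop)))) ⟩
    interleave (take s lam ++ graft lam' (drop s lam)) ((Qinit ++ Qtop ∷ []) ++ Rs) ≡⟨ cong
      (interleave (take s lam ++ graft lam' (drop s lam))) (++-assoc Qinit (Qtop ∷ []) Rs) ⟩
    interleave (take s lam ++ graft lam' (drop s lam)) Blocks ∎
    where
    open ≡-Reasoning
    G = Qtop ++ firstFactorTail lam' Rs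
    lt : length (take s lam) ≡ s
    lt = length-take-≤ s lam (≤-trans (m≤m+n s _) (≤-reflexive (sym lenl)))
    ld : length (drop s lam) ≡ suc (trailingZeros lam')
    ld = trans (length-drop s lam) (trans (cong (_∸ s) lenl) (m+n∸m≡n s _))

  lhs-inner : ∀ i lam' → length lam' ≡ suc t → sum lam' ≡ b →
    sumBy (starPaths m i P (starλ m Q R lam')) g' ≡ sumBy (weakComps (s + suc (trailingZeros lam')) a)
      (λ lam → when (multP (lastOr0 lam) ≡ᵇ i) (g (take s lam ++ graft lam' (drop s lam))))
  lhs-inner i lam' len sm = begin
    sumBy (starPaths m i P S) g' ≡⟨ sumBy-starPaths m i P S g' ⟩
    sumBy (weakComps (suc (length (factors m S))) (L P)) (λ lam → when (inΛ m i P lam) (g' (starλ m P S lam)))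
      ≡⟨ sumBy-congᴬ (weakComps-sound (suc (length (factors m S))) (L P))
        (λ lam (l , sl) → cong (when (inΛ m i P lam))
        (cong g' (starλ-interleave m topP a P S P-split lam l (trans sl L-P)))) ⟩
    sumBy (weakComps (suc (length (factors m S))) (L P))
      (λ lam → when (inΛ m i P lam) (g' (topP ++ interleave lam (factors m S))))
      ≡⟨ cong₂ (λ u w → sumBy (weakComps (suc (length u)) w)
        (λ lam → when (inΛ m i P lam) (g' (topP ++ interleave lam u)))) fS L-P ⟩
    sumBy (weakComps (suc (length (rightFactors lam'))) a)
      (λ lam → when (inΛ m i P lam) (g' (topP ++ interleave lam (rightFactors lam'))))
      ≡⟨ cong (λ u → sumBy (weakComps (suc u) a)
        (λ lam → when (inΛ m i P lam) (g' (topP ++ interleave lam (rightFactors lam')))))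
        (length-rightFactors lam' len) ⟩
    sumBy (weakComps (s + suc (trailingZeros lam')) a)
      (λ lam → when (inΛ m i P lam) (g' (topP ++ interleave lam (rightFactors lam'))))
      ≡⟨ sumBy-congᴬ (weakComps-sound (s + suc (trailingZeros lam')) a)
        (λ lam (l , sl) → cong₂ when (inΛ-P i lam (≤-trans (lastOr0≤sum lam) (≤-reflexive sl)))
        (cong (λ z → g' (topP ++ z)) (interleave-graft lam' lam len l))) ⟩
    sumBy (weakComps (s + suc (trailingZeros lam')) a)
      (λ lam → when (multP (lastOr0 lam) ≡ᵇ i) (g (take s lam ++ graft lam' (drop s lam)))) ∎
    where
    open ≡-Reasoning
    S = starλ m Q R lam'
    Seq : S ≡ topQ ++ interleave lam' Rs
    Seq = starλ-interleave m topQ b Q R Q-split lam' len sm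
    fS : factors m S ≡ rightFactors lam'
    fS = trans (cong (factors m) Seq) (factors-right lam' len sm)

  lhs-expansion : ∀ k i → sumBy (starPaths m k Q R) (λ S → sumBy (starPaths m i P S) g') ≡
    leftSum (λ lam' → multQ (lastOr0 lam') ≡ᵇ k) (_≡ᵇ i) s t a b g
  lhs-expansion k i = begin
    sumBy (starPaths m k Q R) (λ S → sumBy (starPaths m i P S) g') ≡⟨ sumBy-starPaths m k Q R _ ⟩
    sumBy (weakComps (suc t) (L Q)) (λ lam' → when (inΛ m k Q lam') (sumBy (starPaths m i P (starλ m Q R lam')) g'))
      ≡⟨ cong (λ u → sumBy (weakComps (suc t) u)
        (λ lam' → when (inΛ m k Q lam') (sumBy (starPaths m i P (starλ m Q R lam')) g'))) L-Q ⟩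
    sumBy (weakComps (suc t) b) (λ lam' → when (inΛ m k Q lam') (sumBy (starPaths m i P (starλ m Q R lam')) g'))
      ≡⟨ sumBy-congᴬ (weakComps-sound (suc t) b)
        (λ lam' (l , sl) → cong₂ when (inΛ-Q k lam' (≤-trans (lastOr0≤sum lam') (≤-reflexive sl)))
        (lhs-inner i lam' l sl)) ⟩
    _ ∎
    where open ≡-Reasoning

  module RightInner (j : ℕ) (y : List ℕ) (v c : ℕ) (len : length ((y ++ v ∷ []) ++ c ∷ []) ≡ suc s)
                    (sm : sum ((y ++ v ∷ []) ++ c ∷ []) ≡ a) where
    x = (y ++ v ∷ []) ++ c ∷ []
    length-y : length y ≡ length Qinit
    length-y = suc-injective (suc-injective
      (trans (sym (trans (length-∷ʳ (y ++ v ∷ []) c) (cong suc (length-∷ʳ y v)))) len))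
    a-split : a ≡ (v + c) + sum y
    a-split = sym (trans (+-comm (v + c) (sum y))
      (trans (cong (λ z → sum y + (v + z)) (sym (+-identityʳ c)))
      (trans (sym (sum-++ y (v ∷ c ∷ []))) (trans (cong sum (sym (++-assoc y (v ∷ []) (c ∷ [])))) sm))))
    open ConcatColors topP a height-topP Qinit Qinit-paths Qtop b aboveAxis-Qtop height-Qtop y v c length-y
      a-split using (topT; height-topT; topMult-topT-low; topMult-topT-high)

    Tpath = starλ m P Q x
    length-x : length x ≡ suc (length (factors m Q))
    length-x = trans len (cong suc (sym (trans (cong length factors-Q) (length-∷ʳ Qinit Qlast))))
    Tpath-interleave : Tpath ≡ topP ++ interleavePrefix y Qinit ++ downs v ++ (Qtop ++ downs b) ++ downs c
    Tpath-interleave = begin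
      Tpath ≡⟨ starλ-interleave m topP a P Q P-split x length-x sm ⟩
      topP ++ interleave x (factors m Q) ≡⟨ cong₂ (λ u w → topP ++ interleave u w)
        (++-assoc y (v ∷ []) (c ∷ [])) factors-Q ⟩
      topP ++ interleave (y ++ v ∷ c ∷ []) (Qinit ++ Qlast ∷ []) ≡⟨ cong (topP ++_)
        (interleave-++ y (v ∷ c ∷ []) Qinit (Qlast ∷ []) length-y) ⟩
      topP ++ interleavePrefix y Qinit ++ downs v ++ Qlast ++ downs c ≡⟨ cong
        (λ z → topP ++ interleavePrefix y Qinit ++ downs v ++ z ++ downs c)
        (trans Qlast-split (sym (++-assoc Qbody (true ∷ []) (downs b)))) ⟩
      topP ++ interleavePrefix y Qinit ++ downs v ++ (Qtop ++ downs b) ++ downs c ∎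
      where open ≡-Reasoning
    Tpath-split : Tpath ≡ topT ++ downs (b + c)
    Tpath-split = trans Tpath-interleave
      (trans (++-reassoc topP (interleavePrefix y Qinit) (downs v) Qtop (downs b) (downs c))
      (cong (topT ++_) (sym (downs-+ b c))))
    topT-lastUp : topT ≡ (topP ++ interleavePrefix y Qinit ++ downs v ++ Qbody) ++ true ∷ []
    topT-lastUp = begin
      topP ++ interleavePrefix y Qinit ++ downs v ++ Qbody ++ true ∷ [] ≡⟨ cong
        (λ z → topP ++ interleavePrefix y Qinit ++ z) (sym (++-assoc (downs v) Qbody (true ∷ []))) ⟩
      topP ++ interleavePrefix y Qinit ++ (downs v ++ Qbody) ++ true ∷ [] ≡⟨ cong (topP ++_)
        (sym (++-assoc (interleavePrefix y Qinit) (downs v ++ Qbody) (true ∷ []))) ⟩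
      topP ++ (interleavePrefix y Qinit ++ downs v ++ Qbody) ++ true ∷ [] ≡⟨ sym (++-assoc topP _ (true ∷ [])) ⟩
      (topP ++ interleavePrefix y Qinit ++ downs v ++ Qbody) ++ true ∷ [] ∎
      where open ≡-Reasoning
    L-Tpath : L Tpath ≡ b + c
    L-Tpath = trans (cong L (trans Tpath-split (trans (cong (_++ downs (b + c)) topT-lastUp) (++-assoc body (true ∷ []) _))))
                    (L-lastUp body (b + c))
      where body = topP ++ interleavePrefix y Qinit ++ downs v ++ Qbody
    size-topT : 1 ≤ size topT
    size-topT = subst (λ z → 1 ≤ size z) (sym topT-lastUp)
      (size-lastUp (topP ++ interleavePrefix y Qinit ++ downs v ++ Qbody))

    topMult-Tpath : ∀ k → k ≤ b + c → topMult m Tpath k ≡ joined c k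
    topMult-Tpath k le with k ≤? c
    ... | yes k≤c = begin
      topMult m Tpath k                   ≡⟨ cong (λ X → topMult m X k) Tpath-split ⟩
      topMult m (topT ++ downs (b + c)) k ≡⟨ topMult-topT-low k k≤c ⟩
      topMult m (topP ++ downs a) k       ≡⟨ cong (λ X → topMult m X k) P-split ⟨
      multP k                             ≡⟨ joined-≤ c k k≤c ⟨
      joined c k                          ∎
      where open ≡-Reasoning
    ... | no k≰c = begin
      topMult m Tpath k
        ≡⟨ cong₂ (topMult m) Tpath-split (sym (m+[n∸m]≡n (<⇒≤ (≰⇒> k≰c)))) ⟩
      topMult m (topT ++ downs (b + c)) (c + (k ∸ c))
        ≡⟨ topMult-topT-high (k ∸ c) (≤-trans (∸-monoˡ-≤ c le) (≤-reflexive (m+n∸n≡m b c))) ⟩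
      topMult m (topP ++ downs a) c ⊔ topMult m (topQ ++ downs b) (k ∸ c)
        ≡⟨ cong₂ (λ X Y → topMult m X c ⊔ topMult m Y (k ∸ c)) P-split Q-split ⟨
      multP c ⊔ multQ (k ∸ c)
        ≡⟨ joined-≰ c k k≰c ⟨
      joined c k ∎
      where open ≡-Reasoning

    inΛ-Tpath : ∀ mu → lastOr0 mu ≤ b + c → inΛ m j Tpath mu ≡ (joined c (lastOr0 mu) ≡ᵇ j)
    inΛ-Tpath mu le = trans (subst (λ X → inΛ m j X mu ≡ (topMult m X (lastOr0 mu) ≡ᵇ j)) (sym Tpath-split)
      (inΛ≡topMult j topT (b + c) mu height-topT size-topT le))
                       (cong (_≡ᵇ j) (topMult-Tpath (lastOr0 mu) le))

    interleave-regroup : ∀ mu → topT ++ interleave mu Rs ≡ topP ++ interleave (take s x ++ mu) Blocks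
    interleave-regroup mu = begin
      topT ++ interleave mu Rs ≡⟨ ++-assoc topP _ _ ⟩
      topP ++ (interleavePrefix y Qinit ++ downs v ++ Qtop) ++ interleave mu Rs ≡⟨ cong
        (λ z → topP ++ z ++ interleave mu Rs) (sym (interleavePrefix-∷ʳ y v Qinit Qtop length-y)) ⟩
      topP ++ interleavePrefix (y ++ v ∷ []) (Qinit ++ Qtop ∷ []) ++ interleave mu Rs ≡⟨ cong (topP ++_)
        (sym (interleave-++ (y ++ v ∷ []) mu (Qinit ++ Qtop ∷ []) Rs
        (trans (length-∷ʳ y v) (trans (cong suc length-y) (sym (length-∷ʳ Qinit Qtop)))))) ⟩
      topP ++ interleave ((y ++ v ∷ []) ++ mu) ((Qinit ++ Qtop ∷ []) ++ Rs) ≡⟨ cong₂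
        (λ u w → topP ++ interleave (u ++ mu) w) (sym tk) (++-assoc Qinit (Qtop ∷ []) Rs) ⟩
      topP ++ interleave (take s x ++ mu) Blocks ∎
      where
      open ≡-Reasoning
      tk : take s x ≡ y ++ v ∷ []
      tk = take-exact-++ s (y ++ v ∷ []) (c ∷ []) (trans (length-∷ʳ y v) (cong suc length-y))

    rhs-inner : sumBy (starPaths m j Tpath R) g' ≡ sumBy (weakComps (suc t) (b + lastOr0 x))
      (λ mu → when (joined (lastOr0 x) (lastOr0 mu) ≡ᵇ j) (g (take s x ++ mu)))
    rhs-inner = begin
      sumBy (starPaths m j Tpath R) g' ≡⟨ sumBy-starPaths m j Tpath R g' ⟩
      sumBy (weakComps (suc t) (L Tpath)) (λ mu → when (inΛ m j Tpath mu) (g' (starλ m Tpath R mu))) ≡⟨ cong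
        (λ u → sumBy (weakComps (suc t) u) (λ mu → when (inΛ m j Tpath mu) (g' (starλ m Tpath R mu))))
        (trans L-Tpath (cong (b +_) (sym last-x))) ⟩
      sumBy (weakComps (suc t) (b + lastOr0 x)) (λ mu → when (inΛ m j Tpath mu) (g' (starλ m Tpath R mu)))
        ≡⟨ sumBy-congᴬ (weakComps-sound (suc t) (b + lastOr0 x)) (λ mu (l , sl) →
             let sl' = trans sl (cong (b +_) last-x) in
             cong₂ when (trans (inΛ-Tpath mu (≤-trans (lastOr0≤sum mu) (≤-reflexive sl')))
                               (cong (λ z → joined z (lastOr0 mu) ≡ᵇ j) (sym last-x)))
                        (cong g' (trans (starλ-interleave m topT (b + c) Tpath R Tpath-split mu l sl')
                                        (interleave-regroup mu)))) ⟩
      sumBy (weakComps (suc t) (b + lastOr0 x))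
        (λ mu → when (joined (lastOr0 x) (lastOr0 mu) ≡ᵇ j) (g (take s x ++ mu))) ∎
      where
      open ≡-Reasoning
      last-x : lastOr0 x ≡ c
      last-x = lastOr0-∷ʳ (y ++ v ∷ []) c

  rhs-inner : ∀ j x → length x ≡ suc s → sum x ≡ a →
    sumBy (starPaths m j (starλ m P Q x) R) g' ≡ sumBy (weakComps (suc t) (b + lastOr0 x))
      (λ mu → when (joined (lastOr0 x) (lastOr0 mu) ≡ᵇ j) (g (take s x ++ mu)))
  rhs-inner j x len sm with init-last x (subst (1 ≤_) (sym len) (s≤s z≤n))
  ... | x1 , c , refl with init-last x1
    (subst (1 ≤_) (sym (suc-injective (trans (sym (length-∷ʳ x1 c)) len))) (s≤s z≤n))
  ...   | y , v , refl = RightInner.rhs-inner j y v c len sm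

  rhs-expansion : ∀ k j → sumBy (starPaths m k P Q) (λ Tpath → sumBy (starPaths m j Tpath R) g') ≡
    rightSum (_≡ᵇ k) (_≡ᵇ j) s t a b g
  rhs-expansion k j = begin
    sumBy (starPaths m k P Q) (λ Tpath → sumBy (starPaths m j Tpath R) g') ≡⟨ sumBy-starPaths m k P Q _ ⟩
    sumBy (weakComps (suc (length (factors m Q))) (L P))
      (λ x → when (inΛ m k P x) (sumBy (starPaths m j (starλ m P Q x) R) g'))
      ≡⟨ cong₂ (λ u w → sumBy (weakComps (suc u) w)
        (λ x → when (inΛ m k P x) (sumBy (starPaths m j (starλ m P Q x) R) g')))
        (trans (cong length factors-Q) (length-∷ʳ Qinit Qlast)) L-P ⟩
    sumBy (weakComps (suc s) a) (λ x → when (inΛ m k P x) (sumBy (starPaths m j (starλ m P Q x) R) g'))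
      ≡⟨ sumBy-congᴬ (weakComps-sound (suc s) a)
        (λ x (l , sl) → cong₂ when (inΛ-P k x (≤-trans (lastOr0≤sum x) (≤-reflexive sl))) (rhs-inner j x l sl)) ⟩
    _ ∎
    where open ≡-Reasoning

  paths-assoc : ∀ i j → i < j →
    sumBy (starPaths m j Q R) (λ S → sumBy (starPaths m i P S) g') ≡ sumBy (starPaths m i P Q) (λ T → sumBy (starPaths m j T R) g')
  paths-assoc i j i<j = trans (lhs-expansion j i) (trans (interchange-< i j i<j s t a b g) (sym (rhs-expansion i j)))

  paths-starRange : ∀ i → i ≤ m →
    sumBy (upTo (suc i)) (λ k → sumBy (starPaths m k Q R) (λ S → sumBy (starPaths m i P S) g'))
    ≡ sumBy (upTo (suc (m ∸ i))) (λ k → sumBy (starPaths m (i + k) P Q) (λ T → sumBy (starPaths m i T R) g'))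
  paths-starRange i i≤m = begin
    sumBy (upTo (suc i)) (λ k → sumBy (starPaths m k Q R) (λ S → sumBy (starPaths m i P S) g'))
      ≡⟨ sumBy-cong (upTo (suc i)) (λ k → lhs-expansion k i) ⟩
    sumBy (upTo (suc i)) (λ k → sumBy (weakComps (suc t) b)
      (λ lam' → when (multQ (lastOr0 lam') ≡ᵇ k) (leftInner lam')))
      ≡⟨ sumBy-swap (upTo (suc i)) (weakComps (suc t) b) _ ⟩
    sumBy (weakComps (suc t) b) (λ lam' → sumBy (upTo (suc i)) (λ k → when (multQ (lastOr0 lam') ≡ᵇ k) (leftInner lam')))
      ≡⟨ sumBy-cong (weakComps (suc t) b) (λ lam' → sumBy-upTo-when-≡ i (multQ (lastOr0 lam')) (leftInner lam')) ⟩
    sumBy (weakComps (suc t) b) (λ lam' → when (multQ (lastOr0 lam') ≤ᵇ i) (leftInner lam'))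
      ≡⟨ interchange-≤ i s t a b g ⟩
    sumBy (weakComps (suc s) a) (λ x → when (i ≤ᵇ multP (lastOr0 x)) (rightInner x))
      ≡⟨ sumBy-congᴬ (weakComps-sound (suc s) a) (λ x (_ , sl) →
           sumBy-upTo-when-≡+ (m ∸ i) i _ _ (subst (multP (lastOr0 x) ≤_) (sym (m+[n∸m]≡n i≤m)) (multP≤m x sl))) ⟨
    sumBy (weakComps (suc s) a) (λ x → sumBy (upTo (suc (m ∸ i))) (λ k → when (multP (lastOr0 x) ≡ᵇ i + k) (rightInner x)))
      ≡⟨ sumBy-swap (weakComps (suc s) a) (upTo (suc (m ∸ i))) _ ⟩
    sumBy (upTo (suc (m ∸ i))) (λ k → sumBy (weakComps (suc s) a) (λ x → when (multP (lastOr0 x) ≡ᵇ i + k) (rightInner x)))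
      ≡⟨ sumBy-cong (upTo (suc (m ∸ i))) (λ k → rhs-expansion (i + k) i) ⟨
    sumBy (upTo (suc (m ∸ i))) (λ k → sumBy (starPaths m (i + k) P Q) (λ T → sumBy (starPaths m i T R) g')) ∎
    where
    open ≡-Reasoning
    leftInner = λ lam' → sumBy (weakComps (s + suc (trailingZeros lam')) a)
      (λ lam → when (multP (lastOr0 lam) ≡ᵇ i) (g (take s lam ++ graft lam' (drop s lam))))
    rightInner = λ x → sumBy (weakComps (suc t) (b + lastOr0 x))
      (λ mu → when (joined (lastOr0 x) (lastOr0 mu) ≡ᵇ i) (g (take s x ++ mu)))
    multP≤m : ∀ x → sum x ≡ a → multP (lastOr0 x) ≤ m
    multP≤m x sl = subst (λ X → topMult m X (lastOr0 x) ≤ m) (sym P-split)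
      (topMult≤m topP a height-topP (lastOr0 x) (≤-trans (lastOr0≤sum x) (≤-reflexive sl)))

-- The linear extension

module Linear {c ℓ} (K : Field c ℓ) (m : ℕ) where
  open FreeSpace K m public
  open Field K using (Carrier; _≈_; 0#; 1#; +-cong; +-congˡ; *-congˡ; *-congʳ; distribˡ; zeroʳ)
    renaming (_+_ to _+ᴷ_; _*_ to _*ᴷ_; refl to ≈-refl; sym to ≈-sym; trans to ≈-trans; reflexive to ≈-reflexive;
              +-assoc to +ᴷ-assoc; +-identityˡ to +ᴷ-identityˡ; *-assoc to *ᴷ-assoc; *-identityʳ to *ᴷ-identityʳ)
  open import Relation.Binary.Reasoning.Setoid (Field.setoid K)
  open import Algebra.Properties.CommutativeSemigroup (Field.+-commutativeSemigroup K)
    using () renaming (interchange to +ᴷ-interchange)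

  sumᴷ : ∀ {a} {A : Set a} → List A → (A → Carrier) → Carrier
  sumᴷ [] f = 0#
  sumᴷ (x ∷ xs) f = f x +ᴷ sumᴷ xs f

  ⟦_⟧ : ℕ → Carrier
  ⟦ zero ⟧ = 0#
  ⟦ suc n ⟧ = 1# +ᴷ ⟦ n ⟧

  ⟦+⟧ : ∀ a b → ⟦ a + b ⟧ ≈ ⟦ a ⟧ +ᴷ ⟦ b ⟧
  ⟦+⟧ zero b = ≈-sym (+ᴷ-identityˡ _)
  ⟦+⟧ (suc a) b = ≈-trans (+-congˡ (⟦+⟧ a b)) (≈-sym (+ᴷ-assoc _ _ _))

  module _ {a : Level} {A : Set a} where
    sumᴷ-cong : ∀ (xs : List A) {f g : A → Carrier} → (∀ x → f x ≈ g x) → sumᴷ xs f ≈ sumᴷ xs g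
    sumᴷ-cong [] e = ≈-refl
    sumᴷ-cong (x ∷ xs) e = +-cong (e x) (sumᴷ-cong xs e)

    sumᴷ-congᴬ : ∀ {P : A → Set} {xs : List A} {f g : A → Carrier} → All P xs → (∀ x → P x → f x ≈ g x) →
      sumᴷ xs f ≈ sumᴷ xs g
    sumᴷ-congᴬ [] e = ≈-refl
    sumᴷ-congᴬ (p ∷ ps) e = +-cong (e _ p) (sumᴷ-congᴬ ps e)

    sumᴷ-++ : ∀ (xs ys : List A) f → sumᴷ (xs ++ ys) f ≈ sumᴷ xs f +ᴷ sumᴷ ys f
    sumᴷ-++ [] ys f = ≈-sym (+ᴷ-identityˡ _)
    sumᴷ-++ (x ∷ xs) ys f = ≈-trans (+-congˡ (sumᴷ-++ xs ys f)) (≈-sym (+ᴷ-assoc _ _ _))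

    sumᴷ-0 : ∀ (xs : List A) → sumᴷ xs (λ _ → 0#) ≈ 0#
    sumᴷ-0 [] = ≈-refl
    sumᴷ-0 (x ∷ xs) = ≈-trans (+ᴷ-identityˡ _) (sumᴷ-0 xs)

    sumᴷ-+ : ∀ (xs : List A) f g → sumᴷ xs (λ x → f x +ᴷ g x) ≈ sumᴷ xs f +ᴷ sumᴷ xs g
    sumᴷ-+ [] f g = ≈-sym (+ᴷ-identityˡ _)
    sumᴷ-+ (x ∷ xs) f g = ≈-trans (+-congˡ (sumᴷ-+ xs f g)) (+ᴷ-interchange _ _ _ _)

  sumᴷ-swap : ∀ {a b} {A : Set a} {B : Set b} (xs : List A) (ys : List B) (f : A → B → Carrier) →
    sumᴷ xs (λ x → sumᴷ ys (f x)) ≈ sumᴷ ys (λ y → sumᴷ xs (λ x → f x y))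
  sumᴷ-swap [] ys f = ≈-sym (sumᴷ-0 ys)
  sumᴷ-swap (x ∷ xs) ys f = ≈-trans (+-congˡ (sumᴷ-swap xs ys f))
    (≈-sym (sumᴷ-+ ys (f x) (λ y → sumᴷ xs (λ x → f x y))))

  sumᴷ-concatMap : ∀ {a b} {A : Set a} {B : Set b} (g : A → List B) (xs : List A) f →
    sumᴷ (concatMap g xs) f ≈ sumᴷ xs (λ x → sumᴷ (g x) f)
  sumᴷ-concatMap g [] f = ≈-refl
  sumᴷ-concatMap g (x ∷ xs) f = ≈-trans (sumᴷ-++ (g x) _ f) (+-congˡ (sumᴷ-concatMap g xs f))

  sumᴷ-map : ∀ {a b} {A : Set a} {B : Set b} (g : A → B) (xs : List A) f → sumᴷ (map g xs) f ≡ sumᴷ xs (f ∘ g)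
  sumᴷ-map g [] f = refl
  sumᴷ-map g (x ∷ xs) f = cong (f (g x) +ᴷ_) (sumᴷ-map g xs f)

  sumᴷ-scale : ∀ {A : Set} (xs : List A) k (f : A → ℕ) → sumᴷ xs (λ u → k *ᴷ ⟦ f u ⟧) ≈ k *ᴷ ⟦ sumBy xs f ⟧
  sumᴷ-scale [] k f = ≈-sym (zeroʳ k)
  sumᴷ-scale (x ∷ xs) k f = ≈-trans (+-congˡ (sumᴷ-scale xs k f))
    (≈-trans (≈-sym (distribˡ k _ _)) (*-congˡ (≈-sym (⟦+⟧ (f x) _))))

  δ : Word → Word → ℕ
  δ P w = if does (≡-dec BoolP._≟_ P w) then 1 else 0

  multiplicity : Word → List Word → ℕ
  multiplicity w L = sumBy L (λ S → δ S w)

  coeff-++ : ∀ xs ys w → coeff (xs ++ ys) w ≈ coeff xs w +ᴷ coeff ys w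
  coeff-++ [] ys w = ≈-sym (+ᴷ-identityˡ _)
  coeff-++ ((a , P) ∷ xs) ys w with does (≡-dec BoolP._≟_ P w)
  ... | true = ≈-trans (+-congˡ (coeff-++ xs ys w)) (≈-sym (+ᴷ-assoc _ _ _))
  ... | false = coeff-++ xs ys w

  coeff-map : ∀ k Rs w → coeff (map (λ R → (k , R)) Rs) w ≈ k *ᴷ ⟦ multiplicity w Rs ⟧
  coeff-map k [] w = ≈-sym (zeroʳ k)
  coeff-map k (R ∷ Rs) w with does (≡-dec BoolP._≟_ R w)
  ... | true = ≈-trans (+-cong (≈-sym (*ᴷ-identityʳ k)) (coeff-map k Rs w)) (≈-sym (distribˡ k _ _))
  ... | false = coeff-map k Rs w

  coeff-concatMap : ∀ {a} {A : Set a} (g : A → Vec𝕂) xs w → coeff (concatMap g xs) w ≈ sumᴷ xs (λ x → coeff (g x) w)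
  coeff-concatMap g [] w = ≈-refl
  coeff-concatMap g (x ∷ xs) w = ≈-trans (coeff-++ (g x) _ w) (+-congˡ (coeff-concatMap g xs w))

  coeff-star : ∀ i X Y w →
    coeff (star i X Y) w ≈ sumᴷ X (λ aP → sumᴷ Y (λ bQ → (proj₁ aP *ᴷ proj₁ bQ) *ᴷ ⟦ multiplicity w (starPaths m i (proj₂ aP) (proj₂ bQ)) ⟧))
  coeff-star i X Y w = ≈-trans (coeff-concatMap _ X w) (sumᴷ-cong X (λ aP → ≈-trans (coeff-concatMap _ Y w)
    (sumᴷ-cong Y (λ bQ → coeff-map (proj₁ aP *ᴷ proj₁ bQ) (starPaths m i (proj₂ aP) (proj₂ bQ)) w))))

  sumᴷ-star : ∀ j Y Z h →
    sumᴷ (star j Y Z) h ≈ sumᴷ Y (λ bQ → sumᴷ Z (λ cR → sumᴷ (starPaths m j (proj₂ bQ) (proj₂ cR)) (λ S → h (proj₁ bQ *ᴷ proj₁ cR , S))))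
  sumᴷ-star j Y Z h = ≈-trans (sumᴷ-concatMap _ Y h) (sumᴷ-cong Y (λ bQ → ≈-trans (sumᴷ-concatMap _ Z h)
    (sumᴷ-cong Z (λ cR → ≈-reflexive
      (sumᴷ-map (λ R → (proj₁ bQ *ᴷ proj₁ cR , R)) (starPaths m j (proj₂ bQ) (proj₂ cR)) h)))))

  sumᴷ-pull : ∀ (ks : List ℕ) (y z : Vec𝕂) (F : ℕ → Carrier × Word → Carrier × Word → Carrier) →
    sumᴷ ks (λ k → sumᴷ y (λ bQ → sumᴷ z (F k bQ))) ≈ sumᴷ y (λ bQ → sumᴷ z (λ cR → sumᴷ ks (λ k → F k bQ cR)))
  sumᴷ-pull ks y z F = ≈-trans (sumᴷ-swap ks y _) (sumᴷ-cong y λ bQ → sumᴷ-swap ks z (λ k → F k bQ))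

  weighted : Carrier × Word → Carrier × Word → Carrier × Word → ℕ → Carrier
  weighted aP bQ cR n = (proj₁ aP *ᴷ (proj₁ bQ *ᴷ proj₁ cR)) *ᴷ ⟦ n ⟧

  tripleSum : Vec𝕂 → Vec𝕂 → Vec𝕂 → (Word → Word → Word → ℕ) → Carrier
  tripleSum x y z N = sumᴷ x λ aP → sumᴷ y λ bQ → sumᴷ z λ cR → weighted aP bQ cR (N (proj₂ aP) (proj₂ bQ) (proj₂ cR))

  coeff-star-inner : ∀ i (f : ℕ → ℕ) ks x y z w → coeff (star i x (concatMap (λ k → star (f k) y z) ks)) w ≈
    tripleSum x y z (λ P Q R → sumBy ks
      (λ k → sumBy (starPaths m (f k) Q R) (λ S → multiplicity w (starPaths m i P S))))
  coeff-star-inner i f ks x y z w = ≈-trans (coeff-star i x V w) (sumᴷ-cong x λ aP → begin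
    sumᴷ V (λ eS → (proj₁ aP *ᴷ proj₁ eS) *ᴷ ⟦ occurrences aP (proj₂ eS) ⟧)
      ≈⟨ sumᴷ-concatMap _ ks _ ⟩
    sumᴷ ks (λ k → sumᴷ (star (f k) y z) (λ eS → (proj₁ aP *ᴷ proj₁ eS) *ᴷ ⟦ occurrences aP (proj₂ eS) ⟧))
      ≈⟨ sumᴷ-cong ks (λ k → ≈-trans (sumᴷ-star (f k) y z _) (sumᴷ-cong y λ bQ → sumᴷ-cong z λ cR →
           sumᴷ-scale (starPaths m (f k) (proj₂ bQ) (proj₂ cR)) (proj₁ aP *ᴷ (proj₁ bQ *ᴷ proj₁ cR))
             (occurrences aP))) ⟩
    sumᴷ ks (λ k → sumᴷ y (λ bQ → sumᴷ z (λ cR → weighted aP bQ cR (N k aP bQ cR))))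
      ≈⟨ sumᴷ-pull ks y z _ ⟩
    sumᴷ y (λ bQ → sumᴷ z (λ cR → sumᴷ ks (λ k → weighted aP bQ cR (N k aP bQ cR))))
      ≈⟨ sumᴷ-cong y (λ bQ → sumᴷ-cong z λ cR → sumᴷ-scale ks (proj₁ aP *ᴷ (proj₁ bQ *ᴷ proj₁ cR))
        (λ k → N k aP bQ cR)) ⟩
    sumᴷ y (λ bQ → sumᴷ z (λ cR → weighted aP bQ cR (sumBy ks (λ k → N k aP bQ cR)))) ∎)
    where
    V = concatMap (λ k → star (f k) y z) ks
    occurrences : Carrier × Word → Word → ℕ
    occurrences aP S = multiplicity w (starPaths m i (proj₂ aP) S)
    N : ℕ → Carrier × Word → Carrier × Word → Carrier × Word → ℕ
    N k aP bQ cR = sumBy (starPaths m (f k) (proj₂ bQ) (proj₂ cR)) (occurrences aP)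

  coeff-star-outer : ∀ i (f : ℕ → ℕ) ks x y z w → coeff (star i (concatMap (λ k → star (f k) x y) ks) z) w ≈
    tripleSum x y z (λ P Q R → sumBy ks
      (λ k → sumBy (starPaths m (f k) P Q) (λ T → multiplicity w (starPaths m i T R))))
  coeff-star-outer i f ks x y z w = begin
    coeff (star i U z) w
      ≈⟨ coeff-star i U z w ⟩
    sumᴷ U (λ eT → sumᴷ z (λ cR → (proj₁ eT *ᴷ proj₁ cR) *ᴷ ⟦ occurrences (proj₂ eT) cR ⟧))
      ≈⟨ sumᴷ-concatMap _ ks _ ⟩
    sumᴷ ks (λ k → sumᴷ (star (f k) x y)
      (λ eT → sumᴷ z (λ cR → (proj₁ eT *ᴷ proj₁ cR) *ᴷ ⟦ occurrences (proj₂ eT) cR ⟧)))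
      ≈⟨ sumᴷ-cong ks (λ k → ≈-trans (sumᴷ-star (f k) x y _) (sumᴷ-cong x λ aP → sumᴷ-cong y λ bQ →
           ≈-trans (sumᴷ-swap (starPaths m (f k) (proj₂ aP) (proj₂ bQ)) z _)
                   (sumᴷ-cong z λ cR → ≈-trans (sumᴷ-scale (starPaths m (f k) (proj₂ aP) (proj₂ bQ))
                                                           ((proj₁ aP *ᴷ proj₁ bQ) *ᴷ proj₁ cR)
                                                             (λ T → occurrences T cR))
                                                (*-congʳ (*ᴷ-assoc _ _ _))))) ⟩
    sumᴷ ks (λ k → sumᴷ x (λ aP → sumᴷ y (λ bQ → sumᴷ z (λ cR → weighted aP bQ cR (N k aP bQ cR)))))
      ≈⟨ sumᴷ-swap ks x _ ⟩
    sumᴷ x (λ aP → sumᴷ ks (λ k → sumᴷ y (λ bQ → sumᴷ z (λ cR → weighted aP bQ cR (N k aP bQ cR)))))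
      ≈⟨ sumᴷ-cong x (λ aP → ≈-trans (sumᴷ-pull ks y z _) (sumᴷ-cong y λ bQ → sumᴷ-cong z λ cR →
           sumᴷ-scale ks (proj₁ aP *ᴷ (proj₁ bQ *ᴷ proj₁ cR)) (λ k → N k aP bQ cR))) ⟩
    sumᴷ x (λ aP → sumᴷ y (λ bQ → sumᴷ z (λ cR → weighted aP bQ cR (sumBy ks (λ k → N k aP bQ cR))))) ∎
    where
    U = concatMap (λ k → star (f k) x y) ks
    occurrences : Word → Carrier × Word → ℕ
    occurrences T cR = multiplicity w (starPaths m i T (proj₂ cR))
    N : ℕ → Carrier × Word → Carrier × Word → Carrier × Word → ℕ
    N k aP bQ cR = sumBy (starPaths m (f k) (proj₂ aP) (proj₂ bQ)) (λ T → occurrences T cR)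

  tripleSum-cong : ∀ x y z N N' → InDyck x → InDyck y → InDyck z →
    (∀ P Q R → IsDyck m P → IsDyck m Q → IsDyck m R → N P Q R ≡ N' P Q R) → tripleSum x y z N ≈ tripleSum x y z N'
  tripleSum-cong x y z N N' dx dy dz e = sumᴷ-congᴬ dx (λ aP dP → sumᴷ-congᴬ dy (λ bQ dQ → sumᴷ-congᴬ dz (λ cR dR →
    *-congˡ (≈-reflexive (cong ⟦_⟧ (e _ _ _ dP dQ dR))))))

  foldr-⊕≡concatMap : ∀ (g : ℕ → Vec𝕂) ks → foldr (λ k acc → g k ⊕ acc) [] ks ≡ concatMap g ks
  foldr-⊕≡concatMap g [] = refl
  foldr-⊕≡concatMap g (k ∷ ks) = cong (g k ++_) (foldr-⊕≡concatMap g ks)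

  star-nested-≋ : ∀ i i' (f f' : ℕ → ℕ) ks ks' →
    (∀ P Q R → IsDyck m P → IsDyck m Q → IsDyck m R → ∀ w →
       sumBy ks (λ k → sumBy (starPaths m (f k) Q R) (λ S → multiplicity w (starPaths m i P S)))
       ≡ sumBy ks' (λ k → sumBy (starPaths m (f' k) P Q) (λ T → multiplicity w (starPaths m i' T R)))) →
    ∀ x y z → InDyck x → InDyck y → InDyck z →
    star i x (concatMap (λ k → star (f k) y z) ks) ≋ star i' (concatMap (λ k → star (f' k) x y) ks') z
  star-nested-≋ i i' f f' ks ks' paths x y z dx dy dz w =
    ≈-trans (coeff-star-inner i f ks x y z w)
      (≈-trans (tripleSum-cong x y z _ _ dx dy dz (λ P Q R dP dQ dR → paths P Q R dP dQ dR w))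
               (≈-sym (coeff-star-outer i' f' ks' x y z w)))

module _ {c ℓ} (K : Field c ℓ) (m' : ℕ) where
  open Linear K (suc m')

  star-assoc : ∀ i j → i < j → ∀ x y z → InDyck x → InDyck y → InDyck z →
    star i x (star j y z) ≋ star j (star i x y) z
  star-assoc i j i<j x y z dx dy dz =
    subst₂ (λ u v → star i x u ≋ star j v z) (++-identityʳ (star j y z)) (++-identityʳ (star i x y))
      (star-nested-≋ i j id id (j ∷ []) (i ∷ []) single x y z dx dy dz)
    where
    single : ∀ P Q R → IsDyck (suc m') P → IsDyck (suc m') Q → IsDyck (suc m') R → ∀ w →
      sumBy (starPaths (suc m') j Q R) (λ S → multiplicity w (starPaths (suc m') i P S)) + 0
      ≡ sumBy (starPaths (suc m') i P Q) (λ T → multiplicity w (starPaths (suc m') j T R)) + 0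
    single P Q R dP dQ dR w = cong (_+ 0) (Expansion.paths-assoc m' P Q R dP dQ dR (λ S → δ S w) i j i<j)

  star-starRange : ∀ i → i ≤ suc m' → ∀ x y z → InDyck x → InDyck y → InDyck z →
    star i x (starRange 0 i y z) ≋ star i (starRange i (suc m') x y) z
  star-starRange i i≤m x y z dx dy dz =
    subst₂ (λ u v → star i x u ≋ star i v z)
      (sym (foldr-⊕≡concatMap (λ k → star k y z) (upTo (suc i))))
      (sym (foldr-⊕≡concatMap (λ k → star (i + k) x y) (upTo (suc (suc m' ∸ i)))))
      (star-nested-≋ i i id (i +_) (upTo (suc i)) (upTo (suc (suc m' ∸ i)))
        (λ P Q R dP dQ dR w → Expansion.paths-starRange m' P Q R dP dQ dR (λ S → δ S w) i i≤m) x y z dx dy dz)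

theorem3p9 : ∀ {c ℓ} (K : Field c ℓ) (m : ℕ) → 1 ≤ m →
    let open FreeSpace K m in
    (∀ (i j : ℕ) → i < j → j ≤ m → ∀ x y z → InDyck x → InDyck y → InDyck z →
       star i x (star j y z) ≋ star j (star i x y) z)
    × (∀ (i : ℕ) → i ≤ m → ∀ x y z → InDyck x → InDyck y → InDyck z →
       star i x (starRange 0 i y z) ≋ star i (starRange i m x y) z)
theorem3p9 K (suc m') (s≤s z≤n) = (λ i j i<j _ → star-assoc K m' i j i<j) , star-starRange K m'
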